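{- Let $G$ be an atomic bispanning graph with vertex-connectivity $2$, and suppose $G$ is the $2$-clique sum $G=G_1\oplus_2 G_2$ of two simple bispanning graphs $G_1=(V_1,E_1)$ and $G_2=(V_2,E_2)$ at edges $d_1\in E_1$, $d_2\in E_2$ (ends identified by a bijection, and $d_1,d_2$ deleted). Define the directed graph $\eta_{d_1,d_2}=(V_\eta,E_\eta)$ by $$V_\eta=\{((S_1,T_1),(S_2,T_2))\in V_{\tau(G_1)}\times V_{\tau(G_2)} : \text{not }[(d_1\in S_1\text{ and }d_2\in S_2)\text{ or }(d_1\in T_1\text{ and }d_2\in T_2)]\},$$ and $E_\eta$ the set of quadruples $(e,f,(S_1,T_1),(S_2,T_2))$ with $((S_1,T_1),(S_2,T_2))\in V_\eta$ satisfying one of: (a) $(e,f,S_1,T_1)$ is an arc of $\vec{\tau}_3(G_1)$ and $d_1\notin\{e,f\}$; (b) $(e,f,S_2,T_2)$ is an arc of $\vec{\tau}_3(G_2)$ and $d_2\notin\{e,f\}$; (c) $(e,d_1,S_1,T_1)$ is an arc of $\vec{\tau}_3(G_1)$ and $(d_2,f,S_2,T_2)$ is an arc of $\vec{\tau}_3(G_2)$; (d) $(e,d_2,S_2,T_2)$ is an arc of $\vec{\tau}_3(G_2)$ and $(d_1,f,S_1,T_1)$ is an arc of $\vec{\tau}_3(G_1)$. Each such arc goes from $((S_1,T_1),(S_2,T_2))$ to, respectively: in case (a) $((S_1-e+f,T_1+e-f),(S_2,T_2))$ if $(e,f)\in S_1\times T_1$ and $((S_1+e-f,T_1-e+f),(S_2,T_2))$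 if $(e,f)\in T_1\times S_1$; in case (b) $((S_1,T_1),(S_2-e+f,T_2+e-f))$ if $(e,f)\in S_2\times T_2$ and $((S_1,T_1),(S_2+e-f,T_2-e+f))$ if $(e,f)\in T_2\times S_2$; in case (c) $((S_1-e,T_1+e),(S_2+f,T_2-f))$ if $(e,f)\in S_1\times T_2$ and $((S_1+e,T_1-e),(S_2-f,T_2+f))$ if $(e,f)\in T_1\times S_2$; in case (d) $((S_1+f,T_1-f),(S_2-e,T_2+e))$ if $(e,f)\in S_2\times T_1$ and $((S_1-f,T_1+f),(S_2+e,T_2-e))$ if $(e,f)\in T_2\times S_1$. Then $\vec{\tau}_3(G)\cong\eta_{d_1,d_2}$.
   Context: Graphs are finite, undirected, may have parallel edges, no loops. A graph $H$ is bispanning if its edge set is the disjoint union of two spanning trees. A bispanning graph is atomic if it contains no subgraph that is bispanning other than itself and the single-vertex graph $K_1$. Vertex-connectivity is the standard notion. The $2$-clique sum of $G_1$ and $G_2$ at edges $d_1$ (ends $x_1,y_1$) and $d_2$ (ends $x_2,y_2$): take the disjoint union, identify $x_1$ with $x_2$ and $y_1$ with $y_2$ (via a bijection of the ends), then delete $d_1$ and $d_2$; thus $E(G)=(E_1\setminus\{d_1\})\cup(E_2\setminus\{d_2\})$. For a spanning tree $T$ and $e\notin T$, $C_H(T,e)$ is the unique cycle in $T+e$; for a spanning tree $S$ and $e\in S$, $D_H(S,e)$ is the set of edges joining the two components of $S-e$. $V_{\tau(H)}$ is the set of ordered pairs $(S,T)$ of disjoint spanning trees of $H$ with $S\cup T=E(H)$.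 The directed unique exchange graph $\vec{\tau}_3(H)$ has vertex set $V_{\tau(H)}$, an arc $(e,f,S,T)$ from $(S,T)$ to $(S-e+f,T+e-f)$ whenever $(e,f)\in S\times T$ and $D_H(S,e)\cap C_H(T,e)=\{e,f\}$, and an arc $(e,f,S,T)$ from $(S,T)$ to $(S+e-f,T-e+f)$ whenever $(e,f)\in T\times S$ and $D_H(T,e)\cap C_H(S,e)=\{e,f\}$. Isomorphism of directed graphs means bijections on vertices and arcs preserving tails and heads. -}

module Defs where

open import Data.Nat using (ℕ; zero; suc; _<_; _%_)
open import Data.Nat.DivMod using (m%n<n)
open import Data.Fin using (Fin; toℕ; fromℕ<)
open import Data.Fin.Subset using (Subset; _∈_; _∉_; ⊤; ∣_∣; inside; outside)
open import Data.Fin.Subset.Properties using (_∈?_)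
open import Data.Vec using (_[_]≔_)
open import Data.Product using (Σ; ∃; _×_; _,_; proj₁; proj₂)
open import Data.Sum using (_⊎_)
open import Data.Empty using (⊥)
open import Relation.Nullary using (¬_; yes; no)
open import Relation.Binary.PropositionalEquality using (_≡_; _≢_)
open import Function using (Injective; _⇔_; _⤖_; Bijection)
open import Data.Sum using (inj₁; inj₂)

-- Finite undirected multigraphs without loops.
-- Vertices are Fin V, edges are Fin E; edge e has ends src e and tgt e
-- (the orientation is an arbitrary labelling, never used as a direction).

record Graph : Set where
  field
    V      : ℕ
    E      : ℕ
    src    : Fin E → Fin V
    tgt    : Fin E → Fin V
    noLoop : ∀ e → src e ≢ tgt e
open Graph public

module _ (H : Graph) where

  Joins : Fin (E H) → Fin (V H) → Fin (V H) → Set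
  Joins e a b = (src H e ≡ a × tgt H e ≡ b) ⊎ (src H e ≡ b × tgt H e ≡ a)

  Simple : Set
  Simple = ∀ e e′ → Joins e (src H e′) (tgt H e′) → e ≡ e′

  data Reach (P : Fin (E H) → Set) (u : Fin (V H)) : Fin (V H) → Set where
    here : Reach P u u
    step : ∀ {v w} e → P e → Joins e v w → Reach P u v → Reach P u w

  next : ∀ {k} → Fin (suc k) → Fin (suc k)
  next {k} i = fromℕ< (m%n<n (suc (toℕ i)) (suc k))

  -- a cycle all of whose edges satisfy P: distinct vertices v_0..v_{l-1},
  -- distinct edges e_0..e_{l-1}, l ≥ 2, e_i joining v_i and v_{i+1 mod l}
  -- (l = 2 allowed: two parallel edges form a cycle)
  record Cycle (P : Fin (E H) → Set) : Set where
    field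
      len    : ℕ
      vs     : Fin (suc (suc len)) → Fin (V H)
      es     : Fin (suc (suc len)) → Fin (E H)
      vsInj  : Injective _≡_ _≡_ vs
      esInj  : Injective _≡_ _≡_ es
      joins  : ∀ i → Joins (es i) (vs i) (vs (next i))
      inP    : ∀ i → P (es i)

  Acyclic : Subset (E H) → Set
  Acyclic T = ¬ Cycle (_∈ T)

  SpanTreeOn : Subset (V H) → Subset (E H) → Set
  SpanTreeOn W T = (∀ u v → u ∈ W → v ∈ W → Reach (_∈ T) u v) × Acyclic T

  SpanningTree : Subset (E H) → Set
  SpanningTree T = SpanTreeOn ⊤ T

  IsSubgraph : Subset (V H) → Subset (E H) → Set
  IsSubgraph W F = ∀ e → e ∈ F → src H e ∈ W × tgt H e ∈ W

  BispanningOn : Subset (V H) → Subset (E H) → Set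
  BispanningOn W F = Σ (Subset (E H)) λ S → Σ (Subset (E H)) λ T →
      (∀ e → e ∈ S → e ∈ F) × (∀ e → e ∈ T → e ∈ F)
    × (∀ e → e ∈ S → e ∈ T → ⊥) × (∀ e → e ∈ F → e ∈ S ⊎ e ∈ T)
    × SpanTreeOn W S × SpanTreeOn W T

  Bispanning : Set
  Bispanning = BispanningOn ⊤ ⊤

  Atomic : Set
  Atomic = Bispanning × (∀ W F → (∃ λ v → v ∈ W) → IsSubgraph W F → BispanningOn W F
                           → (W ≡ ⊤ × F ≡ ⊤) ⊎ ∣ W ∣ ≡ 1)

  ConnectedAvoiding : Subset (V H) → Set
  ConnectedAvoiding X = ∀ u v → u ∉ X → v ∉ X →
    Reach (λ e → src H e ∉ X × tgt H e ∉ X) u v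

  KConnected : ℕ → Set
  KConnected k = k < V H × (∀ X → ∣ X ∣ < k → ConnectedAvoiding X)

  VertexConnectivity : ℕ → Set
  VertexConnectivity k = KConnected k × ¬ KConnected (suc k)

  -- fundamental cycle / cut membership
  -- g ∈ C_H(T,e) : g lies on a (the unique) cycle of T + e
  InC : Subset (E H) → Fin (E H) → Fin (E H) → Set
  InC T e g = Σ (Cycle (λ h → h ∈ T ⊎ h ≡ e)) λ c → ∃ λ i → Cycle.es c i ≡ g
  -- g ∈ D_H(S,e) : g joins the two components of S - e
  InD : Subset (E H) → Fin (E H) → Fin (E H) → Set
  InD S e g = ¬ Reach (λ h → h ∈ S × h ≢ e) (src H g) (tgt H g)

  UniqueEx : Subset (E H) → Subset (E H) → Fin (E H) → Fin (E H) → Set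
  UniqueEx S T e f = ∀ g → (InD S e g × InC T e g) ⇔ (g ≡ e ⊎ g ≡ f)

  ArcCond : Subset (E H) → Subset (E H) → Fin (E H) → Fin (E H) → Set
  ArcCond S T e f = (e ∈ S × f ∈ T × UniqueEx S T e f)
                  ⊎ (e ∈ T × f ∈ S × UniqueEx T S e f)

  -- vertices of τ(H): ordered pairs of disjoint spanning trees covering E(H)
  -- (the proof is irrelevant, so vertices are equal iff their pairs are)
  record TVert : Set where
    constructor tvert
    field
      S T : Subset (E H)
      .isPair : SpanningTree S × SpanningTree T
              × (∀ e → e ∈ S → e ∈ T → ⊥) × (∀ e → e ∈ S ⊎ e ∈ T)

exch : ∀ {m} → Fin m → Fin m → Subset m × Subset m → Subset m × Subset m
exch e f (S , T) with e ∈? S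
... | yes _ = ((S [ e ]≔ outside) [ f ]≔ inside , (T [ e ]≔ inside) [ f ]≔ outside)
... | no  _ = ((S [ e ]≔ inside) [ f ]≔ outside , (T [ e ]≔ outside) [ f ]≔ inside)

pair : ∀ {H} → TVert H → Subset (E H) × Subset (E H)
pair v = TVert.S v , TVert.T v

record DiGraph : Set₁ where
  field
    Vert Arc  : Set
    tail head : Arc → Vert

record _≅_ (A B : DiGraph) : Set where
  field
    vmap : DiGraph.Vert A ⤖ DiGraph.Vert B
    amap : DiGraph.Arc A ⤖ DiGraph.Arc B
    tailPres : ∀ a → DiGraph.tail B (Bijection.to amap a) ≡ Bijection.to vmap (DiGraph.tail A a)
    headPres : ∀ a → DiGraph.head B (Bijection.to amap a) ≡ Bijection.to vmap (DiGraph.head A a)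

record TArc (H : Graph) : Set where
  field
    e f     : Fin (E H)
    from to : TVert H
    .cond   : ArcCond H (TVert.S from) (TVert.T from) e f
    .isHead : pair to ≡ exch e f (pair from)

tau3 : Graph → DiGraph
tau3 H = record { Vert = TVert H ; Arc = TArc H ; tail = TArc.from ; head = TArc.to }

record IsTwoCliqueSum (G G₁ G₂ : Graph) (d₁ : Fin (E G₁)) (d₂ : Fin (E G₂)) : Set where
  field
    φ₁ : Fin (V G₁) → Fin (V G)
    φ₂ : Fin (V G₂) → Fin (V G)
    φ₁-inj : Injective _≡_ _≡_ φ₁
    φ₂-inj : Injective _≡_ _≡_ φ₂
    cover  : ∀ v → (∃ λ a → φ₁ a ≡ v) ⊎ (∃ λ b → φ₂ b ≡ v)
    glue   : (φ₁ (src G₁ d₁) ≡ φ₂ (src G₂ d₂) × φ₁ (tgt G₁ d₁) ≡ φ₂ (tgt G₂ d₂))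
           ⊎ (φ₁ (src G₁ d₁) ≡ φ₂ (tgt G₂ d₂) × φ₁ (tgt G₁ d₁) ≡ φ₂ (src G₂ d₂))
    onlyGlue : ∀ a b → φ₁ a ≡ φ₂ b → a ≡ src G₁ d₁ ⊎ a ≡ tgt G₁ d₁
    -- edges: E(G) ≅ (E₁ - d₁) ⊎ (E₂ - d₂), preserving ends
    χ      : Fin (E G) → Fin (E G₁) ⊎ Fin (E G₂)
    χ-inj  : Injective _≡_ _≡_ χ
    χ-surj₁ : ∀ e₁ → e₁ ≢ d₁ → ∃ λ e → χ e ≡ Data.Sum.inj₁ e₁
    χ-surj₂ : ∀ e₂ → e₂ ≢ d₂ → ∃ λ e → χ e ≡ Data.Sum.inj₂ e₂
    χ-avoid₁ : ∀ e → χ e ≢ Data.Sum.inj₁ d₁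
    χ-avoid₂ : ∀ e → χ e ≢ Data.Sum.inj₂ d₂
    ends₁  : ∀ e e₁ → χ e ≡ Data.Sum.inj₁ e₁ → Joins G e (φ₁ (src G₁ e₁)) (φ₁ (tgt G₁ e₁))
    ends₂  : ∀ e e₂ → χ e ≡ Data.Sum.inj₂ e₂ → Joins G e (φ₂ (src G₂ e₂)) (φ₂ (tgt G₂ e₂))

module _ (G₁ G₂ : Graph) (d₁ : Fin (E G₁)) (d₂ : Fin (E G₂)) where

  record EVert : Set where
    constructor evert
    field
      v₁ : TVert G₁
      v₂ : TVert G₂
      .ok : ¬ ((d₁ ∈ TVert.S v₁ × d₂ ∈ TVert.S v₂) ⊎ (d₁ ∈ TVert.T v₁ × d₂ ∈ TVert.T v₂))

  private
    AC₁ : TVert G₁ → Fin (E G₁) → Fin (E G₁) → Set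
    AC₁ v = ArcCond G₁ (TVert.S v) (TVert.T v)
    AC₂ : TVert G₂ → Fin (E G₂) → Fin (E G₂) → Set
    AC₂ v = ArcCond G₂ (TVert.S v) (TVert.T v)

  EtaArcCond : (e f : Fin (E G₁) ⊎ Fin (E G₂)) → EVert → EVert → Set
  EtaArcCond (Data.Sum.inj₁ e) (Data.Sum.inj₁ f) x y =
    AC₁ (EVert.v₁ x) e f × e ≢ d₁ × f ≢ d₁
    × pair (EVert.v₁ y) ≡ exch e f (pair (EVert.v₁ x))
    × pair (EVert.v₂ y) ≡ pair (EVert.v₂ x)
  EtaArcCond (Data.Sum.inj₂ e) (Data.Sum.inj₂ f) x y =
    AC₂ (EVert.v₂ x) e f × e ≢ d₂ × f ≢ d₂
    × pair (EVert.v₁ y) ≡ pair (EVert.v₁ x)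
    × pair (EVert.v₂ y) ≡ exch e f (pair (EVert.v₂ x))
  EtaArcCond (Data.Sum.inj₁ e) (Data.Sum.inj₂ f) x y =
    AC₁ (EVert.v₁ x) e d₁ × AC₂ (EVert.v₂ x) d₂ f
    × pair (EVert.v₁ y) ≡ exch e d₁ (pair (EVert.v₁ x))
    × pair (EVert.v₂ y) ≡ exch d₂ f (pair (EVert.v₂ x))
  EtaArcCond (Data.Sum.inj₂ e) (Data.Sum.inj₁ f) x y =
    AC₂ (EVert.v₂ x) e d₂ × AC₁ (EVert.v₁ x) d₁ f
    × pair (EVert.v₁ y) ≡ exch d₁ f (pair (EVert.v₁ x))
    × pair (EVert.v₂ y) ≡ exch e d₂ (pair (EVert.v₂ x))

  record EArc : Set where
    field
      e f     : Fin (E G₁) ⊎ Fin (E G₂)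
      from to : EVert
      .cond   : EtaArcCond e f from to

  eta : DiGraph
  eta = record { Vert = EVert ; Arc = EArc ; tail = EArc.from ; head = EArc.to }

-- Write G = G₁ ⊕₂ G₂ with virtual edges d₁, d₂. An edge set X of G restricts to side 1
-- as its side-1 edges, together with d₁ when the side-2 edges of X join the ends of d₂;
-- symmetrically to side 2. The restrictions of a spanning tree of G are spanning trees of
-- G₁ and G₂, exactly one of which contains its virtual edge, and two such trees glue back
-- to a spanning tree of G. For a complementary pair (S , T) of G, the virtual edge d₁
-- cannot go to both S₁ and T₁: these would be spanning trees of G₁ covering E₁ and sharing
-- one edge, although all spanning trees have the same size (basis exchange) and G₁ is
-- bispanning. So (S , T) ↦ ((S₁ , T₁) , (S₂ , T₂)) is a bijection onto the vertices of η.
--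
-- Cuts and cycles transfer along the restriction. For e and g on side 1, g lies in
-- D(S,e) ∩ C(T,e) iff its image does in G₁. For e on side 1 and g on side 2, the
-- fundamental cycle of e runs through the glued pair of vertices and splits there into a
-- cycle through d₁ in G₁ and one through d₂ in G₂. Hence a unique exchange (e , f) of G is
-- an exchange (a)/(b) of one side when e and f lie on the same side, and a pair of
-- exchanges through the virtual edges, (c)/(d), otherwise; the heads correspond as well.

module Submission where

open import Defs
open import Data.Bool using (Bool; true; false; _∧_; _∨_)
import Data.Bool.Properties as BP
open import Data.Empty using (⊥; ⊥-elim; ⊥-elim-irr)
open import Data.Fin using (Fin; zero; suc; toℕ; fromℕ<; inject₁; fromℕ)
import Data.Fin.Properties as FP
open import Data.Fin.Properties using (_≟_; toℕ-injective; toℕ-fromℕ<; toℕ-inject₁; toℕ-fromℕ; toℕ<n)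
open import Data.Fin.Subset using (Subset; _∈_; _∉_; inside; outside)
open import Data.Fin.Subset.Properties using (_∈?_; ∈⊤; ⊆-antisym)
open import Data.List using (List; []; _∷_; allFin)
open import Data.List.Membership.Propositional as LM using ()
open import Data.List.Membership.Propositional.Properties using (∈-allFin)
open import Data.List.Relation.Unary.Any using (here; there)
open import Data.Nat using (ℕ; zero; suc; _<_; _≤_; _%_; s≤s; _+_; _∸_)
import Data.Nat.Properties as NP
open import Data.Nat.DivMod using (m<n⇒m%n≡m; n%n≡0)
open import Data.Product using (Σ; ∃; _×_; _,_; proj₁; proj₂)
open import Data.Sum using (_⊎_; inj₁; inj₂)
import Data.Sum as Sum
open import Data.Sum.Properties using (inj₁-injective; inj₂-injective)
import Data.Product as Prod
open import Data.Unit using (tt; ⊤)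
open import Data.Vec using (tabulate; _[_]≔_)
open import Data.Vec.Properties using ([]=⇒lookup; lookup⇒[]=; lookup∘update; lookup∘update′; lookup∘tabulate; ≡-dec)
open import Function using (_∘_; _∋_; mk⇔; Equivalence; mk↔ₛ′)
open import Function.Properties.Inverse using (↔⇒⤖)
open import Relation.Binary.PropositionalEquality using (_≡_; _≢_; refl; sym; trans; cong; cong₂; subst; subst₂)
open import Relation.Nullary using (¬_; Dec; yes; no; does)
open import Relation.Nullary.Decidable using (_⊎-dec_; _×-dec_; map′; ¬?; recompute; dec-true)
open import Relation.Unary using (Decidable)

sucIf : Bool → ℕ → ℕ
sucIf true k = suc k
sucIf false k = k

sucIf-∨∧ : ∀ a b x y u v → x + y ≡ u + v → sucIf a x + sucIf b y ≡ sucIf (a ∨ b) u + sucIf (a ∧ b) v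
sucIf-∨∧ true true x y u v eq = cong suc (trans (NP.+-suc x y) (trans (cong suc eq) (sym (NP.+-suc u v))))
sucIf-∨∧ true false x y u v eq = cong suc eq
sucIf-∨∧ false true x y u v eq = trans (NP.+-suc x y) (cong suc eq)
sucIf-∨∧ false false x y u v eq = eq

count : ∀ {n} {P : Fin n → Set} → Decidable P → ℕ
count {zero} P? = 0
count {suc n} P? = sucIf (does (P? zero)) (count (P? ∘ suc))

count-cong : ∀ {n} {P Q : Fin n → Set} (P? : Decidable P) (Q? : Decidable Q)
  → (∀ i → P i → Q i) → (∀ i → Q i → P i) → count P? ≡ count Q?
count-cong {zero} P? Q? f g = refl
count-cong {suc n} P? Q? f g with P? zero | Q? zero
... | yes p | yes q = cong suc (count-cong (P? ∘ suc) (Q? ∘ suc) (f ∘ suc) (g ∘ suc))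
... | yes p | no q = ⊥-elim (q (f zero p))
... | no p | yes q = ⊥-elim (p (g zero q))
... | no p | no q = count-cong (P? ∘ suc) (Q? ∘ suc) (f ∘ suc) (g ∘ suc)

count-⊎+× : ∀ {n} {P Q : Fin n → Set} (P? : Decidable P) (Q? : Decidable Q)
  → count P? + count Q? ≡ count (λ i → P? i ⊎-dec Q? i) + count (λ i → P? i ×-dec Q? i)
count-⊎+× {zero} P? Q? = refl
count-⊎+× {suc n} P? Q? = sucIf-∨∧ (does (P? zero)) (does (Q? zero)) _ _ _ _ (count-⊎+× (P? ∘ suc) (Q? ∘ suc))

count-all : ∀ {n} {P : Fin n → Set} (P? : Decidable P) → (∀ i → P i) → count P? ≡ n
count-all {zero} P? f = refl
count-all {suc n} P? f with P? zero
... | yes _ = cong suc (count-all (P? ∘ suc) (f ∘ suc))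
... | no np = ⊥-elim (np (f zero))

count-none : ∀ {n} {P : Fin n → Set} (P? : Decidable P) → (∀ i → ¬ P i) → count P? ≡ 0
count-none {zero} P? f = refl
count-none {suc n} P? f with P? zero
... | yes p = ⊥-elim (f zero p)
... | no np = count-none (P? ∘ suc) (f ∘ suc)

count-suc⇒∃ : ∀ {n} {P : Fin n → Set} (P? : Decidable P) {k} → count P? ≡ suc k → ∃ P
count-suc⇒∃ {zero} P? ()
count-suc⇒∃ {suc n} P? eq with P? zero
... | yes p = zero , p
... | no np with count-suc⇒∃ (P? ∘ suc) eq
...   | i , pi = suc i , pi

count-unique : ∀ {n} {P : Fin n → Set} (P? : Decidable P) (j : Fin n) → (∀ i → P i → i ≡ j) → P j → count P? ≡ 1
count-unique {suc n} P? zero f pj with P? zero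
... | yes _ = cong suc (count-none (P? ∘ suc) (λ i p → z (f (suc i) p)))
  where z : ∀ {i : Fin n} → Fin.suc i ≢ zero
        z ()
... | no np = ⊥-elim (np pj)
count-unique {suc n} P? (suc j) f pj with P? zero
... | yes p = ⊥-elim (z (f zero p))
  where z : Fin.zero ≢ suc j
        z ()
... | no np = count-unique (P? ∘ suc) j (λ i p → sufi (f (suc i) p)) pj
  where sufi : ∀ {i} → Fin.suc i ≡ suc j → i ≡ j
        sufi refl = refl

count-remove : ∀ {n} {P : Fin n → Set} (P? : Decidable P) (j : Fin n) → P j
  → count P? ≡ suc (count (λ i → P? i ×-dec ¬? (i ≟ j)))
count-remove {n} {P} P? j pj = trans (sym e1) (trans (sym (count-⊎+× A? B?)) (trans (cong (count A? +_) (count-unique B? j (λ i e → e) refl)) (NP.+-comm _ 1)))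
  where
  A? : Decidable (λ i → P i × ¬ (i ≡ j))
  A? i = P? i ×-dec ¬? (i ≟ j)
  B? : Decidable (λ i → i ≡ j)
  B? i = i ≟ j
  case : ∀ {i} → Dec (i ≡ j) → P i → (P i × ¬ (i ≡ j)) ⊎ i ≡ j
  case (yes e) p = inj₂ e
  case (no ne) p = inj₁ (p , ne)
  e1 : count (λ i → A? i ⊎-dec B? i) + count (λ i → A? i ×-dec B? i) ≡ count P?
  e1 = trans (cong₂ _+_ (count-cong _ P? (λ { i (inj₁ (p , _)) → p ; i (inj₂ refl) → pj }) (λ i p → case (i ≟ j) p))
                        (count-none (λ i → A? i ×-dec B? i) (λ { i ((_ , ne) , e) → ne e })))
             (NP.+-identityʳ _)

module _ {n : ℕ} where

  ∈-insert⁻ : ∀ {p : Subset n} {i j} → j ∈ (p [ i ]≔ inside) → j ≡ i ⊎ j ∈ p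
  ∈-insert⁻ {p} {i} {j} m with j ≟ i
  ... | yes e = inj₁ e
  ... | no ne = inj₂ (lookup⇒[]= j p (trans (sym (lookup∘update′ ne p inside)) ([]=⇒lookup m)))

  ∈-insert⁺ : ∀ {p : Subset n} {i j} → j ≡ i ⊎ j ∈ p → j ∈ (p [ i ]≔ inside)
  ∈-insert⁺ {p} {i} (inj₁ refl) = lookup⇒[]= i _ (lookup∘update i p inside)
  ∈-insert⁺ {p} {i} {j} (inj₂ m) with j ≟ i
  ... | yes refl = lookup⇒[]= i _ (lookup∘update i p inside)
  ... | no ne = lookup⇒[]= j _ (trans (lookup∘update′ ne p inside) ([]=⇒lookup m))

  ∈-delete⁻ : ∀ {p : Subset n} {i j} → j ∈ (p [ i ]≔ outside) → j ≢ i × j ∈ p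
  ∈-delete⁻ {p} {i} {j} m with j ≟ i
  ... | yes refl with trans (sym (lookup∘update i p outside)) ([]=⇒lookup m)
  ...   | ()
  ∈-delete⁻ {p} {i} {j} m | no ne = ne , lookup⇒[]= j p (trans (sym (lookup∘update′ ne p outside)) ([]=⇒lookup m))

  ∈-delete⁺ : ∀ {p : Subset n} {i j} → j ≢ i × j ∈ p → j ∈ (p [ i ]≔ outside)
  ∈-delete⁺ {p} {i} {j} (ne , m) = lookup⇒[]= j _ (trans (lookup∘update′ ne p outside) ([]=⇒lookup m))

  ∈-update⁻ : ∀ {p : Subset n} {i k b} → k ∈ (p [ i ]≔ b) → (k ≡ i × b ≡ true) ⊎ (k ≢ i × k ∈ p)
  ∈-update⁻ {i = i} {k} {true} m with k ≟ i | ∈-insert⁻ m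
  ... | yes e | _ = inj₁ (e , refl)
  ... | no ne | inj₁ e = ⊥-elim (ne e)
  ... | no ne | inj₂ mp = inj₂ (ne , mp)
  ∈-update⁻ {b = false} m = inj₂ (∈-delete⁻ m)

  ∈-update⁺ : ∀ {p : Subset n} {i k b} → (k ≡ i × b ≡ true) ⊎ (k ≢ i × k ∈ p) → k ∈ (p [ i ]≔ b)
  ∈-update⁺ (inj₁ (e , refl)) = ∈-insert⁺ (inj₁ e)
  ∈-update⁺ {b = true} (inj₂ (ne , m)) = ∈-insert⁺ (inj₂ m)
  ∈-update⁺ {b = false} (inj₂ (ne , m)) = ∈-delete⁺ (ne , m)

  removeAdd : Subset n → Fin n → Fin n → Subset n
  removeAdd p i j = (p [ i ]≔ outside) [ j ]≔ inside

  addRemove : Subset n → Fin n → Fin n → Subset n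
  addRemove p i j = (p [ i ]≔ inside) [ j ]≔ outside

  ∈-removeAdd⁻ : ∀ {p i j k} → k ∈ removeAdd p i j → k ≡ j ⊎ (k ≢ i × k ∈ p)
  ∈-removeAdd⁻ m = Sum.map₂ ∈-delete⁻ (∈-insert⁻ m)

  ∈-removeAdd⁺ : ∀ {p i j k} → k ≡ j ⊎ (k ≢ i × k ∈ p) → k ∈ removeAdd p i j
  ∈-removeAdd⁺ m = ∈-insert⁺ (Sum.map₂ ∈-delete⁺ m)

  ∈-addRemove⁻ : ∀ {p i j k} → k ∈ addRemove p i j → k ≢ j × (k ≡ i ⊎ k ∈ p)
  ∈-addRemove⁻ m = Prod.map₂ ∈-insert⁻ (∈-delete⁻ m)

  ∈-addRemove⁺ : ∀ {p i j k} → k ≢ j × (k ≡ i ⊎ k ∈ p) → k ∈ addRemove p i j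
  ∈-addRemove⁺ (ne , m) = ∈-delete⁺ (ne , ∈-insert⁺ m)

  toSubset : ∀ {P : Fin n → Set} → Decidable P → Subset n
  toSubset P? = tabulate (λ i → does (P? i))

  ∈-toSubset⁻ : ∀ {P : Fin n → Set} (P? : Decidable P) {j} → j ∈ toSubset P? → P j
  ∈-toSubset⁻ P? {j} m with P? j | trans (sym (lookup∘tabulate (λ i → does (P? i)) j)) ([]=⇒lookup m)
  ... | yes p | _ = p

  ∈-toSubset⁺ : ∀ {P : Fin n → Set} (P? : Decidable P) {j} → P j → j ∈ toSubset P?
  ∈-toSubset⁺ P? {j} p = lookup⇒[]= j _ (trans (lookup∘tabulate (λ i → does (P? i)) j) (dec-true (P? j) p))

  subset-ext : ∀ {p q : Subset n} → (∀ j → j ∈ p → j ∈ q) → (∀ j → j ∈ q → j ∈ p) → p ≡ q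
  subset-ext f g = ⊆-antisym (λ {j} → f j) (λ {j} → g j)

  -- Recovers equalities proved from the irrelevant isPair fields of vertices.
  ≡-recompute : ∀ {p q : Subset n} → .(p ≡ q) → p ≡ q
  ≡-recompute {p} {q} = recompute (≡-dec BP._≟_ p q)

exch-∈ : ∀ {m} {e f : Fin m} {S T} → e ∈ S → exch e f (S , T) ≡ (removeAdd S e f , addRemove T e f)
exch-∈ {e = e} {S = S} m with e ∈? S
... | yes _ = refl
... | no e∉ = ⊥-elim (e∉ m)

exch-∉ : ∀ {m} {e f : Fin m} {S T} → e ∉ S → exch e f (S , T) ≡ (addRemove S e f , removeAdd T e f)
exch-∉ {e = e} {S = S} e∉ with e ∈? S
... | yes m = ⊥-elim (e∉ m)
... | no _ = refl

Exactly : {A : Set} → (A → Set) → A → A → Set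
Exactly P a b = ∀ g → (P g → g ≡ a ⊎ g ≡ b) × (g ≡ a ⊎ g ≡ b → P g)

module GraphProperties (H : Graph) where
  Edge = Fin (E H)
  Vertex = Fin (V H)
  EdgePred : Set₁
  EdgePred = Edge → Set

  J = Joins H
  R = Reach H

  joins-self : ∀ e → J e (src H e) (tgt H e)
  joins-self e = inj₁ (refl , refl)

  joins-sym : ∀ {e a b} → J e a b → J e b a
  joins-sym (inj₁ x) = inj₂ x
  joins-sym (inj₂ x) = inj₁ x

  joins-unique : ∀ {e a b c d} → J e a b → J e c d → (a ≡ c × b ≡ d) ⊎ (a ≡ d × b ≡ c)
  joins-unique (inj₁ (refl , refl)) (inj₁ (refl , refl)) = inj₁ (refl , refl)
  joins-unique (inj₁ (refl , refl)) (inj₂ (refl , refl)) = inj₂ (refl , refl)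
  joins-unique (inj₂ (refl , refl)) (inj₁ (refl , refl)) = inj₂ (refl , refl)
  joins-unique (inj₂ (refl , refl)) (inj₂ (refl , refl)) = inj₁ (refl , refl)

  module _ {P : EdgePred} where
    reach-trans : ∀ {u v w} → R P u v → R P v w → R P u w
    reach-trans r here = r
    reach-trans r (step e p j r') = step e p j (reach-trans r r')

    reach-edge : ∀ {e a b} → P e → J e a b → R P a b
    reach-edge {e} p j = step e p j here

    reach-sym : ∀ {u v} → R P u v → R P v u
    reach-sym here = here
    reach-sym (step e p j r) = reach-trans (reach-edge p (joins-sym j)) (reach-sym r)

  reach-mono : ∀ {P Q : EdgePred} → (∀ e → P e → Q e) → ∀ {u v} → R P u v → R Q u v
  reach-mono f here = here
  reach-mono f (step e p j r) = step e (f e p) j (reach-mono f r)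

  reach-none : ∀ {u v} → R (λ _ → ⊥) u v → u ≡ v
  reach-none here = refl
  reach-none (step e () j r)

  Minus : EdgePred → Edge → EdgePred
  Minus P g h = P h × h ≢ g

  Plus : EdgePred → Edge → EdgePred
  Plus P e h = P h ⊎ h ≡ e

  module WithEdge (P : EdgePred) (h : Edge) where
    a = src H h
    b = tgt H h

    ReachUsing : Vertex → Vertex → Set
    ReachUsing u v = R P u v ⊎ (R P u a × R P b v) ⊎ (R P u b × R P a v)

    reach-with⁻ : ∀ {u v} → R (Plus P h) u v → ReachUsing u v
    reach-with⁻ here = inj₁ here
    reach-with⁻ (step e (inj₁ p) j r) with reach-with⁻ r
    ... | inj₁ x = inj₁ (step e p j x)
    ... | inj₂ (inj₁ (x , y)) = inj₂ (inj₁ (x , step e p j y))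
    ... | inj₂ (inj₂ (x , y)) = inj₂ (inj₂ (x , step e p j y))
    reach-with⁻ (step e (inj₂ refl) j r) with reach-with⁻ r | joins-unique j (joins-self h)
    ... | inj₁ x | inj₁ (refl , refl) = inj₂ (inj₁ (x , here))
    ... | inj₁ x | inj₂ (refl , refl) = inj₂ (inj₂ (x , here))
    ... | inj₂ (inj₁ (x , y)) | inj₁ (refl , refl) = inj₂ (inj₁ (x , here))
    ... | inj₂ (inj₁ (x , y)) | inj₂ (refl , refl) = inj₁ x
    ... | inj₂ (inj₂ (x , y)) | inj₁ (refl , refl) = inj₁ x
    ... | inj₂ (inj₂ (x , y)) | inj₂ (refl , refl) = inj₂ (inj₂ (x , here))

    reach-with⁺ : ∀ {u v} → ReachUsing u v → R (Plus P h) u v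
    reach-with⁺ (inj₁ x) = reach-mono (λ _ → inj₁) x
    reach-with⁺ (inj₂ (inj₁ (x , y))) = reach-trans (reach-mono (λ _ → inj₁) x) (reach-trans (reach-edge (inj₂ refl) (joins-self h)) (reach-mono (λ _ → inj₁) y))
    reach-with⁺ (inj₂ (inj₂ (x , y))) = reach-trans (reach-mono (λ _ → inj₁) x) (reach-trans (reach-edge (inj₂ refl) (joins-sym (joins-self h))) (reach-mono (λ _ → inj₁) y))

  module DecReach (P : EdgePred) (P? : Decidable P) where
    Within : List Edge → EdgePred
    Within L e = P e × e LM.∈ L

    reach?-within : (L : List Edge) → ∀ u v → Dec (R (Within L) u v)
    reach?-within [] u v with u ≟ v
    ... | yes refl = yes here
    ... | no ne = no (λ r → ne (reach-none (reach-mono (λ { e (_ , ()) }) r)))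
    reach?-within (h ∷ L) u v with P? h
    ... | no ¬p = map′ (reach-mono (λ e x → proj₁ x , there (proj₂ x))) (reach-mono g) (reach?-within L u v)
      where g : ∀ e → Within (h ∷ L) e → Within L e
            g e (p , here refl) = ⊥-elim (¬p p)
            g e (p , there m) = p , m
    ... | yes p = map′ (λ x → reach-mono back (AE.reach-with⁺ x)) (λ r → AE.reach-with⁻ (reach-mono fwd r))
                   (reach?-within L u v ⊎-dec (reach?-within L u AE.a ×-dec reach?-within L AE.b v) ⊎-dec (reach?-within L u AE.b ×-dec reach?-within L AE.a v))
      where module AE = WithEdge (Within L) h
            back : ∀ e → Plus (Within L) h e → Within (h ∷ L) e
            back e (inj₁ (q , m)) = q , there m
            back e (inj₂ refl) = p , here refl
            fwd : ∀ e → Within (h ∷ L) e → Plus (Within L) h e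
            fwd e (q , here refl) = inj₂ refl
            fwd e (q , there m) = inj₁ (q , m)

    reach? : ∀ u v → Dec (R P u v)
    reach? u v = map′ (reach-mono (λ _ → proj₁)) (reach-mono (λ e p → p , ∈-allFin e)) (reach?-within (allFin (E H)) u v)

  data LView {n : ℕ} : Fin (suc n) → Set where
    isLast : LView (fromℕ n)
    isInj  : (k : Fin n) → LView (inject₁ k)

  lview : ∀ {n} (i : Fin (suc n)) → LView i
  lview {zero} zero = isLast
  lview {suc n} zero = isInj zero
  lview {suc n} (suc i) with lview i
  ... | isLast = isLast
  ... | isInj k = isInj (suc k)

  next-inj : ∀ {n} (k : Fin (suc n)) → next H (inject₁ k) ≡ suc k
  next-inj {n} k = toℕ-injective (trans (toℕ-fromℕ< _) (trans (m<n⇒m%n≡m lt) (cong suc (toℕ-inject₁ k))))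
    where lt : suc (toℕ (inject₁ k)) < suc (suc n)
          lt = s≤s (subst (_< suc n) (sym (toℕ-inject₁ k)) (toℕ<n k))

  next-last : ∀ {n} → next H (fromℕ (suc n)) ≡ zero
  next-last {n} = toℕ-injective (trans (toℕ-fromℕ< _) (trans (cong (λ x → suc x % suc (suc n)) (toℕ-fromℕ (suc n))) (n%n≡0 (suc (suc n)))))

  module Paths (Q : EdgePred) where
    data Path (u : Vertex) : Vertex → ℕ → Set where
      pnil : Path u u 0
      pcons : ∀ {v w m} (e : Edge) → Q e → J e v w → Path u v m → Path u w (suc m)

    _∈P_ : ∀ {u v m} → Vertex → Path u v m → Set
    _∈P_ {u} x pnil = x ≡ u
    x ∈P pcons {w = w} e q j p = x ≡ w ⊎ x ∈P p

    IsSimple : ∀ {u v m} → Path u v m → Set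
    IsSimple pnil = ⊤
    IsSimple (pcons {w = w} e q j p) = ¬ (w ∈P p) × IsSimple p

    ∈P? : ∀ {u v m} x (p : Path u v m) → Dec (x ∈P p)
    ∈P? {u} x pnil = x ≟ u
    ∈P? x (pcons {w = w} e q j p) = (x ≟ w) ⊎-dec ∈P? x p

    SimplePath : Vertex → Vertex → Set
    SimplePath u v = Σ ℕ λ m → Σ (Path u v m) IsSimple

    truncate : ∀ {u v m x} (p : Path u v m) → IsSimple p → x ∈P p → SimplePath u x
    truncate pnil s refl = 0 , pnil , tt
    truncate (pcons e q j p) s (inj₁ refl) = _ , pcons e q j p , s
    truncate (pcons e q j p) (_ , s) (inj₂ m) = truncate p s m

    simplify : ∀ {u v} → R Q u v → SimplePath u v
    simplify here = 0 , pnil , tt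
    simplify (step {v} {w} e q j r) with simplify r
    ... | m , p , s with ∈P? w p
    ...   | yes i = truncate p s i
    ...   | no ni = suc m , pcons e q j p , ni , s

    vert : ∀ {u v m} → Path u v m → Fin (suc m) → Vertex
    vert {u} pnil zero = u
    vert (pcons {w = w} e q j p) zero = w
    vert (pcons e q j p) (suc i) = vert p i

    vert-∈ : ∀ {u v m} (p : Path u v m) i → vert p i ∈P p
    vert-∈ pnil zero = refl
    vert-∈ (pcons e q j p) zero = inj₁ refl
    vert-∈ (pcons e q j p) (suc i) = inj₂ (vert-∈ p i)

    vert-injective : ∀ {u v m} (p : Path u v m) → IsSimple p → ∀ i k → vert p i ≡ vert p k → i ≡ k
    vert-injective pnil s zero zero eq = refl
    vert-injective (pcons e q j p) s zero zero eq = refl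
    vert-injective (pcons e q j p) (ns , s) zero (suc k) eq = ⊥-elim (ns (subst (_∈P p) (sym eq) (vert-∈ p k)))
    vert-injective (pcons e q j p) (ns , s) (suc i) zero eq = ⊥-elim (ns (subst (_∈P p) eq (vert-∈ p i)))
    vert-injective (pcons e q j p) (ns , s) (suc i) (suc k) eq = cong suc (vert-injective p s i k eq)

    vert-zero : ∀ {u v m} (p : Path u v m) → vert p zero ≡ v
    vert-zero pnil = refl
    vert-zero (pcons e q j p) = refl

    vert-last : ∀ {u v m} (p : Path u v m) → vert p (fromℕ m) ≡ u
    vert-last pnil = refl
    vert-last (pcons e q j p) = vert-last p

    edge : ∀ {u v m} → Path u v m → Fin m → Edge
    edge (pcons e q j p) zero = e
    edge (pcons e q j p) (suc i) = edge p i

    edge-∈ : ∀ {u v m} (p : Path u v m) i → Q (edge p i)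
    edge-∈ (pcons e q j p) zero = q
    edge-∈ (pcons e q j p) (suc i) = edge-∈ p i

    edge-joins : ∀ {u v m} (p : Path u v m) i → J (edge p i) (vert p (suc i)) (vert p (inject₁ i))
    edge-joins (pcons e q j p) zero = subst (λ z → J e z _) (sym (vert-zero p)) j
    edge-joins (pcons e q j p) (suc i) = edge-joins p i

    edge-injective : ∀ {u v m} (p : Path u v m) → IsSimple p → ∀ i k → edge p i ≡ edge p k → i ≡ k
    edge-injective p s i k eq with joins-unique (edge-joins p i) (subst (λ z → J z _ _) (sym eq) (edge-joins p k))
    ... | inj₁ (a , b) = FP.suc-injective (vert-injective p s _ _ a)
    ... | inj₂ (a , b) = ⊥-elim (absurd (cong toℕ (vert-injective p s _ _ a)) (cong toℕ (vert-injective p s _ _ b)))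
      where nss : ∀ n → n ≢ suc (suc n)
            nss zero ()
            nss (suc n) eq = nss n (NP.suc-injective eq)
            absurd : suc (toℕ i) ≡ toℕ (inject₁ k) → toℕ (inject₁ i) ≡ suc (toℕ k) → ⊥
            absurd x y rewrite toℕ-inject₁ k | toℕ-inject₁ i | sym x = nss _ y

    module Closing (g : Edge) where
      cycEdge : ∀ {u v m} → Path u v m → Fin (suc m) → Edge
      cycEdge pnil zero = g
      cycEdge (pcons e q j p) zero = e
      cycEdge (pcons e q j p) (suc i) = cycEdge p i

      cycEdge-inject₁ : ∀ {u v m} (p : Path u v m) k → cycEdge p (inject₁ k) ≡ edge p k
      cycEdge-inject₁ (pcons e q j p) zero = refl
      cycEdge-inject₁ (pcons e q j p) (suc k) = cycEdge-inject₁ p k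

      cycEdge-last : ∀ {u v m} (p : Path u v m) → cycEdge p (fromℕ m) ≡ g
      cycEdge-last pnil = refl
      cycEdge-last (pcons e q j p) = cycEdge-last p

  next-toℕ : ∀ {k} (i : Fin (suc k)) → suc (toℕ i) < suc k → toℕ (next H i) ≡ suc (toℕ i)
  next-toℕ i lt = trans (toℕ-fromℕ< _) (m<n⇒m%n≡m lt)

  CycleThrough : EdgePred → Edge → Set
  CycleThrough P g = Σ (Cycle H P) λ c → ∃ λ i → Cycle.es c i ≡ g

  path-length-0 : ∀ {Q u v} → Paths.Path Q u v 0 → u ≡ v
  path-length-0 Paths.pnil = refl

  bypass⇒cycle : (P : EdgePred) (g : Edge) → P g → R (Minus P g) (src H g) (tgt H g) → CycleThrough P g
  bypass⇒cycle P g pg r with Paths.simplify (Minus P g) r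
  ... | zero , p , s = ⊥-elim (noLoop H g (path-length-0 p))
  ... | suc n , p , s = cycle , fromℕ (suc n) , cycEdge-last p
    where
    open Paths (Minus P g)
    open Closing g
    es-injective : ∀ {i k} → cycEdge p i ≡ cycEdge p k → i ≡ k
    es-injective {i} {k} eq with lview i | lview k
    ... | isLast | isLast = refl
    ... | isLast | isInj b = ⊥-elim (proj₂ (edge-∈ p b) (trans (sym (cycEdge-inject₁ p b)) (trans (sym eq) (cycEdge-last p))))
    ... | isInj a | isLast = ⊥-elim (proj₂ (edge-∈ p a) (trans (sym (cycEdge-inject₁ p a)) (trans eq (cycEdge-last p))))
    ... | isInj a | isInj b = cong inject₁ (edge-injective p s a b (trans (sym (cycEdge-inject₁ p a)) (trans eq (cycEdge-inject₁ p b))))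
    es-joins : ∀ i → J (cycEdge p i) (vert p i) (vert p (next H i))
    es-joins i with lview i
    ... | isLast rewrite next-last {n} | cycEdge-last p | vert-last p | vert-zero p = joins-self g
    ... | isInj a rewrite next-inj a | cycEdge-inject₁ p a = joins-sym (edge-joins p a)
    es-∈ : ∀ i → P (cycEdge p i)
    es-∈ i with lview i
    ... | isLast rewrite cycEdge-last p = pg
    ... | isInj a rewrite cycEdge-inject₁ p a = proj₁ (edge-∈ p a)
    cycle : Cycle H P
    cycle = record { len = n ; vs = vert p ; es = cycEdge p ; vsInj = λ eq → vert-injective p s _ _ eq
                 ; esInj = es-injective ; joins = es-joins ; inP = es-∈ }

  module AroundCycle (P : EdgePred) (c : Cycle H P) where
    open Cycle c
    L : ℕ
    L = suc (suc len)
    arc-walk : (g : Edge) (x : Fin L) (d : ℕ) (y : Fin L) → toℕ y ≡ toℕ x + d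
        → (∀ j → toℕ x ≤ toℕ j → toℕ j < toℕ y → es j ≢ g) → R (Minus P g) (vs x) (vs y)
    arc-walk g x zero y eq h = subst (λ z → R _ (vs x) (vs z)) (toℕ-injective (trans (sym (NP.+-identityʳ _)) (sym eq))) here
    arc-walk g x (suc d) y eq h = step (es y') (inP y' , h y' x≤y' y'<y) jn' (arc-walk g x d y' ty' λ j a b → h j a (NP.<-trans b y'<y))
      where
      lt2 : toℕ x + d < L
      lt2 = NP.<-trans (subst (toℕ x + d <_) (sym (trans eq (NP.+-suc _ d))) (NP.n<1+n _)) (toℕ<n y)
      y' : Fin L
      y' = fromℕ< lt2
      ty' : toℕ y' ≡ toℕ x + d
      ty' = toℕ-fromℕ< lt2
      x≤y' : toℕ x ≤ toℕ y'
      x≤y' = subst (toℕ x ≤_) (sym ty') (NP.m≤m+n _ _)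
      y'<y : toℕ y' < toℕ y
      y'<y = subst₂ _<_ (sym ty') (sym (trans eq (NP.+-suc _ d))) (NP.n<1+n _)
      nx : next H y' ≡ y
      nx = toℕ-injective (trans (next-toℕ y' (subst (_< L) (trans (trans eq (NP.+-suc _ d)) (sym (cong suc ty'))) (toℕ<n y))) (trans (cong suc ty') (sym (trans eq (NP.+-suc _ d)))))
      jn' : J (es y') (vs y') (vs y)
      jn' = subst (λ z → J (es y') (vs y') (vs z)) nx (joins y')

    bypass : (g : Edge) (i : Fin L) → es i ≡ g → R (Minus P g) (src H g) (tgt H g)
    bypass g i ei with lview i
    ... | isLast = orient (joins (fromℕ (suc len)))
      where
      w : R (Minus P g) (vs zero) (vs (fromℕ (suc len)))
      w = arc-walk g zero (suc len) (fromℕ (suc len)) (toℕ-fromℕ _) λ j _ lt eq →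
            NP.<-irrefl (cong toℕ (esInj (trans eq (sym ei)))) lt
      orient : J (es (fromℕ (suc len))) (vs (fromℕ (suc len))) (vs (next H (fromℕ (suc len)))) → R (Minus P g) (src H g) (tgt H g)
      orient j rewrite next-last {len} | ei with joins-unique j (joins-self g)
      ... | inj₁ (a , b) = subst₂ (R _) a b (reach-sym w)
      ... | inj₂ (a , b) = subst₂ (R _) b a w
    ... | isInj k = orient (joins (inject₁ k))
      where
      tk = toℕ k
      tk≤ : tk ≤ len
      tk≤ = NP.<⇒≤pred (toℕ<n k)
      bad : ∀ j → es j ≡ g → toℕ j ≡ tk
      bad j eq = trans (cong toℕ (esInj (trans eq (sym ei)))) (toℕ-inject₁ k)
      w1 : R (Minus P g) (vs (suc k)) (vs (fromℕ (suc len)))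
      w1 = arc-walk g (suc k) (len ∸ tk) (fromℕ (suc len)) (trans (toℕ-fromℕ _) (cong suc (sym (NP.m+[n∸m]≡n tk≤))))
             λ j a _ eq → NP.<-irrefl (sym (bad j eq)) a
      w2 : R (Minus P g) (vs (fromℕ (suc len))) (vs zero)
      w2 = subst (λ z → R (Minus P g) (vs (fromℕ (suc len))) (vs z)) (next-last {len})
             (reach-edge (inP _ , λ eq → NP.<-irrefl (trans (sym (bad _ eq)) (toℕ-fromℕ _)) (s≤s tk≤)) (joins (fromℕ (suc len))))
      w3 : R (Minus P g) (vs zero) (vs (inject₁ k))
      w3 = arc-walk g zero tk (inject₁ k) (toℕ-inject₁ k) λ j _ lt eq →
             NP.<-irrefl (bad j eq) (subst (toℕ j <_) (toℕ-inject₁ k) lt)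
      w : R (Minus P g) (vs (suc k)) (vs (inject₁ k))
      w = reach-trans w1 (reach-trans w2 w3)
      orient : J (es (inject₁ k)) (vs (inject₁ k)) (vs (next H (inject₁ k))) → R (Minus P g) (src H g) (tgt H g)
      orient j rewrite next-inj k | ei with joins-unique j (joins-self g)
      ... | inj₁ (a , b) = subst₂ (R _) a b (reach-sym w)
      ... | inj₂ (a , b) = subst₂ (R _) b a w

  cycle⇒bypass : ∀ {P g} → CycleThrough P g → P g × R (Minus P g) (src H g) (tgt H g)
  cycle⇒bypass {P} {g} (c , i , ei) = subst P ei (Cycle.inP c i) , AroundCycle.bypass P c g i ei

  Forest : EdgePred → Set
  Forest P = ∀ g → P g → ¬ R (Minus P g) (src H g) (tgt H g)

  Connected : EdgePred → Set
  Connected P = ∀ u v → R P u v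

  Tree : EdgePred → Set
  Tree P = Connected P × Forest P

  acyc⇒forest : ∀ {P} → ¬ Cycle H P → Forest P
  acyc⇒forest {P} ac g pg r = ac (proj₁ (bypass⇒cycle P g pg r))

  forest⇒acyc : ∀ {P} → Forest P → ¬ Cycle H P
  forest⇒acyc {P} fo c with cycle⇒bypass {P} (c , zero , refl)
  ... | pg , r = fo _ pg r

  crossing-edge : ∀ {Q : EdgePred} (A : Vertex → Set) → Decidable A → ∀ {u v} → R Q u v → A u → ¬ A v
        → Σ Edge λ g → Σ Vertex λ a → Σ Vertex λ b → Q g × J g a b × A a × ¬ A b
  crossing-edge A A? here au nav = ⊥-elim (nav au)
  crossing-edge A A? (step {v} e q j r) au nav with A? v
  ... | yes av = e , v , _ , q , j , av , nav
  ... | no nav' = crossing-edge A A? r au nav'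

  reach-either-end : ∀ {P} x → Connected P → ∀ v → R (Minus P x) (src H x) v ⊎ R (Minus P x) (tgt H x) v
  reach-either-end {P} x co v = split (co (src H x) v)
    where
    split : ∀ {w} → R P (src H x) w → R (Minus P x) (src H x) w ⊎ R (Minus P x) (tgt H x) w
    split here = inj₁ here
    split (step e p j r) with e ≟ x | split r
    ... | no ne | inj₁ a = inj₁ (step e (p , ne) j a)
    ... | no ne | inj₂ b = inj₂ (step e (p , ne) j b)
    ... | yes refl | inj₁ a with joins-unique j (joins-self x)
    ...   | inj₁ (refl , refl) = inj₂ here
    ...   | inj₂ (refl , refl) = inj₁ here
    split (step e p j r) | yes refl | inj₂ b with joins-unique j (joins-self x)
    ...   | inj₁ (refl , refl) = inj₂ here
    ...   | inj₂ (refl , refl) = inj₁ here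

  -- Basis exchange: an edge y ∈ Y ∖ X reconnects the two components of X − x, and
  -- X − x + y is a tree sharing one more edge with Y.
  module TreeExchange {X Y : EdgePred} (X? : Decidable X) (Y? : Decidable Y) (tX : Tree X) (tY : Tree Y)
                  (x : Edge) (Xx : X x) (nYx : ¬ Y x) where
    A : Vertex → Set
    A v = R (Minus X x) (src H x) v
    A? : Decidable A
    A? v = DecReach.reach? (Minus X x) (λ h → X? h ×-dec ¬? (h ≟ x)) (src H x) v

    cr = crossing-edge A A? (proj₁ tY (src H x) (tgt H x)) here (proj₂ tX x Xx)
    y = proj₁ cr
    a = proj₁ (proj₂ cr)
    b = proj₁ (proj₂ (proj₂ cr))
    Yy : Y y
    Yy = proj₁ (proj₂ (proj₂ (proj₂ cr)))
    Jy : J y a b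
    Jy = proj₁ (proj₂ (proj₂ (proj₂ (proj₂ cr))))
    Aa : A a
    Aa = proj₁ (proj₂ (proj₂ (proj₂ (proj₂ (proj₂ cr)))))
    nAb : ¬ A b
    nAb = proj₂ (proj₂ (proj₂ (proj₂ (proj₂ (proj₂ cr)))))

    y≢x : y ≢ x
    y≢x e = nYx (subst Y e Yy)

    nXy : ¬ X y
    nXy Xy = nAb (reach-trans Aa (reach-edge (Xy , y≢x) Jy))

    X' : EdgePred
    X' h = Minus X x h ⊎ h ≡ y

    noBridge : ¬ R (Minus X x) (src H y) (tgt H y)
    noBridge r with joins-unique Jy (joins-self y)
    ... | inj₁ (e1 , e2) = nAb (reach-trans Aa (subst₂ (R _) (sym e1) (sym e2) r))
    ... | inj₂ (e1 , e2) = nAb (reach-trans Aa (subst₂ (R _) (sym e1) (sym e2) (reach-sym r)))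

    bridge : R X' (src H x) (tgt H x)
    bridge with reach-either-end {X} x (proj₁ tX) b
    ... | inj₁ ab = ⊥-elim (nAb ab)
    ... | inj₂ bb = reach-trans (reach-mono (λ _ → inj₁) Aa) (reach-trans (reach-edge (inj₂ refl) Jy) (reach-sym (reach-mono (λ _ → inj₁) bb)))

    connected′ : Connected X'
    connected′ u v = reach-trans (reach-sym (fromSrc u)) (fromSrc v)
      where fromSrc : ∀ w → R X' (src H x) w
            fromSrc w with reach-either-end {X} x (proj₁ tX) w
            ... | inj₁ r = reach-mono (λ _ → inj₁) r
            ... | inj₂ r = reach-trans bridge (reach-mono (λ _ → inj₁) r)

    forest′ : Forest X'
    forest′ g (inj₂ refl) r = noBridge (reach-mono f r)
      where f : ∀ h → Minus X' y h → Minus X x h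
            f h (inj₁ m , _) = m
            f h (inj₂ e , ne) = ⊥-elim (ne e)
    forest′ g (inj₁ (Xg , g≢x)) r with WithEdge.reach-with⁻ (Minus (Minus X x) g) y (reach-mono f r)
      where f : ∀ h → Minus X' g h → Plus (Minus (Minus X x) g) y h
            f h (inj₁ m , ne) = inj₁ (m , ne)
            f h (inj₂ e , ne) = inj₂ e
    ... | inj₁ r' = proj₂ tX g Xg (reach-mono (λ h m → proj₁ (proj₁ m) , proj₂ m) r')
    ... | inj₂ (inj₁ (r1 , r2)) = noBridge (reach-trans (reach-sym (reach-mono (λ _ → proj₁) r1)) (reach-trans (reach-edge (Xg , g≢x) (joins-self g)) (reach-sym (reach-mono (λ _ → proj₁) r2))))
    ... | inj₂ (inj₂ (r1 , r2)) = noBridge (reach-trans (reach-mono (λ _ → proj₁) r2) (reach-trans (reach-edge (Xg , g≢x) (joins-sym (joins-self g))) (reach-mono (λ _ → proj₁) r1)))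

    X'? : Decidable X'
    X'? h = (X? h ×-dec ¬? (h ≟ x)) ⊎-dec (h ≟ y)

    count-exchanged : count X'? ≡ count X?
    count-exchanged = trans (count-remove X'? y (inj₂ refl))
                (trans (cong suc (count-cong _ (λ h → X? h ×-dec ¬? (h ≟ x))
                          (λ { h (inj₁ m , _) → m ; h (inj₂ e , ne) → ⊥-elim (ne e) })
                          (λ h m → inj₁ m , λ e → nXy (subst X e (proj₁ m)))))
                       (sym (count-remove X? x Xx)))

    count-difference : count (λ h → X? h ×-dec ¬? (Y? h)) ≡ suc (count (λ h → X'? h ×-dec ¬? (Y? h)))
    count-difference = trans (count-remove _ x (Xx , nYx)) (cong suc (count-cong (λ i → (X? i ×-dec ¬? (Y? i)) ×-dec ¬? (i ≟ x)) (λ h → X'? h ×-dec ¬? (Y? h))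
                  (λ h ((Xh , nYh) , ne) → inj₁ (Xh , ne) , nYh)
                  (λ { h (inj₁ (Xh , ne) , nYh) → (Xh , nYh) , ne ; h (inj₂ refl , nYh) → ⊥-elim (nYh Yy) })))

  tree-size : ∀ {X Y : EdgePred} (X? : Decidable X) (Y? : Decidable Y) → Tree X → Tree Y → count X? ≡ count Y?
  tree-size {X} {Y} X? Y? tX tY = induct _ X? tX refl
    where
    induct : ∀ k {X : EdgePred} (X? : Decidable X) → Tree X → count (λ h → X? h ×-dec ¬? (Y? h)) ≡ k → count X? ≡ count Y?
    induct zero {X} X? tX eq = count-cong X? Y? XY YX
      where
      XY : ∀ h → X h → Y h
      XY h Xh with Y? h
      ... | yes Yh = Yh
      ... | no nYh = ⊥-elim (0≢s (trans (sym eq) (count-remove _ h (Xh , nYh))))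
        where 0≢s : ∀ {k} → 0 ≢ suc k
              0≢s ()
      YX : ∀ h → Y h → X h
      YX h Yh with X? h
      ... | yes Xh = Xh
      ... | no nXh = ⊥-elim (proj₂ tY h Yh (reach-mono (λ g Xg → XY g Xg , λ e → nXh (subst X e Xg)) (proj₁ tX (src H h) (tgt H h))))
    induct (suc k) {X} X? tX eq with count-suc⇒∃ {P = λ h → X h × ¬ Y h} _ eq
    ... | x , (Xx , nYx) = trans (sym (TreeExchange.count-exchanged X? Y? tX tY x Xx nYx))
           (induct k _ (TreeExchange.connected′ X? Y? tX tY x Xx nYx , TreeExchange.forest′ X? Y? tX tY x Xx nYx)
               (NP.suc-injective (trans (sym (TreeExchange.count-difference X? Y? tX tY x Xx nYx)) eq)))

  ¬cover-sharing-one-edge : ∀ {A B X Y : EdgePred} (A? : Decidable A) (B? : Decidable B) (X? : Decidable X) (Y? : Decidable Y)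
    → Tree A → Tree B → (∀ h → A h ⊎ B h) → (∀ h → A h → B h → ⊥)
    → Tree X → Tree Y → (∀ h → X h ⊎ Y h) → (d : Edge) → X d → Y d → (∀ h → X h → Y h → h ≡ d) → ⊥
  ¬cover-sharing-one-edge {A} {B} {X} {Y} A? B? X? Y? tA tB cAB dAB tX tY cXY d Xd Yd dXY = absurd eqA eqX
    where
    eqA : count A? + count B? ≡ E H + 0
    eqA = trans (count-⊎+× A? B?) (cong₂ _+_ (count-all (λ h → A? h ⊎-dec B? h) cAB) (count-none (λ h → A? h ×-dec B? h) (λ h (a , b) → dAB h a b)))
    eqX : count X? + count Y? ≡ E H + 1
    eqX = trans (count-⊎+× X? Y?) (cong₂ _+_ (count-all (λ h → X? h ⊎-dec Y? h) cXY) (count-unique (λ h → X? h ×-dec Y? h) d (λ h (x , y) → dXY h x y) (Xd , Yd)))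
    k = count A?
    absurd : k + count B? ≡ E H + 0 → count X? + count Y? ≡ E H + 1 → ⊥
    absurd e1 e2 rewrite sym (tree-size A? B? tA tB) | tree-size X? A? tX tA | tree-size Y? A? tY tA = 0≢1 (NP.+-cancelˡ-≡ (E H) 0 1 (trans (sym e1) e2))
      where 0≢1 : 0 ≢ 1
            0≢1 ()

  cycle-other-edge : ∀ {P d} → P d → R (Minus P d) (src H d) (tgt H d)
            → Σ Edge λ g → g ≢ d × P g × R (Minus P g) (src H g) (tgt H g)
  cycle-other-edge {P} {d} pd r with bypass⇒cycle P d pd r
  ... | c , i , ei with Cycle.es c zero ≟ d
  ...   | no ne = _ , ne , cycle⇒bypass {P} (c , zero , refl)
  ...   | yes e0 = _ , (λ e1 → z1 (Cycle.esInj c (trans e0 (sym e1)))) , cycle⇒bypass {P} (c , suc zero , refl)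
    where z1 : ∀ {n} → Fin.zero {suc n} ≢ suc zero
          z1 ()

  -- Walk forms of InD and InC: g lies on the cycle of Y + e iff g ∈ Y + e and its ends
  -- are joined in Y + e − g.
  InCut : EdgePred → Edge → Edge → Set
  InCut X e g = ¬ R (Minus X e) (src H g) (tgt H g)

  InCycle : EdgePred → Edge → Edge → Set
  InCycle Y e g = Plus Y e g × R (Minus (Plus Y e) g) (src H g) (tgt H g)

  cycleThrough⇒InCycle : ∀ {Y e g} → CycleThrough (Plus Y e) g → InCycle Y e g
  cycleThrough⇒InCycle c = cycle⇒bypass c
  InCycle⇒cycleThrough : ∀ {Y e g} → InCycle Y e g → CycleThrough (Plus Y e) g
  InCycle⇒cycleThrough {Y} {e} {g} (p , r) = bypass⇒cycle (Plus Y e) g p r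

  _⇔P_ : EdgePred → EdgePred → Set
  P ⇔P Q = (∀ h → P h → Q h) × (∀ h → Q h → P h)

  InCut-cong : ∀ {X X' e g} → X ⇔P X' → InCut X e g → InCut X' e g
  InCut-cong (f , b) n r = n (reach-mono (λ h (x , ne) → b h x , ne) r)

  InCycle-cong : ∀ {Y Y' e g} → Y ⇔P Y' → InCycle Y e g → InCycle Y' e g
  InCycle-cong {Y} {Y'} {e} {g} (f , b) (p , r) = pl p , reach-mono (λ h (x , ne) → pl x , ne) r
    where pl : ∀ {h} → Plus Y e h → Plus Y' e h
          pl (inj₁ y) = inj₁ (f _ y)
          pl (inj₂ eq) = inj₂ eq

  cycle-on-itself : ∀ {P} (c : Cycle H P) → Cycle H (λ h → ∃ λ i → Cycle.es c i ≡ h)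
  cycle-on-itself c = record { len = len ; vs = vs ; es = es ; vsInj = vsInj ; esInj = esInj ; joins = joins ; inP = λ i → i , refl }
    where open Cycle c

  tree-cong : ∀ {P P'} → P ⇔P P' → Tree P → Tree P'
  tree-cong (f , b) (co , fo) = (λ u v → reach-mono f (co u v)) , λ g p' r → fo g (b g p') (reach-mono (λ h (x , ne) → b h x , ne) r)

  ⇔P-sym : ∀ {P Q} → P ⇔P Q → Q ⇔P P
  ⇔P-sym (f , b) = b , f

  ⇔P-refl : ∀ {P} → P ⇔P P
  ⇔P-refl = (λ _ x → x) , (λ _ x → x)

  uniqueEx⇒Exactly : ∀ {X' Y' : EdgePred} {S T : Subset (E H)} {e f} → X' ⇔P (_∈ S) → Y' ⇔P (_∈ T)
    → UniqueEx H S T e f → Exactly (λ g → InCut X' e g × InCycle Y' e g) e f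
  uniqueEx⇒Exactly ex ey U g = (λ (d , c) → Equivalence.to (U g) (InCut-cong ex d , InCycle⇒cycleThrough (InCycle-cong ey c)))
                    , (λ o → let (d , c) = Equivalence.from (U g) o in InCut-cong (⇔P-sym ex) d , InCycle-cong (⇔P-sym ey) (cycleThrough⇒InCycle c))

  Exactly⇒uniqueEx : ∀ {X' Y' : EdgePred} {S T : Subset (E H)} {e f} → X' ⇔P (_∈ S) → Y' ⇔P (_∈ T)
    → Exactly (λ g → InCut X' e g × InCycle Y' e g) e f → UniqueEx H S T e f
  Exactly⇒uniqueEx ex ey U g = mk⇔ (λ (d , c) → proj₁ (U g) (InCut-cong (⇔P-sym ex) d , InCycle-cong (⇔P-sym ey) (cycleThrough⇒InCycle c)))
                          (λ o → let (d , c) = proj₂ (U g) o in InCut-cong ex d , InCycle⇒cycleThrough (InCycle-cong ey c))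

  spt⇒tree : ∀ {T} → SpanningTree H T → Tree (_∈ T)
  spt⇒tree (co , ac) = (λ u v → co u v ∈⊤ ∈⊤) , acyc⇒forest ac
  tree⇒spt : ∀ {T} → Tree (_∈ T) → SpanningTree H T
  tree⇒spt (co , fo) = (λ u v _ _ → co u v) , forest⇒acyc fo

  bispanning-trees : Bispanning H → Σ (Subset (E H)) λ A → Σ (Subset (E H)) λ B →
     Tree (_∈ A) × Tree (_∈ B) × (∀ h → h ∈ A ⊎ h ∈ B) × (∀ h → h ∈ A → h ∈ B → ⊥)
  bispanning-trees (A , B , _ , _ , dj , cv , sa , sb) = A , B , spt⇒tree sa , spt⇒tree sb , (λ h → cv h ∈⊤) , dj

IsPair : (H : Graph) → Subset (E H) → Subset (E H) → Set
IsPair H S T = SpanningTree H S × SpanningTree H T × (∀ e → e ∈ S → e ∈ T → ⊥) × (∀ e → e ∈ S ⊎ e ∈ T)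

arc-ends-distinct : ∀ {H : Graph} {S T : Subset (E H)} {a b} → (∀ e → e ∈ S → e ∈ T → ⊥) → ArcCond H S T a b → a ≢ b
arc-ends-distinct dj (inj₁ (aS , bT , _)) eq = dj _ (subst (_∈ _) eq aS) bT
arc-ends-distinct dj (inj₂ (aT , bS , _)) eq = dj _ bS (subst (_∈ _) eq aT)

-- IsTwoCliqueSum with each field accompanied by its mirror image, so that swapSides is
-- free and every argument about side 1 applies verbatim to side 2.
record CliqueSum (G G₁ G₂ : Graph) (d₁ : Fin (E G₁)) (d₂ : Fin (E G₂)) : Set₁ where
  field
    φ₁ : Fin (V G₁) → Fin (V G)
    φ₂ : Fin (V G₂) → Fin (V G)
    φ₁-inj : ∀ {a b} → φ₁ a ≡ φ₁ b → a ≡ b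
    φ₂-inj : ∀ {a b} → φ₂ a ≡ φ₂ b → a ≡ b
    cover : ∀ v → (∃ λ a → φ₁ a ≡ v) ⊎ (∃ λ b → φ₂ b ≡ v)
    cover-sym : ∀ v → (∃ λ b → φ₂ b ≡ v) ⊎ (∃ λ a → φ₁ a ≡ v)
    glue : (φ₁ (src G₁ d₁) ≡ φ₂ (src G₂ d₂) × φ₁ (tgt G₁ d₁) ≡ φ₂ (tgt G₂ d₂))
         ⊎ (φ₁ (src G₁ d₁) ≡ φ₂ (tgt G₂ d₂) × φ₁ (tgt G₁ d₁) ≡ φ₂ (src G₂ d₂))
    glue-sym : (φ₂ (src G₂ d₂) ≡ φ₁ (src G₁ d₁) × φ₂ (tgt G₂ d₂) ≡ φ₁ (tgt G₁ d₁))
         ⊎ (φ₂ (src G₂ d₂) ≡ φ₁ (tgt G₁ d₁) × φ₂ (tgt G₂ d₂) ≡ φ₁ (src G₁ d₁))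
    only₁ : ∀ a b → φ₁ a ≡ φ₂ b → a ≡ src G₁ d₁ ⊎ a ≡ tgt G₁ d₁
    only₂ : ∀ b a → φ₂ b ≡ φ₁ a → b ≡ src G₂ d₂ ⊎ b ≡ tgt G₂ d₂
    On₁ : Fin (E G) → Fin (E G₁) → Set
    On₂ : Fin (E G) → Fin (E G₂) → Set
    side : ∀ e → (∃ (On₁ e)) ⊎ (∃ (On₂ e))
    side-sym : ∀ e → (∃ (On₂ e)) ⊎ (∃ (On₁ e))
    On₁-functional : ∀ {e x y} → On₁ e x → On₁ e y → x ≡ y
    On₂-functional : ∀ {e x y} → On₂ e x → On₂ e y → x ≡ y
    On₁-injective : ∀ {e e' x} → On₁ e x → On₁ e' x → e ≡ e'
    On₂-injective : ∀ {e e' x} → On₂ e x → On₂ e' x → e ≡ e'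
    On₁₂-disjoint : ∀ {e x y} → On₁ e x → On₂ e y → ⊥
    surj₁ : ∀ x → x ≢ d₁ → ∃ λ e → On₁ e x
    surj₂ : ∀ x → x ≢ d₂ → ∃ λ e → On₂ e x
    avoid₁ : ∀ e → ¬ On₁ e d₁
    avoid₂ : ∀ e → ¬ On₂ e d₂
    ends₁ : ∀ {e x} → On₁ e x → Joins G e (φ₁ (src G₁ x)) (φ₁ (tgt G₁ x))
    ends₂ : ∀ {e x} → On₂ e x → Joins G e (φ₂ (src G₂ x)) (φ₂ (tgt G₂ x))

swapSides : ∀ {G G₁ G₂ d₁ d₂} → CliqueSum G G₁ G₂ d₁ d₂ → CliqueSum G G₂ G₁ d₂ d₁
swapSides c = record
  { φ₁ = φ₂ ; φ₂ = φ₁ ; φ₁-inj = φ₂-inj ; φ₂-inj = φ₁-inj ; cover = cover-sym ; cover-sym = cover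
  ; glue = glue-sym ; glue-sym = glue
  ; only₁ = only₂ ; only₂ = only₁ ; On₁ = On₂ ; On₂ = On₁ ; side = side-sym ; side-sym = side
  ; On₁-functional = On₂-functional ; On₂-functional = On₁-functional ; On₁-injective = On₂-injective ; On₂-injective = On₁-injective
  ; On₁₂-disjoint = λ a b → On₁₂-disjoint b a ; surj₁ = surj₂ ; surj₂ = surj₁ ; avoid₁ = avoid₂ ; avoid₂ = avoid₁
  ; ends₁ = ends₂ ; ends₂ = ends₁ }
  where open CliqueSum c

fromIsTwoCliqueSum : ∀ {G G₁ G₂ d₁ d₂} → IsTwoCliqueSum G G₁ G₂ d₁ d₂ → CliqueSum G G₁ G₂ d₁ d₂
fromIsTwoCliqueSum {G} {G₁} {G₂} {d₁} {d₂} t = record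
  { φ₁ = φ₁ ; φ₂ = φ₂ ; φ₁-inj = φ₁-inj ; φ₂-inj = φ₂-inj ; cover = cover ; cover-sym = Sum.swap ∘ cover ; glue = glue
  ; glue-sym = Sum.map (λ (a , b) → sym a , sym b) (λ (a , b) → sym b , sym a) glue
  ; only₁ = onlyGlue ; only₂ = only₂′
  ; On₁ = λ e x → χ e ≡ inj₁ x ; On₂ = λ e x → χ e ≡ inj₂ x
  ; side = sd ; side-sym = Sum.swap ∘ sd
  ; On₁-functional = λ a b → inj₁-injective (trans (sym a) b) ; On₂-functional = λ a b → inj₂-injective (trans (sym a) b)
  ; On₁-injective = λ a b → χ-inj (trans a (sym b)) ; On₂-injective = λ a b → χ-inj (trans a (sym b))
  ; On₁₂-disjoint = λ a b → inj₁≢inj₂ (trans (sym a) b)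
  ; surj₁ = χ-surj₁ ; surj₂ = χ-surj₂ ; avoid₁ = χ-avoid₁ ; avoid₂ = χ-avoid₂
  ; ends₁ = λ {e} {x} p → ends₁ e x p ; ends₂ = λ {e} {x} p → ends₂ e x p }
  where
  open IsTwoCliqueSum t
  inj₁≢inj₂ : ∀ {x y} → inj₁ {A = Fin (E G₁)} {B = Fin (E G₂)} x ≢ inj₂ y
  inj₁≢inj₂ ()
  sd : ∀ e → (∃ λ x → χ e ≡ inj₁ x) ⊎ (∃ λ x → χ e ≡ inj₂ x)
  sd e with χ e
  ... | inj₁ x = inj₁ (x , refl)
  ... | inj₂ x = inj₂ (x , refl)
  only₂′ : ∀ b a → φ₂ b ≡ φ₁ a → b ≡ src G₂ d₂ ⊎ b ≡ tgt G₂ d₂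
  only₂′ b a eq with onlyGlue a b (sym eq) | glue
  ... | inj₁ refl | inj₁ (g1 , g2) = inj₁ (φ₂-inj (trans eq g1))
  ... | inj₁ refl | inj₂ (g1 , g2) = inj₂ (φ₂-inj (trans eq g1))
  ... | inj₂ refl | inj₁ (g1 , g2) = inj₂ (φ₂-inj (trans eq g2))
  ... | inj₂ refl | inj₂ (g1 , g2) = inj₁ (φ₂-inj (trans eq g2))

module Restriction {G G₁ G₂ d₁ d₂} (cs : CliqueSum G G₁ G₂ d₁ d₂) where
  open CliqueSum cs public
  module L = GraphProperties G
  module L₁ = GraphProperties G₁
  module L₂ = GraphProperties G₂
  PredG : Set₁
  PredG = Fin (E G) → Set
  s₁ = src G₁ d₁
  t₁ = tgt G₁ d₁
  s₂ = src G₂ d₂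
  t₂ = tgt G₂ d₂

  Part₁ : PredG → L₁.EdgePred
  Part₁ P x = Σ (Fin (E G)) λ e → On₁ e x × P e
  Part₂ : PredG → L₂.EdgePred
  Part₂ P x = Σ (Fin (E G)) λ e → On₂ e x × P e

  Joined₁ : PredG → Set
  Joined₁ P = Reach G₁ (Part₁ P) s₁ t₁
  Joined₂ : PredG → Set
  Joined₂ P = Reach G₂ (Part₂ P) s₂ t₂

  -- d₁ stands in for a path of P through G₂.
  Res₁ : PredG → L₁.EdgePred
  Res₁ P x = Part₁ P x ⊎ (x ≡ d₁ × Joined₂ P)
  Res₂ : PredG → L₂.EdgePred
  Res₂ P x = Part₂ P x ⊎ (x ≡ d₂ × Joined₁ P)

  record GlueData : Set where
    field
      x₂ y₂ : Fin (V G₂)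
      gx : φ₁ s₁ ≡ φ₂ x₂
      gy : φ₁ t₁ ≡ φ₂ y₂
      xy : (x₂ ≡ s₂ × y₂ ≡ t₂) ⊎ (x₂ ≡ t₂ × y₂ ≡ s₂)

  glueData : GlueData
  glueData with glue
  ... | inj₁ (a , b) = record { x₂ = s₂ ; y₂ = t₂ ; gx = a ; gy = b ; xy = inj₁ (refl , refl) }
  ... | inj₂ (a , b) = record { x₂ = t₂ ; y₂ = s₂ ; gx = a ; gy = b ; xy = inj₂ (refl , refl) }
  open GlueData glueData public

  joined₂-glued : ∀ {Q} → Reach G₂ Q s₂ t₂ → Reach G₂ Q x₂ y₂
  joined₂-glued r with xy
  ... | inj₁ (a , b) = subst₂ (Reach G₂ _) (sym a) (sym b) r
  ... | inj₂ (a , b) = subst₂ (Reach G₂ _) (sym a) (sym b) (L₂.reach-sym r)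

  joined₂-glued⁻ : ∀ {Q} → Reach G₂ Q x₂ y₂ → Reach G₂ Q s₂ t₂
  joined₂-glued⁻ r with xy
  ... | inj₁ (a , b) = subst₂ (Reach G₂ _) a b r
  ... | inj₂ (a , b) = L₂.reach-sym (subst₂ (Reach G₂ _) a b r)

  mapJ₁ : ∀ {x v w e} → Joins G₁ x v w → Joins G e (φ₁ (src G₁ x)) (φ₁ (tgt G₁ x)) → Joins G e (φ₁ v) (φ₁ w)
  mapJ₁ (inj₁ (refl , refl)) j = j
  mapJ₁ (inj₂ (refl , refl)) j = L.joins-sym j
  mapJ₂ : ∀ {x v w e} → Joins G₂ x v w → Joins G e (φ₂ (src G₂ x)) (φ₂ (tgt G₂ x)) → Joins G e (φ₂ v) (φ₂ w)
  mapJ₂ (inj₁ (refl , refl)) j = j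
  mapJ₂ (inj₂ (refl , refl)) j = L.joins-sym j

  lift₂ : ∀ {P u v} → Reach G₂ (Part₂ P) u v → Reach G P (φ₂ u) (φ₂ v)
  lift₂ here = here
  lift₂ (step x (e , sd , p) j r) = step e p (mapJ₂ j (ends₂ sd)) (lift₂ r)

  glue-reach : ∀ {P} → Joined₂ P → Reach G P (φ₁ s₁) (φ₁ t₁)
  glue-reach r = subst₂ (Reach G _) (sym gx) (sym gy) (lift₂ (joined₂-glued r))

  lift₁ : ∀ {P u v} → Reach G₁ (Res₁ P) u v → Reach G P (φ₁ u) (φ₁ v)
  lift₁ here = here
  lift₁ (step x (inj₁ (e , sd , p)) j r) = step e p (mapJ₁ j (ends₁ sd)) (lift₁ r)
  lift₁ {P} (step x (inj₂ (refl , r2)) j r) with L₁.joins-unique j (L₁.joins-self d₁)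
  ... | inj₁ (refl , refl) = L.reach-trans (lift₁ r) (glue-reach r2)
  ... | inj₂ (refl , refl) = L.reach-trans (lift₁ r) (L.reach-sym (glue-reach r2))

  -- A walk of G from φ₁ a is pulled back to G₁ edge by edge; while it is inside G₂ we
  -- remember through which end of d₁ it left G₁.
  module Descend (P : PredG) where
    R₁ = Reach G₁ (Res₁ P)
    R₂ = Reach G₂ (Part₂ P)
    Invariant : Fin (V G₁) → Fin (V G) → Set
    Invariant a w = (∀ c → φ₁ c ≡ w → R₁ a c)
            × (∀ c → φ₂ c ≡ w → (R₁ a s₁ × R₂ x₂ c) ⊎ (R₁ a t₁ × R₂ y₂ c))

    joined-via-d₁ : ∀ {a} → R₂ y₂ x₂ → R₁ a t₁ → R₁ a s₁
    joined-via-d₁ q r = L₁.reach-trans r (L₁.reach-edge (inj₂ (refl , joined₂-glued⁻ (L₂.reach-sym q))) (L₁.joins-sym (L₁.joins-self d₁)))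
    joined-via-d₁′ : ∀ {a} → R₂ y₂ x₂ → R₁ a s₁ → R₁ a t₁
    joined-via-d₁′ q r = L₁.reach-trans r (L₁.reach-edge (inj₂ (refl , joined₂-glued⁻ (L₂.reach-sym q))) (L₁.joins-self d₁))

    invariant-side₁ : ∀ {a t w} → R₁ a t → w ≡ φ₁ t → Invariant a w
    invariant-side₁ {a} {t} r refl = c1 , c2
      where
      c1 : ∀ c → φ₁ c ≡ φ₁ t → R₁ a c
      c1 c eq = subst (R₁ a) (sym (φ₁-inj eq)) r
      c2 : ∀ c → φ₂ c ≡ φ₁ t → (R₁ a s₁ × R₂ x₂ c) ⊎ (R₁ a t₁ × R₂ y₂ c)
      c2 c eq with only₁ t c (sym eq)
      ... | inj₁ refl = inj₁ (r , subst (R₂ x₂) (φ₂-inj (trans (sym gx) (sym eq))) here)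
      ... | inj₂ refl = inj₂ (r , subst (R₂ y₂) (φ₂-inj (trans (sym gy) (sym eq))) here)

    invariant-side₂ : ∀ {a t w} → (R₁ a s₁ × R₂ x₂ t) ⊎ (R₁ a t₁ × R₂ y₂ t) → w ≡ φ₂ t → Invariant a w
    invariant-side₂ {a} {t} h refl = c1 , c2
      where
      c2 : ∀ c → φ₂ c ≡ φ₂ t → (R₁ a s₁ × R₂ x₂ c) ⊎ (R₁ a t₁ × R₂ y₂ c)
      c2 c eq rewrite φ₂-inj eq = h
      fromS : t ≡ x₂ → (R₁ a s₁ × R₂ x₂ t) ⊎ (R₁ a t₁ × R₂ y₂ t) → R₁ a s₁
      fromS e (inj₁ (r , _)) = r
      fromS e (inj₂ (r , q)) = joined-via-d₁ (subst (R₂ y₂) e q) r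
      fromT : t ≡ y₂ → (R₁ a s₁ × R₂ x₂ t) ⊎ (R₁ a t₁ × R₂ y₂ t) → R₁ a t₁
      fromT e (inj₂ (r , _)) = r
      fromT e (inj₁ (r , q)) = joined-via-d₁′ (L₂.reach-sym (subst (R₂ x₂) e q)) r
      c1 : ∀ c → φ₁ c ≡ φ₂ t → R₁ a c
      c1 c eq with only₁ c t eq
      ... | inj₁ refl = fromS (φ₂-inj (trans (sym eq) gx)) h
      ... | inj₂ refl = fromT (φ₂-inj (trans (sym eq) gy)) h

    invariant-step : ∀ {a v w e} → Invariant a v → P e → Joins G e v w → Invariant a w
    invariant-step {a} {v} {w} {e} (i1 , i2) p j with side e
    ... | inj₁ (x , sd) with L.joins-unique j (ends₁ sd)
    ...   | inj₁ (ev , ew) = invariant-side₁ (L₁.reach-trans (i1 _ (sym ev)) (L₁.reach-edge (inj₁ (e , sd , p)) (L₁.joins-self x))) ew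
    ...   | inj₂ (ev , ew) = invariant-side₁ (L₁.reach-trans (i1 _ (sym ev)) (L₁.reach-edge (inj₁ (e , sd , p)) (L₁.joins-sym (L₁.joins-self x)))) ew
    invariant-step {a} {v} {w} {e} (i1 , i2) p j | inj₂ (x , sd) with L.joins-unique j (ends₂ sd)
    ...   | inj₁ (ev , ew) = invariant-side₂ (ext (i2 _ (sym ev)) (L₂.joins-self x)) ew
      where ext : ∀ {c c'} → (R₁ a s₁ × R₂ x₂ c) ⊎ (R₁ a t₁ × R₂ y₂ c) → Joins G₂ x c c' → (R₁ a s₁ × R₂ x₂ c') ⊎ (R₁ a t₁ × R₂ y₂ c')
            ext (inj₁ (r , q)) jj = inj₁ (r , L₂.reach-trans q (L₂.reach-edge (e , sd , p) jj))
            ext (inj₂ (r , q)) jj = inj₂ (r , L₂.reach-trans q (L₂.reach-edge (e , sd , p) jj))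
    ...   | inj₂ (ev , ew) = invariant-side₂ (ext (i2 _ (sym ev)) (L₂.joins-sym (L₂.joins-self x))) ew
      where ext : ∀ {c c'} → (R₁ a s₁ × R₂ x₂ c) ⊎ (R₁ a t₁ × R₂ y₂ c) → Joins G₂ x c c' → (R₁ a s₁ × R₂ x₂ c') ⊎ (R₁ a t₁ × R₂ y₂ c')
            ext (inj₁ (r , q)) jj = inj₁ (r , L₂.reach-trans q (L₂.reach-edge (e , sd , p) jj))
            ext (inj₂ (r , q)) jj = inj₂ (r , L₂.reach-trans q (L₂.reach-edge (e , sd , p) jj))

    walk-invariant : ∀ {a w} → Reach G P (φ₁ a) w → Invariant a w
    walk-invariant here = invariant-side₁ here refl
    walk-invariant (step e p j r) = invariant-step (walk-invariant r) p j

    down₁ : ∀ {a b} → Reach G P (φ₁ a) (φ₁ b) → R₁ a b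
    down₁ r = proj₁ (walk-invariant r) _ refl

  down₁ : ∀ {P a b} → Reach G P (φ₁ a) (φ₁ b) → Reach G₁ (Res₁ P) a b
  down₁ {P} = Descend.down₁ P

  orient₁ : ∀ {P g x} → On₁ g x → Reach G P (src G g) (tgt G g) → Reach G P (φ₁ (src G₁ x)) (φ₁ (tgt G₁ x))
  orient₁ sd r with L.joins-unique (ends₁ sd) (L.joins-self _)
  ... | inj₁ (a , b) = subst₂ (Reach G _) (sym a) (sym b) r
  ... | inj₂ (a , b) = subst₂ (Reach G _) (sym a) (sym b) (L.reach-sym r)
  orient₁⁻ : ∀ {P g x} → On₁ g x → Reach G P (φ₁ (src G₁ x)) (φ₁ (tgt G₁ x)) → Reach G P (src G g) (tgt G g)
  orient₁⁻ sd r with L.joins-unique (ends₁ sd) (L.joins-self _)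
  ... | inj₁ (a , b) = subst₂ (Reach G _) a b r
  ... | inj₂ (a , b) = L.reach-sym (subst₂ (Reach G _) a b r)

  Joined₂-mono : ∀ {P P' : PredG} → (∀ e x → On₂ e x → P e → P' e) → Joined₂ P → Joined₂ P'
  Joined₂-mono f = L₂.reach-mono (λ x (e , sd , p) → e , sd , f e x sd p)

  Res₁-Minus⇒ : ∀ {X g x h} → On₁ g x → Res₁ (L.Minus X g) h → L₁.Minus (Res₁ X) x h
  Res₁-Minus⇒ sd (inj₁ (e , sd' , (Xe , ne))) = inj₁ (e , sd' , Xe) , λ eq → ne (On₁-injective sd' (subst (On₁ _) (sym eq) sd))
  Res₁-Minus⇒ sd (inj₂ (refl , r)) = inj₂ (refl , Joined₂-mono (λ e x _ → proj₁) r) , λ eq → avoid₁ _ (subst (On₁ _) (sym eq) sd)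

  Res₁-Minus⇐ : ∀ {X g x h} → On₁ g x → L₁.Minus (Res₁ X) x h → Res₁ (L.Minus X g) h
  Res₁-Minus⇐ sd (inj₁ (e , sd' , Xe) , ne) = inj₁ (e , sd' , Xe , λ eq → ne (On₁-functional (subst (λ z → On₁ z _) eq sd') sd))
  Res₁-Minus⇐ sd (inj₂ (refl , r) , ne) = inj₂ (refl , Joined₂-mono (λ e x sd2 Xe → Xe , λ eq → On₁₂-disjoint (subst (λ z → On₁ z _) (sym eq) sd) sd2) r)

  module Trees (X : PredG) where
    forest-side : L₁.Forest (Res₁ X) → ∀ {g x} → On₁ g x → X g → ¬ Reach G (L.Minus X g) (src G g) (tgt G g)
    forest-side fo {g} {x} sd Xg r = fo x (inj₁ (g , sd , Xg)) (L₁.reach-mono (λ h → Res₁-Minus⇒ sd) (down₁ (orient₁ sd r)))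

    forest-Part₁ : L.Forest X → ∀ x → Part₁ X x → ¬ Reach G₁ (L₁.Minus (Res₁ X) x) (src G₁ x) (tgt G₁ x)
    forest-Part₁ fo x (g , sd , Xg) r = fo g Xg (orient₁⁻ sd (lift₁ (L₁.reach-mono (λ h → Res₁-Minus⇐ sd) r)))

    ¬both-joined : L.Forest X → Joined₁ X → Joined₂ X → ⊥
    ¬both-joined fo r1 r2 with L₁.cycle-other-edge {Res₁ X} {d₁} (inj₂ (refl , r2))
                              (L₁.reach-mono (λ h (e , sd , Xe) → inj₁ (e , sd , Xe) , λ eq → avoid₁ e (subst (On₁ e) eq sd)) r1)
    ... | g , ne , inj₁ dg , r = forest-Part₁ fo g dg r
    ... | g , ne , inj₂ (eq , _) , r = ne eq

    tree-res : L.Tree X → L₁.Tree (Res₁ X)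
    tree-res (co , fo) = (λ a b → down₁ (co (φ₁ a) (φ₁ b))) , fo'
      where
      fo' : L₁.Forest (Res₁ X)
      fo' x (inj₁ dx) r = forest-Part₁ fo x dx r
      fo' x (inj₂ (refl , r2)) r = ¬both-joined fo (L₁.reach-mono f r) r2
        where f : ∀ h → L₁.Minus (Res₁ X) d₁ h → Part₁ X h
              f h (inj₁ dh , ne) = dh
              f h (inj₂ (eq , _) , ne) = ⊥-elim (ne eq)

    joined₁-unless-joined₂ : L.Connected X → ¬ Joined₂ X → Joined₁ X
    joined₁-unless-joined₂ co nr2 = L₁.reach-mono f (down₁ (co (φ₁ s₁) (φ₁ t₁)))
      where f : ∀ h → Res₁ X h → Part₁ X h
            f h (inj₁ dh) = dh
            f h (inj₂ (_ , r2)) = ⊥-elim (nr2 r2)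

    reach-glued-end : L₁.Connected (Res₁ X) → ∀ a → Reach G X (φ₁ a) (φ₁ s₁)
    reach-glued-end co a = lift₁ (co a s₁)

  module Decidability (X : PredG) (X? : Decidable X) where
    Part₁? : Decidable (Part₁ X)
    Part₁? x with x ≟ d₁
    ... | yes refl = no (λ (e , sd , _) → avoid₁ e sd)
    ... | no ne with surj₁ x ne
    ...   | e , sd with X? e
    ...     | yes p = yes (e , sd , p)
    ...     | no np = no (λ (e' , sd' , p') → np (subst X (On₁-injective sd' sd) p'))
    Part₂? : Decidable (Part₂ X)
    Part₂? x with x ≟ d₂
    ... | yes refl = no (λ (e , sd , _) → avoid₂ e sd)
    ... | no ne with surj₂ x ne
    ...   | e , sd with X? e
    ...     | yes p = yes (e , sd , p)
    ...     | no np = no (λ (e' , sd' , p') → np (subst X (On₂-injective sd' sd) p'))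
    Joined₂? : Dec (Joined₂ X)
    Joined₂? = L₂.DecReach.reach? (Part₂ X) Part₂? s₂ t₂
    Joined₁? : Dec (Joined₁ X)
    Joined₁? = L₁.DecReach.reach? (Part₁ X) Part₁? s₁ t₁
    Res₁? : Decidable (Res₁ X)
    Res₁? x = Part₁? x ⊎-dec (x ≟ d₁ ×-dec Joined₂?)

  reach-ends₁⇒ : ∀ {P g x} → On₁ g x → Reach G P (src G g) (tgt G g) → Reach G₁ (Res₁ P) (src G₁ x) (tgt G₁ x)
  reach-ends₁⇒ sd r = down₁ (orient₁ sd r)
  reach-ends₁⇐ : ∀ {P g x} → On₁ g x → Reach G₁ (Res₁ P) (src G₁ x) (tgt G₁ x) → Reach G P (src G g) (tgt G g)
  reach-ends₁⇐ sd r = orient₁⁻ sd (lift₁ r)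

  Res₁-Plus⇒ : ∀ {Y e e1 h} → On₁ e e1 → Res₁ (L.Plus Y e) h → L₁.Plus (Res₁ Y) e1 h
  Res₁-Plus⇒ sde (inj₁ (e' , sd' , inj₁ Ye')) = inj₁ (inj₁ (e' , sd' , Ye'))
  Res₁-Plus⇒ sde (inj₁ (e' , sd' , inj₂ eq)) = inj₂ (On₁-functional (subst (λ z → On₁ z _) eq sd') sde)
  Res₁-Plus⇒ {Y} {e} sde (inj₂ (refl , r)) = inj₁ (inj₂ (refl , Joined₂-mono back r))
    where back : ∀ e' x → On₂ e' x → L.Plus Y e e' → Y e'
          back e' x sd2 (inj₁ y) = y
          back e' x sd2 (inj₂ eq) = ⊥-elim (On₁₂-disjoint (subst (λ z → On₁ z _) (sym eq) sde) sd2)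

  Res₁-Plus⇐ : ∀ {Y e e1 h} → On₁ e e1 → L₁.Plus (Res₁ Y) e1 h → Res₁ (L.Plus Y e) h
  Res₁-Plus⇐ sde (inj₁ (inj₁ (e' , sd' , Ye'))) = inj₁ (e' , sd' , inj₁ Ye')
  Res₁-Plus⇐ sde (inj₁ (inj₂ (refl , r))) = inj₂ (refl , Joined₂-mono (λ _ _ _ → inj₁) r)
  Res₁-Plus⇐ {e = e} sde (inj₂ refl) = inj₁ (e , sde , inj₂ refl)

  module Transfer₁ (X Y : PredG) {e e1} (sde : On₁ e e1) {g g1} (sdg : On₁ g g1) where
    InCut⇒ : L.InCut X e g → L₁.InCut (Res₁ X) e1 g1
    InCut⇒ n r1 = n (reach-ends₁⇐ sdg (L₁.reach-mono (λ h → Res₁-Minus⇐ sde) r1))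
    InCut⇐ : L₁.InCut (Res₁ X) e1 g1 → L.InCut X e g
    InCut⇐ n r = n (L₁.reach-mono (λ h → Res₁-Minus⇒ sde) (reach-ends₁⇒ sdg r))
    InCycle⇒ : L.InCycle Y e g → L₁.InCycle (Res₁ Y) e1 g1
    InCycle⇒ (p , r) = pp p , L₁.reach-mono (λ h q → let (a , b) = Res₁-Minus⇒ sdg q in Res₁-Plus⇒ sde a , b) (reach-ends₁⇒ sdg r)
      where pp : L.Plus Y e g → L₁.Plus (Res₁ Y) e1 g1
            pp (inj₁ Yg) = inj₁ (inj₁ (g , sdg , Yg))
            pp (inj₂ eq) = inj₂ (On₁-functional (subst (λ z → On₁ z _) eq sdg) sde)
    InCycle⇐ : L₁.InCycle (Res₁ Y) e1 g1 → L.InCycle Y e g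
    InCycle⇐ (p , r) = pp p , reach-ends₁⇐ sdg (L₁.reach-mono (λ h (a , b) → Res₁-Minus⇐ sdg (Res₁-Plus⇐ sde a , b)) r)
      where pp : L₁.Plus (Res₁ Y) e1 g1 → L.Plus Y e g
            pp (inj₁ (inj₁ (g' , sd' , Yg'))) = inj₁ (subst Y (On₁-injective sd' sdg) Yg')
            pp (inj₁ (inj₂ (eq , _))) = ⊥-elim (avoid₁ g (subst (On₁ g) eq sdg))
            pp (inj₂ eq) = inj₂ (On₁-injective sdg (subst (On₁ e) (sym eq) sde))

module Gluing {G G₁ G₂ d₁ d₂} (cs : CliqueSum G G₁ G₂ d₁ d₂) where
  module S = Restriction cs
  module S' = Restriction (swapSides cs)
  open CliqueSum cs
  module L = GraphProperties G
  module L₁ = GraphProperties G₁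
  module L₂ = GraphProperties G₂
  open S using (PredG; Res₁; Res₂; Part₁; Part₂; Joined₁; Joined₂; s₁; t₁; s₂; t₂)

  tree-glue : ∀ {X} → L₁.Tree (Res₁ X) → L₂.Tree (Res₂ X) → L.Tree X
  tree-glue {X} (c1 , f1) (c2 , f2) = (λ u v → L.reach-trans (hub u) (L.reach-sym (hub v))) , fo
    where
    hub : ∀ v → Reach G X v (φ₁ s₁)
    hub v with cover v
    ... | inj₁ (a , refl) = S.Trees.reach-glued-end X c1 a
    ... | inj₂ (b , refl) with glue
    ...   | inj₁ (ga , _) = subst (Reach G X (φ₂ b)) (sym ga) (S'.Trees.reach-glued-end X c2 b)
    ...   | inj₂ (_ , gb) = L.reach-trans (subst (Reach G X (φ₂ b)) (sym gb) (S'.Trees.reach-glued-end X c2 b)) (S.Trees.reach-glued-end X c1 t₁)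
    fo : L.Forest X
    fo g Xg r with side g
    ... | inj₁ (x , sd) = S.Trees.forest-side X f1 sd Xg r
    ... | inj₂ (x , sd) = S'.Trees.forest-side X f2 sd Xg r

  module ExchangeAcross (X Y : PredG) (X? : Decidable X) (Y? : Decidable Y) (tX : L.Tree X) (tY : L.Tree Y)
             (¬d₁-in-both : ¬ (Res₁ X d₁ × Res₁ Y d₁)) (¬d₂-in-both : ¬ (Res₂ X d₂ × Res₂ Y d₂))
             {e e1} (sde : On₁ e e1) where
    tree-res₂X : L₂.Tree (Res₂ X)
    tree-res₂X = S'.Trees.tree-res X tX
    tree-res₂Y : L₂.Tree (Res₂ Y)
    tree-res₂Y = S'.Trees.tree-res Y tY

    DC : Fin (E G) → Set
    DC g = L.InCut X e g × L.InCycle Y e g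
    DC₁ : Fin (E G₁) → Set
    DC₁ g1 = L₁.InCut (Res₁ X) e1 g1 × L₁.InCycle (Res₁ Y) e1 g1
    DC₂ : Fin (E G₂) → Set
    DC₂ g2 = L₂.InCut (Res₂ X) d₂ g2 × L₂.InCycle (Res₂ Y) d₂ g2

    -- The fundamental cycle of e in Y runs through the glued vertices; it splits into a
    -- cycle through d₁ in G₁ and a cycle through d₂ and g in G₂.
    module OnSide₂ {g g2} (sdg : On₂ g g2) where
      g≢e : g ≢ e
      g≢e eq = On₁₂-disjoint (subst (λ z → On₁ z _) (sym eq) sde) sdg

      ≢e : ∀ {h y} → On₂ h y → h ≢ e
      ≢e sd eq = On₁₂-disjoint (subst (λ z → On₁ z _) (sym eq) sde) sd

      cut-side₂ : L.InCut X e g → ¬ Reach G₂ (Res₂ (L.Minus X e)) (src G₂ g2) (tgt G₂ g2)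
      cut-side₂ n r = n (S'.reach-ends₁⇐ sdg r)

      Part₂-Minus : ∀ h → Part₂ X h → Part₂ (L.Minus X e) h
      Part₂-Minus h (e' , sd' , Xe') = e' , sd' , Xe' , ≢e sd'

      InCut⇒ : L.InCut X e g → L₁.InCut (Res₁ X) e1 d₁ × L₂.InCut (Res₂ X) d₂ g2
      InCut⇒ n = first , second
        where
        first : L₁.InCut (Res₁ X) e1 d₁
        first r with S.Decidability.Joined₂? X X?
        ... | yes r2 = cut-side₂ n (L₂.reach-mono f (proj₁ tree-res₂X _ _))
          where f : ∀ h → Res₂ X h → Res₂ (L.Minus X e) h
                f h (inj₁ dx) = inj₁ (Part₂-Minus h dx)
                f h (inj₂ (_ , r1)) = ⊥-elim (S.Trees.¬both-joined X (proj₂ tX) r1 r2)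
        ... | no nr2 = cut-side₂ n (L₂.reach-mono f (proj₁ tree-res₂X _ _))
          where k : ∀ h → L₁.Minus (Res₁ X) e1 h → Part₁ (L.Minus X e) h
                k h (inj₁ (e' , sd' , Xe') , ne) = e' , sd' , Xe' , λ eq → ne (On₁-functional (subst (λ z → On₁ z _) eq sd') sde)
                k h (inj₂ (_ , r2) , _) = ⊥-elim (nr2 r2)
                f : ∀ h → Res₂ X h → Res₂ (L.Minus X e) h
                f h (inj₁ dx) = inj₁ (Part₂-Minus h dx)
                f h (inj₂ (eq , _)) = inj₂ (eq , L₁.reach-mono k r)
        second : L₂.InCut (Res₂ X) d₂ g2
        second r = cut-side₂ n (L₂.reach-mono f r)
          where f : ∀ h → L₂.Minus (Res₂ X) d₂ h → Res₂ (L.Minus X e) h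
                f h (inj₁ dx , ne) = inj₁ (Part₂-Minus h dx)
                f h (inj₂ (eq , _) , ne) = ⊥-elim (ne eq)

      InCut⇐ : L₁.InCut (Res₁ X) e1 d₁ → L₂.InCut (Res₂ X) d₂ g2 → L.InCut X e g
      InCut⇐ n1 n2 r = n2 (L₂.reach-mono f (S'.reach-ends₁⇒ sdg r))
        where
        k : ∀ h → Part₁ (L.Minus X e) h → L₁.Minus (Res₁ X) e1 h
        k h (e' , sd' , Xe' , ne) = inj₁ (e' , sd' , Xe') , λ eq → ne (On₁-injective sd' (subst (On₁ e) (sym eq) sde))
        f : ∀ h → Res₂ (L.Minus X e) h → L₂.Minus (Res₂ X) d₂ h
        f h (inj₁ (e' , sd' , Xe' , _)) = inj₁ (e' , sd' , Xe') , λ eq → avoid₂ e' (subst (On₂ e') eq sd')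
        f h (inj₂ (eq , K)) = ⊥-elim (n1 (L₁.reach-mono k K))

      YE = L.Minus (L.Plus Y e) g
      YE? : Decidable YE
      YE? h = (Y? h ⊎-dec (h ≟ e)) ×-dec ¬? (h ≟ g)

      InCycle⇒ : L.InCycle Y e g → L₁.InCycle (Res₁ Y) e1 d₁ × L₂.InCycle (Res₂ Y) d₂ g2
      InCycle⇒ (p , r) = cycle₁ , cycle₂
        where
        getY : L.Plus Y e g → Y g
        getY (inj₁ y) = y
        getY (inj₂ eq) = ⊥-elim (g≢e eq)
        Yg : Y g
        Yg = getY p
        r' : Reach G₂ (Res₂ YE) (src G₂ g2) (tgt G₂ g2)
        r' = S'.reach-ends₁⇒ sdg r
        Res₂Yg2 : Res₂ Y g2
        Res₂Yg2 = inj₁ (g , sdg , Yg)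
        toMin : (Joined₁ YE → Res₂ Y d₂) → ∀ h → Res₂ YE h → L₂.Minus (Res₂ Y) g2 h
        toMin hd h (inj₁ (e' , sd' , inj₁ Ye' , ne)) = inj₁ (e' , sd' , Ye') , λ eq → ne (On₂-injective sd' (subst (On₂ g) (sym eq) sdg))
        toMin hd h (inj₁ (e' , sd' , inj₂ eq , _)) = ⊥-elim (≢e sd' eq)
        toMin hd h (inj₂ (refl , m)) = hd m , λ eq → avoid₂ g (subst (On₂ g) (sym eq) sdg)
        contra : (Joined₁ YE → Res₂ Y d₂) → ⊥
        contra hd = proj₂ tree-res₂Y g2 Res₂Yg2 (L₂.reach-mono (toMin hd) r')
        joined₂Y : Joined₂ Y
        joined₂Y with S.Decidability.Joined₂? Y Y?
        ... | yes r2 = r2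
        ... | no nr2 = ⊥-elim (contra (λ _ → inj₂ (refl , S.Trees.joined₁-unless-joined₂ Y (proj₁ tY) nr2)))
        M : Joined₁ YE
        M with S.Decidability.Joined₁? YE YE?
        ... | yes m = m
        ... | no nm = ⊥-elim (contra (λ m → ⊥-elim (nm m)))
        m1 : ∀ h → Part₁ YE h → L₁.Minus (L₁.Plus (Res₁ Y) e1) d₁ h
        m1 h (e' , sd' , inj₁ Ye' , _) = inj₁ (inj₁ (e' , sd' , Ye')) , λ eq → avoid₁ e' (subst (On₁ e') eq sd')
        m1 h (e' , sd' , inj₂ eq , _) = inj₂ (On₁-functional (subst (λ z → On₁ z _) eq sd') sde) , λ eq2 → avoid₁ e' (subst (On₁ e') eq2 sd')
        cycle₁ : L₁.InCycle (Res₁ Y) e1 d₁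
        cycle₁ = inj₁ (inj₂ (refl , joined₂Y)) , L₁.reach-mono m1 M
        m2 : ∀ h → Res₂ YE h → L₂.Minus (L₂.Plus (Res₂ Y) d₂) g2 h
        m2 h (inj₁ (e' , sd' , inj₁ Ye' , ne)) = inj₁ (inj₁ (e' , sd' , Ye')) , λ eq → ne (On₂-injective sd' (subst (On₂ g) (sym eq) sdg))
        m2 h (inj₁ (e' , sd' , inj₂ eq , _)) = ⊥-elim (≢e sd' eq)
        m2 h (inj₂ (refl , _)) = inj₂ refl , λ eq → avoid₂ g (subst (On₂ g) (sym eq) sdg)
        cycle₂ : L₂.InCycle (Res₂ Y) d₂ g2
        cycle₂ = inj₁ Res₂Yg2 , L₂.reach-mono m2 r'

      InCycle⇐ : L₁.InCycle (Res₁ Y) e1 d₁ → L₂.InCycle (Res₂ Y) d₂ g2 → L.InCycle Y e g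
      InCycle⇐ (p1 , r1) (p2 , r2) = inj₁ Yg , S'.reach-ends₁⇐ sdg (L₂.reach-mono m r2)
        where
        getY : L₂.Plus (Res₂ Y) d₂ g2 → Y g
        getY (inj₁ (inj₁ (g' , sd' , Yg'))) = subst Y (On₂-injective sd' sdg) Yg'
        getY (inj₁ (inj₂ (eq , _))) = ⊥-elim (avoid₂ g (subst (On₂ g) eq sdg))
        getY (inj₂ eq) = ⊥-elim (avoid₂ g (subst (On₂ g) eq sdg))
        Yg : Y g
        Yg = getY p2
        k : ∀ h → L₁.Minus (L₁.Plus (Res₁ Y) e1) d₁ h → Part₁ YE h
        k h (inj₁ (inj₁ (e' , sd' , Ye')) , _) = e' , sd' , inj₁ Ye' , λ eq → On₁₂-disjoint (subst (λ z → On₁ z _) eq sd') sdg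
        k h (inj₁ (inj₂ (eq , _)) , ne) = ⊥-elim (ne eq)
        k h (inj₂ refl , _) = e , sde , inj₂ refl , λ eq → g≢e (sym eq)
        M : Joined₁ YE
        M = L₁.reach-mono k r1
        m : ∀ h → L₂.Minus (L₂.Plus (Res₂ Y) d₂) g2 h → Res₂ YE h
        m h (inj₁ (inj₁ (e' , sd' , Ye')) , ne) = inj₁ (e' , sd' , inj₁ Ye' , λ eq → ne (On₂-functional (subst (λ z → On₂ z _) eq sd') sdg))
        m h (inj₁ (inj₂ (refl , _)) , _) = inj₂ (refl , M)
        m h (inj₂ refl , _) = inj₂ (refl , M)

      DC⇒ : DC g → DC₁ d₁ × DC₂ g2
      DC⇒ (a , b) = let (a1 , a2) = InCut⇒ a ; (b1 , b2) = InCycle⇒ b in (a1 , b1) , (a2 , b2)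
      DC⇐ : DC₁ d₁ → DC₂ g2 → DC g
      DC⇐ (a1 , b1) (a2 , b2) = InCut⇐ a1 a2 , InCycle⇐ b1 b2

    DC₂-d₂ : Res₂ X d₂ → DC₂ d₂
    DC₂-d₂ q = proj₂ tree-res₂X d₂ q , (inj₂ refl , L₂.reach-mono (λ h qy → inj₁ qy , λ eq → ¬d₂-in-both (q , subst (Res₂ Y) eq qy)) (proj₁ tree-res₂Y s₂ t₂))

    Res₂X? : Decidable (Res₂ X)
    Res₂X? = S'.Decidability.Res₁? X X?

    -- The fundamental cycle of d₂ in Res₂ Y crosses the cut of d₂ in Res₂ X a second time.
    DC₂-other-edge : Res₂ X d₂ → Σ (Fin (E G₂)) λ g2 → g2 ≢ d₂ × DC₂ g2
    DC₂-other-edge q = g2 , ne , g2-in-cut , L₂.cycleThrough⇒InCycle {Res₂ Y} {d₂} {g2} (c , j , ejg)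
      where
      P = L₂.Plus (Res₂ Y) d₂
      r0 : Reach G₂ (L₂.Minus P d₂) s₂ t₂
      r0 = L₂.reach-mono (λ h qy → inj₁ qy , λ eq → ¬d₂-in-both (q , subst (Res₂ Y) eq qy)) (proj₁ tree-res₂Y s₂ t₂)
      cyc = L₂.bypass⇒cycle P d₂ (inj₂ refl) r0
      c = proj₁ cyc
      i = proj₁ (proj₂ cyc)
      ei = proj₂ (proj₂ cyc)
      w = L₂.AroundCycle.bypass _ (L₂.cycle-on-itself c) d₂ i ei
      A : Fin (V G₂) → Set
      A v = Reach G₂ (L₂.Minus (Res₂ X) d₂) s₂ v
      A? : Decidable A
      A? v = L₂.DecReach.reach? (L₂.Minus (Res₂ X) d₂) (λ h → Res₂X? h ×-dec ¬? (h ≟ d₂)) s₂ v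
      cr = L₂.crossing-edge A A? w here (proj₂ tree-res₂X d₂ q)
      g2 = proj₁ cr
      a = proj₁ (proj₂ cr)
      b = proj₁ (proj₂ (proj₂ cr))
      Wg = proj₁ (proj₂ (proj₂ (proj₂ cr)))
      j = proj₁ (proj₁ Wg)
      ejg = proj₂ (proj₁ Wg)
      ne = proj₂ Wg
      J = proj₁ (proj₂ (proj₂ (proj₂ (proj₂ cr))))
      Aa = proj₁ (proj₂ (proj₂ (proj₂ (proj₂ (proj₂ cr)))))
      nAb = proj₂ (proj₂ (proj₂ (proj₂ (proj₂ (proj₂ cr)))))
      g2-in-cut : L₂.InCut (Res₂ X) d₂ g2
      g2-in-cut r with L₂.joins-unique J (L₂.joins-self g2)
      ... | inj₁ (e1' , e2') = nAb (L₂.reach-trans Aa (subst₂ (Reach G₂ _) (sym e1') (sym e2') r))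
      ... | inj₂ (e1' , e2') = nAb (L₂.reach-trans Aa (subst₂ (Reach G₂ _) (sym e1') (sym e2') (L₂.reach-sym r)))

    DC₁-d₁⇒Res₂ : DC₁ d₁ → Res₂ X d₂
    DC₁-d₁⇒Res₂ (_ , p , _) = inj₂ (refl , S.Trees.joined₁-unless-joined₂ X (proj₁ tX) (λ r2 → ¬d₁-in-both (inj₂ (refl , r2) , Res₁-Y-d₁ p)))
      where Res₁-Y-d₁ : L₁.Plus (Res₁ Y) e1 d₁ → Res₁ Y d₁
            Res₁-Y-d₁ (inj₁ x) = x
            Res₁-Y-d₁ (inj₂ eq) = ⊥-elim (avoid₁ e (subst (On₁ e) (sym eq) sde))

    module OnSide₁ {g g1} (sdg : On₁ g g1) where
      open S.Transfer₁ X Y sde sdg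
      DC⇒ : DC g → DC₁ g1
      DC⇒ (a , b) = InCut⇒ a , InCycle⇒ b
      DC⇐ : DC₁ g1 → DC g
      DC⇐ (a , b) = InCut⇐ a , InCycle⇐ b

    exactly-same-side : ∀ {f f1} → On₁ f f1 → (Exactly DC e f → Exactly DC₁ e1 f1) × (Exactly DC₁ e1 f1 → Exactly DC e f)
    exactly-same-side {f} {f1} sdf = ⇒ , ⇐
      where
      ⇒ : Exactly DC e f → Exactly DC₁ e1 f1
      ⇒ H g1 with g1 ≟ d₁
      ... | yes refl = (λ dc → ⊥-elim (noD dc)) , λ { (inj₁ eq) → ⊥-elim (avoid₁ e (subst (On₁ e) (sym eq) sde)) ; (inj₂ eq) → ⊥-elim (avoid₁ f (subst (On₁ f) (sym eq) sdf)) }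
        where noD : DC₁ d₁ → ⊥
              noD dc with DC₂-other-edge (DC₁-d₁⇒Res₂ dc)
              ... | g2 , ne , dc2 with surj₂ g2 ne
              ...   | g , sdg with proj₁ (H g) (OnSide₂.DC⇐ sdg dc dc2)
              ...     | inj₁ eq = On₁₂-disjoint (subst (λ z → On₁ z _) (sym eq) sde) sdg
              ...     | inj₂ eq = On₁₂-disjoint (subst (λ z → On₁ z _) (sym eq) sdf) sdg
      ... | no ne with surj₁ g1 ne
      ...   | g , sdg = (λ dc → Sum.map (λ eq → On₁-functional (subst (λ z → On₁ z _) eq sdg) sde) (λ eq → On₁-functional (subst (λ z → On₁ z _) eq sdg) sdf) (proj₁ (H g) (OnSide₁.DC⇐ sdg dc)))
                    , λ o → OnSide₁.DC⇒ sdg (proj₂ (H g) (Sum.map (λ eq → On₁-injective sdg (subst (On₁ e) (sym eq) sde)) (λ eq → On₁-injective sdg (subst (On₁ f) (sym eq) sdf)) o))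
      ⇐ : Exactly DC₁ e1 f1 → Exactly DC e f
      ⇐ H1 g with side g
      ... | inj₁ (g1 , sdg) = (λ dc → Sum.map (λ eq → On₁-injective sdg (subst (On₁ e) (sym eq) sde)) (λ eq → On₁-injective sdg (subst (On₁ f) (sym eq) sdf)) (proj₁ (H1 g1) (OnSide₁.DC⇒ sdg dc)))
                            , λ o → OnSide₁.DC⇐ sdg (proj₂ (H1 g1) (Sum.map (λ eq → On₁-functional (subst (λ z → On₁ z _) eq sdg) sde) (λ eq → On₁-functional (subst (λ z → On₁ z _) eq sdg) sdf) o))
      ... | inj₂ (g2 , sdg) = (λ dc → ⊥-elim (bad (proj₁ (H1 d₁) (proj₁ (OnSide₂.DC⇒ sdg dc)))))
                            , λ { (inj₁ eq) → ⊥-elim (On₁₂-disjoint (subst (λ z → On₁ z _) (sym eq) sde) sdg) ; (inj₂ eq) → ⊥-elim (On₁₂-disjoint (subst (λ z → On₁ z _) (sym eq) sdf) sdg) }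
        where bad : d₁ ≡ e1 ⊎ d₁ ≡ f1 → ⊥
              bad (inj₁ eq) = avoid₁ e (subst (On₁ e) (sym eq) sde)
              bad (inj₂ eq) = avoid₁ f (subst (On₁ f) (sym eq) sdf)

    exactly-across : ∀ {f f2} → On₂ f f2 → (Exactly DC e f → Exactly DC₁ e1 d₁ × Exactly DC₂ d₂ f2) × (Exactly DC₁ e1 d₁ × Exactly DC₂ d₂ f2 → Exactly DC e f)
    exactly-across {f} {f2} sdf = ⇒ , ⇐
      where
      ⇒ : Exactly DC e f → Exactly DC₁ e1 d₁ × Exactly DC₂ d₂ f2
      ⇒ H = H1 , H2
        where
        dcs = OnSide₂.DC⇒ sdf (proj₂ (H f) (inj₂ refl))
        dc1d = proj₁ dcs
        H1 : Exactly DC₁ e1 d₁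
        H1 g1 with g1 ≟ d₁
        ... | yes refl = (λ _ → inj₂ refl) , λ _ → dc1d
        ... | no ne with surj₁ g1 ne
        ...   | g , sdg = (λ dc → case1 (proj₁ (H g) (OnSide₁.DC⇐ sdg dc)))
                        , λ { (inj₁ eq) → OnSide₁.DC⇒ sdg (proj₂ (H g) (inj₁ (On₁-injective sdg (subst (On₁ e) (sym eq) sde)))) ; (inj₂ eq) → ⊥-elim (ne eq) }
          where case1 : g ≡ e ⊎ g ≡ f → g1 ≡ e1 ⊎ g1 ≡ d₁
                case1 (inj₁ eq) = inj₁ (On₁-functional (subst (λ z → On₁ z _) eq sdg) sde)
                case1 (inj₂ eq) = ⊥-elim (On₁₂-disjoint (subst (λ z → On₁ z _) eq sdg) sdf)
        H2 : Exactly DC₂ d₂ f2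
        H2 g2 with g2 ≟ d₂
        ... | yes refl = (λ _ → inj₁ refl) , λ _ → DC₂-d₂ (DC₁-d₁⇒Res₂ dc1d)
        ... | no ne with surj₂ g2 ne
        ...   | g , sdg = (λ dc → case2 (proj₁ (H g) (OnSide₂.DC⇐ sdg dc1d dc)))
                        , λ { (inj₁ eq) → ⊥-elim (ne eq) ; (inj₂ eq) → proj₂ (OnSide₂.DC⇒ sdg (proj₂ (H g) (inj₂ (On₂-injective sdg (subst (On₂ f) (sym eq) sdf))))) }
          where case2 : g ≡ e ⊎ g ≡ f → g2 ≡ d₂ ⊎ g2 ≡ f2
                case2 (inj₁ eq) = ⊥-elim (On₁₂-disjoint (subst (λ z → On₁ z _) (sym eq) sde) sdg)
                case2 (inj₂ eq) = inj₂ (On₂-functional (subst (λ z → On₂ z _) eq sdg) sdf)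
      ⇐ : Exactly DC₁ e1 d₁ × Exactly DC₂ d₂ f2 → Exactly DC e f
      ⇐ (H1 , H2) g with side g
      ... | inj₁ (g1 , sdg) = (λ dc → c1 (proj₁ (H1 g1) (OnSide₁.DC⇒ sdg dc)))
                            , λ { (inj₁ eq) → OnSide₁.DC⇐ sdg (proj₂ (H1 g1) (inj₁ (On₁-functional (subst (λ z → On₁ z _) eq sdg) sde))) ; (inj₂ eq) → ⊥-elim (On₁₂-disjoint (subst (λ z → On₁ z _) eq sdg) sdf) }
        where c1 : g1 ≡ e1 ⊎ g1 ≡ d₁ → g ≡ e ⊎ g ≡ f
              c1 (inj₁ eq) = inj₁ (On₁-injective sdg (subst (On₁ e) (sym eq) sde))
              c1 (inj₂ eq) = ⊥-elim (avoid₁ g (subst (On₁ g) eq sdg))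
      ... | inj₂ (g2 , sdg) = (λ dc → c2 (proj₁ (H2 g2) (proj₂ (OnSide₂.DC⇒ sdg dc))))
                            , λ { (inj₁ eq) → ⊥-elim (On₁₂-disjoint (subst (λ z → On₁ z _) (sym eq) sde) sdg)
                                ; (inj₂ eq) → OnSide₂.DC⇐ sdg (proj₂ (H1 d₁) (inj₂ refl)) (proj₂ (H2 g2) (inj₂ (On₂-functional (subst (λ z → On₂ z _) eq sdg) sdf))) }
        where c2 : g2 ≡ d₂ ⊎ g2 ≡ f2 → g ≡ e ⊎ g ≡ f
              c2 (inj₁ eq) = ⊥-elim (avoid₂ g (subst (On₂ g) eq sdg))
              c2 (inj₂ eq) = inj₂ (On₂-injective sdg (subst (On₂ f) (sym eq) sdf))

module BispanningSide₁ {G G₁ G₂ d₁ d₂} (cs : CliqueSum G G₁ G₂ d₁ d₂) (b₁ : Bispanning G₁) where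
  open Restriction cs
  -- Otherwise Res₁ X and Res₁ Y would be spanning trees of G₁ covering E₁ and sharing d₁.
  ¬joined₂-both : ∀ {X Y : PredG} → Decidable X → Decidable Y → L.Tree X → L.Tree Y
    → (∀ h → X h ⊎ Y h) → (∀ h → X h → Y h → ⊥) → Joined₂ X → Joined₂ Y → ⊥
  ¬joined₂-both {X} {Y} X? Y? tX tY cv dj r2X r2Y with GraphProperties.bispanning-trees G₁ b₁
  ... | A , B , tA , tB , cAB , dAB =
    L₁.¬cover-sharing-one-edge (_∈? A) (_∈? B) (Decidability.Res₁? X X?) (Decidability.Res₁? Y Y?) tA tB cAB dAB
      (Trees.tree-res X tX) (Trees.tree-res Y tY) cov d₁ (inj₂ (refl , r2X)) (inj₂ (refl , r2Y)) com
    where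
    cov : ∀ h → Res₁ X h ⊎ Res₁ Y h
    cov h with h ≟ d₁
    ... | yes refl = inj₁ (inj₂ (refl , r2X))
    ... | no ne with surj₁ h ne
    ...   | e , sd with cv e
    ...     | inj₁ x = inj₁ (inj₁ (e , sd , x))
    ...     | inj₂ y = inj₂ (inj₁ (e , sd , y))
    com : ∀ h → Res₁ X h → Res₁ Y h → h ≡ d₁
    com h (inj₂ (eq , _)) _ = eq
    com h (inj₁ _) (inj₂ (eq , _)) = eq
    com h (inj₁ (e , sd , x)) (inj₁ (e' , sd' , y)) = ⊥-elim (dj e x (subst Y (On₁-injective sd' sd) y))

module BispanningSide₂ {G G₁ G₂ d₁ d₂} (cs : CliqueSum G G₁ G₂ d₁ d₂) (b₂ : Bispanning G₂) where
  open Restriction cs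
  joined₂-some : ∀ {X Y : PredG} → Decidable X → Decidable Y → L.Tree X → L.Tree Y
    → (∀ h → X h ⊎ Y h) → (∀ h → X h → Y h → ⊥) → Joined₂ X ⊎ Joined₂ Y
  joined₂-some {X} {Y} X? Y? tX tY cv dj with Decidability.Joined₂? X X? | Decidability.Joined₂? Y Y?
  ... | yes r | _ = inj₁ r
  ... | no _ | yes r = inj₂ r
  ... | no nx | no ny = ⊥-elim (BispanningSide₁.¬joined₂-both (swapSides cs) b₂ X? Y? tX tY cv dj
                           (Trees.joined₁-unless-joined₂ X (proj₁ tX) nx) (Trees.joined₁-unless-joined₂ Y (proj₁ tY) ny))

module ResGlue {G G₁ G₂ d₁ d₂} (cs : CliqueSum G G₁ G₂ d₁ d₂) where
  open Restriction cs
  res-glue : ∀ {A₁ A₂ X} → L₁.Tree A₁ → L₂.Tree A₂ → A₁ d₁ → ¬ A₂ d₂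
    → (∀ x → Part₁ X x → A₁ x) → (∀ x → A₁ x → x ≢ d₁ → Part₁ X x)
    → (∀ x → Part₂ X x → A₂ x) → (∀ x → A₂ x → x ≢ d₂ → Part₂ X x)
    → (L₁._⇔P_ (Res₁ X) A₁) × (L₂._⇔P_ (Res₂ X) A₂)
  res-glue {A₁} {A₂} {X} tA1 tA2 a₁ na₂ f1 g1 f2 g2 = (q1⇒ , q1⇐) , (q2⇒ , q2⇐)
    where
    r2 : Joined₂ X
    r2 = L₂.reach-mono (λ h a → g2 h a (λ eq → na₂ (subst A₂ eq a))) (proj₁ tA2 s₂ t₂)
    nr1 : ¬ Joined₁ X
    nr1 r = proj₂ tA1 d₁ a₁ (L₁.reach-mono (λ h dx → f1 h dx , λ eq → avoid₁ (proj₁ dx) (subst (On₁ _) eq (proj₁ (proj₂ dx)))) r)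
    q1⇒ : ∀ h → Res₁ X h → A₁ h
    q1⇒ h (inj₁ dx) = f1 h dx
    q1⇒ h (inj₂ (refl , _)) = a₁
    q1⇐ : ∀ h → A₁ h → Res₁ X h
    q1⇐ h a with h ≟ d₁
    ... | yes refl = inj₂ (refl , r2)
    ... | no ne = inj₁ (g1 h a ne)
    q2⇒ : ∀ h → Res₂ X h → A₂ h
    q2⇒ h (inj₁ dx) = f2 h dx
    q2⇒ h (inj₂ (_ , r1)) = ⊥-elim (nr1 r1)
    q2⇐ : ∀ h → A₂ h → Res₂ X h
    q2⇐ h a = inj₁ (g2 h a (λ eq → na₂ (subst A₂ eq a)))

module SideSubsets {G G₁ G₂ d₁ d₂} (cs : CliqueSum G G₁ G₂ d₁ d₂) (b₁ : Bispanning G₁) (b₂ : Bispanning G₂) where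
  open Restriction cs

  res₁ : Subset (E G) → Subset (E G₁)
  res₁ S = toSubset (Decidability.Res₁? (_∈ S) (_∈? S))

  ∈-res₁⁻ : ∀ {S x} → x ∈ res₁ S → Res₁ (_∈ S) x
  ∈-res₁⁻ {S} = ∈-toSubset⁻ (Decidability.Res₁? (_∈ S) (_∈? S))
  ∈-res₁⁺ : ∀ {S x} → Res₁ (_∈ S) x → x ∈ res₁ S
  ∈-res₁⁺ {S} = ∈-toSubset⁺ (Decidability.Res₁? (_∈ S) (_∈? S))

  res₁-≐ : ∀ S → L₁._⇔P_ (Res₁ (_∈ S)) (_∈ res₁ S)
  res₁-≐ S = (λ h → ∈-res₁⁺) , (λ h → ∈-res₁⁻)

  isPair-res₁ : ∀ {S T} → IsPair G S T → IsPair G₁ (res₁ S) (res₁ T)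
  isPair-res₁ {S} {T} (sS , sT , dj , cv) = GraphProperties.tree⇒spt G₁ (L₁.tree-cong (res₁-≐ S) (Trees.tree-res _ tS))
                                    , GraphProperties.tree⇒spt G₁ (L₁.tree-cong (res₁-≐ T) (Trees.tree-res _ tT)) , dj₁ , cv₁
    where
    tS = GraphProperties.spt⇒tree G sS
    tT = GraphProperties.spt⇒tree G sT
    dj₁ : ∀ x → x ∈ res₁ S → x ∈ res₁ T → ⊥
    dj₁ x m m' with ∈-res₁⁻ {S} m | ∈-res₁⁻ {T} m'
    ... | inj₁ (e , sd , a) | inj₁ (e' , sd' , b) = dj e a (subst (_∈ T) (On₁-injective sd' sd) b)
    ... | inj₁ (e , sd , a) | inj₂ (refl , _) = avoid₁ e sd
    ... | inj₂ (refl , _) | inj₁ (e , sd , b) = avoid₁ e sd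
    ... | inj₂ (_ , r) | inj₂ (_ , r') = BispanningSide₁.¬joined₂-both cs b₁ (_∈? S) (_∈? T) tS tT cv dj r r'
    cv₁ : ∀ x → x ∈ res₁ S ⊎ x ∈ res₁ T
    cv₁ x with x ≟ d₁
    ... | yes refl = Sum.map (λ r → ∈-res₁⁺ {S} (inj₂ (refl , r))) (λ r → ∈-res₁⁺ {T} (inj₂ (refl , r)))
                       (BispanningSide₂.joined₂-some cs b₂ (_∈? S) (_∈? T) tS tT cv dj)
    ... | no ne with surj₁ x ne
    ...   | e , sd = Sum.map (λ a → ∈-res₁⁺ {S} (inj₁ (e , sd , a))) (λ b → ∈-res₁⁺ {T} (inj₁ (e , sd , b))) (cv e)

  InMerge : Subset (E G₁) → Subset (E G₂) → Fin (E G) → Set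
  InMerge A1 A2 e = (Σ (Fin (E G₁)) λ x → On₁ e x × x ∈ A1) ⊎ (Σ (Fin (E G₂)) λ x → On₂ e x × x ∈ A2)

  InMerge? : ∀ A1 A2 → Decidable (InMerge A1 A2)
  InMerge? A1 A2 e with side e
  ... | inj₁ (x , sd) with x ∈? A1
  ...   | yes m = yes (inj₁ (x , sd , m))
  ...   | no n = no λ { (inj₁ (x' , sd' , m')) → n (subst (_∈ A1) (On₁-functional sd' sd) m') ; (inj₂ (x' , sd' , _)) → On₁₂-disjoint sd sd' }
  InMerge? A1 A2 e | inj₂ (x , sd) with x ∈? A2
  ...   | yes m = yes (inj₂ (x , sd , m))
  ...   | no n = no λ { (inj₂ (x' , sd' , m')) → n (subst (_∈ A2) (On₂-functional sd' sd) m') ; (inj₁ (x' , sd' , _)) → On₁₂-disjoint sd' sd }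

  merge : Subset (E G₁) → Subset (E G₂) → Subset (E G)
  merge A1 A2 = toSubset (InMerge? A1 A2)

  ∈-merge⁻ : ∀ {A1 A2 e} → e ∈ merge A1 A2 → InMerge A1 A2 e
  ∈-merge⁻ {A1} {A2} = ∈-toSubset⁻ (InMerge? A1 A2)
  ∈-merge⁺ : ∀ {A1 A2 e} → InMerge A1 A2 e → e ∈ merge A1 A2
  ∈-merge⁺ {A1} {A2} = ∈-toSubset⁺ (InMerge? A1 A2)

  Part₁-merge⁻ : ∀ {A1 A2 x} → Part₁ (_∈ merge A1 A2) x → x ∈ A1
  Part₁-merge⁻ (e , sd , m) with ∈-merge⁻ m
  ... | inj₁ (x' , sd' , m') = subst (_∈ _) (On₁-functional sd' sd) m'
  ... | inj₂ (x' , sd' , _) = ⊥-elim (On₁₂-disjoint sd sd')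
  Part₁-merge⁺ : ∀ {A1 A2 x} → x ∈ A1 → x ≢ d₁ → Part₁ (_∈ merge A1 A2) x
  Part₁-merge⁺ {x = x} m ne with surj₁ x ne
  ... | e , sd = e , sd , ∈-merge⁺ (inj₁ (x , sd , m))
  Part₂-merge⁻ : ∀ {A1 A2 x} → Part₂ (_∈ merge A1 A2) x → x ∈ A2
  Part₂-merge⁻ (e , sd , m) with ∈-merge⁻ m
  ... | inj₂ (x' , sd' , m') = subst (_∈ _) (On₂-functional sd' sd) m'
  ... | inj₁ (x' , sd' , _) = ⊥-elim (On₁₂-disjoint sd' sd)
  Part₂-merge⁺ : ∀ {A1 A2 x} → x ∈ A2 → x ≢ d₂ → Part₂ (_∈ merge A1 A2) x
  Part₂-merge⁺ {x = x} m ne with surj₂ x ne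
  ... | e , sd = e , sd , ∈-merge⁺ (inj₂ (x , sd , m))

  res-merge : ∀ {A1 A2} → SpanningTree G₁ A1 → SpanningTree G₂ A2
    → (d₁ ∈ A1 × d₂ ∉ A2) ⊎ (d₁ ∉ A1 × d₂ ∈ A2)
    → L₁._⇔P_ (Res₁ (_∈ merge A1 A2)) (_∈ A1) × L₂._⇔P_ (Res₂ (_∈ merge A1 A2)) (_∈ A2)
  res-merge {A1} {A2} s1 s2 (inj₁ (a , na)) =
    ResGlue.res-glue cs (GraphProperties.spt⇒tree G₁ s1) (GraphProperties.spt⇒tree G₂ s2) a na (λ x → Part₁-merge⁻) (λ x → Part₁-merge⁺) (λ x → Part₂-merge⁻) (λ x → Part₂-merge⁺)
  res-merge {A1} {A2} s1 s2 (inj₂ (na , a)) with ResGlue.res-glue (swapSides cs) (GraphProperties.spt⇒tree G₂ s2) (GraphProperties.spt⇒tree G₁ s1) a na (λ x → Part₂-merge⁻) (λ x → Part₂-merge⁺) (λ x → Part₁-merge⁻) (λ x → Part₁-merge⁺)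
  ... | p , q = q , p

  spanningTree-merge : ∀ {A1 A2} → SpanningTree G₁ A1 → SpanningTree G₂ A2
    → (d₁ ∈ A1 × d₂ ∉ A2) ⊎ (d₁ ∉ A1 × d₂ ∈ A2) → SpanningTree G (merge A1 A2)
  spanningTree-merge s1 s2 c with res-merge s1 s2 c
  ... | (f1 , g1) , (f2 , g2) = GraphProperties.tree⇒spt G (Gluing.tree-glue cs (L₁.tree-cong (g1 , f1) (GraphProperties.spt⇒tree G₁ s1)) (L₂.tree-cong (g2 , f2) (GraphProperties.spt⇒tree G₂ s2)))

  res₁-On₁⁻ : ∀ {P h x} → On₁ h x → x ∈ res₁ P → h ∈ P
  res₁-On₁⁻ {P} sd m with ∈-res₁⁻ {P} m
  ... | inj₁ (h' , sd' , m') = subst (_∈ P) (On₁-injective sd' sd) m'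
  ... | inj₂ (refl , _) = ⊥-elim (avoid₁ _ sd)
  res₁-On₁⁺ : ∀ {P h x} → On₁ h x → h ∈ P → x ∈ res₁ P
  res₁-On₁⁺ {P} {h} sd m = ∈-res₁⁺ {P} (inj₁ (h , sd , m))

  res₁-≡ : ∀ {P A} → (∀ h x → On₁ h x → h ∈ P → x ∈ A) → (∀ h x → On₁ h x → x ∈ A → h ∈ P)
       → (Joined₂ (_∈ P) → d₁ ∈ A) → (d₁ ∈ A → Joined₂ (_∈ P)) → res₁ P ≡ A
  res₁-≡ {P} {A} f g r a = subset-ext fw bw
    where
    fw : ∀ x → x ∈ res₁ P → x ∈ A
    fw x m with ∈-res₁⁻ {P} m
    ... | inj₁ (h , sd , m') = f h x sd m'
    ... | inj₂ (refl , r2) = r r2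
    bw : ∀ x → x ∈ A → x ∈ res₁ P
    bw x m with x ≟ d₁
    ... | yes refl = ∈-res₁⁺ {P} (inj₂ (refl , a m))
    ... | no ne with surj₁ x ne
    ...   | h , sd = res₁-On₁⁺ {P} sd (g h x sd m)

  merge-update₁ : ∀ {h x} → On₁ h x → ∀ b A1 A2 → merge (A1 [ x ]≔ b) A2 ≡ (merge A1 A2) [ h ]≔ b
  merge-update₁ {h} {x} sd b A1 A2 = subset-ext fw bw
    where
    fw : ∀ k → k ∈ merge (A1 [ x ]≔ b) A2 → k ∈ (merge A1 A2) [ h ]≔ b
    fw k m with ∈-merge⁻ m
    ... | inj₂ (y , sd' , m') = ∈-update⁺ (inj₂ ((λ eq → On₁₂-disjoint (subst (λ z → On₁ z x) (sym eq) sd) sd') , ∈-merge⁺ (inj₂ (y , sd' , m'))))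
    ... | inj₁ (y , sd' , m') with ∈-update⁻ {p = A1} m'
    ...   | inj₁ (eq , eb) = ∈-update⁺ (inj₁ (On₁-injective sd' (subst (On₁ h) (sym eq) sd) , eb))
    ...   | inj₂ (ne , m'') = ∈-update⁺ (inj₂ ((λ eq → ne (On₁-functional (subst (λ z → On₁ z y) eq sd') sd)) , ∈-merge⁺ (inj₁ (y , sd' , m''))))
    bw : ∀ k → k ∈ (merge A1 A2) [ h ]≔ b → k ∈ merge (A1 [ x ]≔ b) A2
    bw k m with ∈-update⁻ {p = merge A1 A2} m
    ... | inj₁ (refl , eb) = ∈-merge⁺ (inj₁ (x , sd , ∈-update⁺ (inj₁ (refl , eb))))
    ... | inj₂ (ne , m') with ∈-merge⁻ m'
    ...   | inj₂ (y , sd' , m'') = ∈-merge⁺ (inj₂ (y , sd' , m''))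
    ...   | inj₁ (y , sd' , m'') = ∈-merge⁺ (inj₁ (y , sd' , ∈-update⁺ (inj₂ ((λ eq → ne (On₁-injective sd' (subst (On₁ h) (sym eq) sd))) , m''))))

  merge-update-d₁ : ∀ b A1 A2 → merge (A1 [ d₁ ]≔ b) A2 ≡ merge A1 A2
  merge-update-d₁ b A1 A2 = subset-ext fw bw
    where
    fw : ∀ k → k ∈ merge (A1 [ d₁ ]≔ b) A2 → k ∈ merge A1 A2
    fw k m with ∈-merge⁻ m
    ... | inj₂ y = ∈-merge⁺ (inj₂ y)
    ... | inj₁ (y , sd' , m') with ∈-update⁻ {p = A1} m'
    ...   | inj₁ (refl , _) = ⊥-elim (avoid₁ k sd')
    ...   | inj₂ (_ , m'') = ∈-merge⁺ (inj₁ (y , sd' , m''))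
    bw : ∀ k → k ∈ merge A1 A2 → k ∈ merge (A1 [ d₁ ]≔ b) A2
    bw k m with ∈-merge⁻ m
    ... | inj₂ y = ∈-merge⁺ (inj₂ y)
    ... | inj₁ (y , sd' , m') = ∈-merge⁺ (inj₁ (y , sd' , ∈-update⁺ (inj₂ ((λ eq → avoid₁ k (subst (On₁ k) eq sd')) , m'))))

  merge-update₂ : ∀ {h x} → On₂ h x → ∀ b A1 A2 → merge A1 (A2 [ x ]≔ b) ≡ (merge A1 A2) [ h ]≔ b
  merge-update₂ {h} {x} sd b A1 A2 = subset-ext fw bw
    where
    fw : ∀ k → k ∈ merge A1 (A2 [ x ]≔ b) → k ∈ (merge A1 A2) [ h ]≔ b
    fw k m with ∈-merge⁻ m
    ... | inj₁ (y , sd' , m') = ∈-update⁺ (inj₂ ((λ eq → On₁₂-disjoint sd' (subst (λ z → On₂ z x) (sym eq) sd)) , ∈-merge⁺ (inj₁ (y , sd' , m'))))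
    ... | inj₂ (y , sd' , m') with ∈-update⁻ {p = A2} m'
    ...   | inj₁ (eq , eb) = ∈-update⁺ (inj₁ (On₂-injective sd' (subst (On₂ h) (sym eq) sd) , eb))
    ...   | inj₂ (ne , m'') = ∈-update⁺ (inj₂ ((λ eq → ne (On₂-functional (subst (λ z → On₂ z y) eq sd') sd)) , ∈-merge⁺ (inj₂ (y , sd' , m''))))
    bw : ∀ k → k ∈ (merge A1 A2) [ h ]≔ b → k ∈ merge A1 (A2 [ x ]≔ b)
    bw k m with ∈-update⁻ {p = merge A1 A2} m
    ... | inj₁ (refl , eb) = ∈-merge⁺ (inj₂ (x , sd , ∈-update⁺ (inj₁ (refl , eb))))
    ... | inj₂ (ne , m') with ∈-merge⁻ m'
    ...   | inj₁ (y , sd' , m'') = ∈-merge⁺ (inj₁ (y , sd' , m''))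
    ...   | inj₂ (y , sd' , m'') = ∈-merge⁺ (inj₂ (y , sd' , ∈-update⁺ (inj₂ ((λ eq → ne (On₂-injective sd' (subst (On₂ h) (sym eq) sd))) , m''))))

  merge-update-d₂ : ∀ b A1 A2 → merge A1 (A2 [ d₂ ]≔ b) ≡ merge A1 A2
  merge-update-d₂ b A1 A2 = subset-ext fw bw
    where
    fw : ∀ k → k ∈ merge A1 (A2 [ d₂ ]≔ b) → k ∈ merge A1 A2
    fw k m with ∈-merge⁻ m
    ... | inj₁ y = ∈-merge⁺ (inj₁ y)
    ... | inj₂ (y , sd' , m') with ∈-update⁻ {p = A2} m'
    ...   | inj₁ (refl , _) = ⊥-elim (avoid₂ k sd')
    ...   | inj₂ (_ , m'') = ∈-merge⁺ (inj₂ (y , sd' , m''))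
    bw : ∀ k → k ∈ merge A1 A2 → k ∈ merge A1 (A2 [ d₂ ]≔ b)
    bw k m with ∈-merge⁻ m
    ... | inj₁ y = ∈-merge⁺ (inj₁ y)
    ... | inj₂ (y , sd' , m') = ∈-merge⁺ (inj₂ (y , sd' , ∈-update⁺ (inj₂ ((λ eq → avoid₂ k (subst (On₂ k) eq sd')) , m'))))

tvert-eq : ∀ {H S S' T T'} .{p q} → S ≡ S' → T ≡ T' → tvert {H} S T p ≡ tvert S' T' q
tvert-eq refl refl = refl

evert-eq : ∀ {G₁ G₂ d₁ d₂ v₁ v₁' v₂ v₂'} .{p q} → v₁ ≡ v₁' → v₂ ≡ v₂' → evert {G₁} {G₂} {d₁} {d₂} v₁ v₂ p ≡ evert v₁' v₂' q
evert-eq refl refl = refl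

module VertexBijection {G G₁ G₂ d₁ d₂} (cs : CliqueSum G G₁ G₂ d₁ d₂) (b₁ : Bispanning G₁) (b₂ : Bispanning G₂) where
  module V1 = SideSubsets cs b₁ b₂
  module V2 = SideSubsets (swapSides cs) b₂ b₁
  module S = Restriction cs
  module S' = Restriction (swapSides cs)
  open CliqueSum cs

  res₁ = V1.res₁
  res₂ = V2.res₁

  Res₁-d₁⇒joined₂ : ∀ {X} → S.Res₁ X d₁ → S.Joined₂ X
  Res₁-d₁⇒joined₂ (inj₁ (e , sd , _)) = ⊥-elim (avoid₁ e sd)
  Res₁-d₁⇒joined₂ (inj₂ (_ , r)) = r
  Res₂-d₂⇒joined₁ : ∀ {X} → S.Res₂ X d₂ → S.Joined₁ X
  Res₂-d₂⇒joined₁ (inj₁ (e , sd , _)) = ⊥-elim (avoid₂ e sd)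
  Res₂-d₂⇒joined₁ (inj₂ (_ , r)) = r

  ¬both-virtual : ∀ {S T} → IsPair G S T → ¬ ((d₁ ∈ res₁ S × d₂ ∈ res₂ S) ⊎ (d₁ ∈ res₁ T × d₂ ∈ res₂ T))
  ¬both-virtual {S} {T} (sS , sT , _ , _) (inj₁ (m1 , m2)) = S.Trees.¬both-joined (_∈ S) (proj₂ (GraphProperties.spt⇒tree G sS)) (Res₂-d₂⇒joined₁ (V2.∈-res₁⁻ m2)) (Res₁-d₁⇒joined₂ (V1.∈-res₁⁻ m1))
  ¬both-virtual {S} {T} (sS , sT , _ , _) (inj₂ (m1 , m2)) = S.Trees.¬both-joined (_∈ T) (proj₂ (GraphProperties.spt⇒tree G sT)) (Res₂-d₂⇒joined₁ (V2.∈-res₁⁻ m2)) (Res₁-d₁⇒joined₂ (V1.∈-res₁⁻ m1))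

  toEta : TVert G → EVert G₁ G₂ d₁ d₂
  toEta (tvert S T ip) = evert (tvert (res₁ S) (res₁ T) (V1.isPair-res₁ ip)) (tvert (res₂ S) (res₂ T) (V2.isPair-res₁ ip)) (¬both-virtual ip)

  OneVirtual : Subset (E G₁) → Subset (E G₂) → Set
  OneVirtual A1 A2 = (d₁ ∈ A1 × d₂ ∉ A2) ⊎ (d₁ ∉ A1 × d₂ ∈ A2)

  oneVirtual : ∀ {S1 T1 S2 T2} → IsPair G₁ S1 T1 → IsPair G₂ S2 T2
       → ¬ ((d₁ ∈ S1 × d₂ ∈ S2) ⊎ (d₁ ∈ T1 × d₂ ∈ T2)) → OneVirtual S1 S2 × OneVirtual T1 T2
  oneVirtual {S1} {T1} {S2} {T2} (_ , _ , dj1 , cv1) (_ , _ , dj2 , cv2) ok = cS , cT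
    where
    cS : OneVirtual S1 S2
    cS with d₁ ∈? S1
    ... | yes m = inj₁ (m , λ m2 → ok (inj₁ (m , m2)))
    ... | no n with cv1 d₁
    ...   | inj₁ m = ⊥-elim (n m)
    ...   | inj₂ mt with cv2 d₂
    ...     | inj₁ ms = inj₂ (n , ms)
    ...     | inj₂ mt2 = ⊥-elim (ok (inj₂ (mt , mt2)))
    cT : OneVirtual T1 T2
    cT with d₁ ∈? T1
    ... | yes m = inj₁ (m , λ m2 → ok (inj₂ (m , m2)))
    ... | no n with cv1 d₁
    ...   | inj₂ m = ⊥-elim (n m)
    ...   | inj₁ ms with cv2 d₂
    ...     | inj₂ mt = inj₂ (n , mt)
    ...     | inj₁ ms2 = ⊥-elim (ok (inj₁ (ms , ms2)))

  isPair-merge : ∀ {S1 T1 S2 T2} → IsPair G₁ S1 T1 → IsPair G₂ S2 T2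
       → ¬ ((d₁ ∈ S1 × d₂ ∈ S2) ⊎ (d₁ ∈ T1 × d₂ ∈ T2)) → IsPair G (V1.merge S1 S2) (V1.merge T1 T2)
  isPair-merge {S1} {T1} {S2} {T2} p1 p2 ok with oneVirtual p1 p2 ok
  ... | cS , cT = V1.spanningTree-merge (proj₁ p1) (proj₁ p2) cS , V1.spanningTree-merge (proj₁ (proj₂ p1)) (proj₁ (proj₂ p2)) cT , dj , cv
    where
    dj1 = proj₁ (proj₂ (proj₂ p1))
    cv1 = proj₂ (proj₂ (proj₂ p1))
    dj2 = proj₁ (proj₂ (proj₂ p2))
    cv2 = proj₂ (proj₂ (proj₂ p2))
    dj : ∀ e → e ∈ V1.merge S1 S2 → e ∈ V1.merge T1 T2 → ⊥
    dj e m m' with V1.∈-merge⁻ m | V1.∈-merge⁻ m'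
    ... | inj₁ (x , sd , a) | inj₁ (x' , sd' , b) = dj1 x a (subst (_∈ T1) (On₁-functional sd' sd) b)
    ... | inj₂ (x , sd , a) | inj₂ (x' , sd' , b) = dj2 x a (subst (_∈ T2) (On₂-functional sd' sd) b)
    ... | inj₁ (x , sd , _) | inj₂ (x' , sd' , _) = On₁₂-disjoint sd sd'
    ... | inj₂ (x , sd , _) | inj₁ (x' , sd' , _) = On₁₂-disjoint sd' sd
    cv : ∀ e → e ∈ V1.merge S1 S2 ⊎ e ∈ V1.merge T1 T2
    cv e with side e
    ... | inj₁ (x , sd) = Sum.map (λ a → V1.∈-merge⁺ (inj₁ (x , sd , a))) (λ b → V1.∈-merge⁺ (inj₁ (x , sd , b))) (cv1 x)
    ... | inj₂ (x , sd) = Sum.map (λ a → V1.∈-merge⁺ (inj₂ (x , sd , a))) (λ b → V1.∈-merge⁺ (inj₂ (x , sd , b))) (cv2 x)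

  fromEta : EVert G₁ G₂ d₁ d₂ → TVert G
  fromEta (evert (tvert S1 T1 ip1) (tvert S2 T2 ip2) ok) = tvert (V1.merge S1 S2) (V1.merge T1 T2) (isPair-merge ip1 ip2 ok)

  merge-res : ∀ S → V1.merge (res₁ S) (res₂ S) ≡ S
  merge-res S = subset-ext f g
    where
    f : ∀ e → e ∈ V1.merge (res₁ S) (res₂ S) → e ∈ S
    f e m with V1.∈-merge⁻ m
    ... | inj₁ (x , sd , mx) with V1.∈-res₁⁻ {S} mx
    ...   | inj₁ (e' , sd' , m') = subst (_∈ S) (On₁-injective sd' sd) m'
    ...   | inj₂ (refl , _) = ⊥-elim (avoid₁ e sd)
    f e m | inj₂ (x , sd , mx) with V2.∈-res₁⁻ {S} mx
    ...   | inj₁ (e' , sd' , m') = subst (_∈ S) (On₂-injective sd' sd) m'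
    ...   | inj₂ (refl , _) = ⊥-elim (avoid₂ e sd)
    g : ∀ e → e ∈ S → e ∈ V1.merge (res₁ S) (res₂ S)
    g e m with side e
    ... | inj₁ (x , sd) = V1.∈-merge⁺ (inj₁ (x , sd , V1.∈-res₁⁺ {S} (inj₁ (e , sd , m))))
    ... | inj₂ (x , sd) = V1.∈-merge⁺ (inj₂ (x , sd , V2.∈-res₁⁺ {S} (inj₁ (e , sd , m))))

  fromEta-toEta : ∀ v → fromEta (toEta v) ≡ v
  fromEta-toEta (tvert S T ip) = tvert-eq (merge-res S) (merge-res T)

  res₁-merge : ∀ {A1 A2} → SpanningTree G₁ A1 → SpanningTree G₂ A2 → OneVirtual A1 A2 → res₁ (V1.merge A1 A2) ≡ A1
  res₁-merge {A1} {A2} s1 s2 c with V1.res-merge s1 s2 c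
  ... | (f1 , g1) , _ = subset-ext (λ x m → f1 x (V1.∈-res₁⁻ m)) (λ x m → V1.∈-res₁⁺ (g1 x m))
  res₂-merge : ∀ {A1 A2} → SpanningTree G₁ A1 → SpanningTree G₂ A2 → OneVirtual A1 A2 → res₂ (V1.merge A1 A2) ≡ A2
  res₂-merge {A1} {A2} s1 s2 c with V1.res-merge s1 s2 c
  ... | _ , (f2 , g2) = subset-ext (λ x m → f2 x (V2.∈-res₁⁻ m)) (λ x m → V2.∈-res₁⁺ (g2 x m))

  toEta-fromEta : ∀ w → toEta (fromEta w) ≡ w
  toEta-fromEta (evert (tvert S1 T1 ip1) (tvert S2 T2 ip2) ok) =
    evert-eq (tvert-eq (≡-recompute (res₁-merge (proj₁ ip1) (proj₁ ip2) (proj₁ (oneVirtual ip1 ip2 ok))))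
                       (≡-recompute (res₁-merge (proj₁ (proj₂ ip1)) (proj₁ (proj₂ ip2)) (proj₂ (oneVirtual ip1 ip2 ok)))))
             (tvert-eq (≡-recompute (res₂-merge (proj₁ ip1) (proj₁ ip2) (proj₁ (oneVirtual ip1 ip2 ok))))
                       (≡-recompute (res₂-merge (proj₁ (proj₂ ip1)) (proj₁ (proj₂ ip2)) (proj₂ (oneVirtual ip1 ip2 ok)))))

module ArcTransfer {G G₁ G₂ d₁ d₂} (cs : CliqueSum G G₁ G₂ d₁ d₂) (b₁ : Bispanning G₁) (b₂ : Bispanning G₂) where
  open VertexBijection cs b₁ b₂
  open CliqueSum cs
  module B = Gluing cs
  module L = GraphProperties G
  module L₁ = GraphProperties G₁
  module L₂ = GraphProperties G₂

  module ForPair (X Y : Subset (E G)) (p : IsPair G X Y) where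
    tX = GraphProperties.spt⇒tree G (proj₁ p)
    tY = GraphProperties.spt⇒tree G (proj₁ (proj₂ p))
    dj = proj₁ (proj₂ (proj₂ p))
    cv = proj₂ (proj₂ (proj₂ p))
    ¬d₁-in-both : ¬ (S.Res₁ (_∈ X) d₁ × S.Res₁ (_∈ Y) d₁)
    ¬d₁-in-both (a , b) = BispanningSide₁.¬joined₂-both cs b₁ (_∈? X) (_∈? Y) tX tY cv dj (Res₁-d₁⇒joined₂ a) (Res₁-d₁⇒joined₂ b)
    ¬d₂-in-both : ¬ (S.Res₂ (_∈ X) d₂ × S.Res₂ (_∈ Y) d₂)
    ¬d₂-in-both (a , b) = BispanningSide₁.¬joined₂-both (swapSides cs) b₂ (_∈? X) (_∈? Y) tX tY cv dj (Res₂-d₂⇒joined₁ a) (Res₂-d₂⇒joined₁ b)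
    module Ar {e e1} (sde : On₁ e e1) = B.ExchangeAcross (_∈ X) (_∈ Y) (_∈? X) (_∈? Y) tX tY ¬d₁-in-both ¬d₂-in-both sde

    uniqueEx-same-side⇒ : ∀ {e e1 f f1} → On₁ e e1 → On₁ f f1 → UniqueEx G X Y e f → UniqueEx G₁ (res₁ X) (res₁ Y) e1 f1
    uniqueEx-same-side⇒ sde sdf U = L₁.Exactly⇒uniqueEx (V1.res₁-≐ X) (V1.res₁-≐ Y) (proj₁ (Ar.exactly-same-side sde sdf) (L.uniqueEx⇒Exactly L.⇔P-refl L.⇔P-refl U))
    uniqueEx-same-side⇐ : ∀ {e e1 f f1} → On₁ e e1 → On₁ f f1 → UniqueEx G₁ (res₁ X) (res₁ Y) e1 f1 → UniqueEx G X Y e f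
    uniqueEx-same-side⇐ sde sdf U = L.Exactly⇒uniqueEx L.⇔P-refl L.⇔P-refl (proj₂ (Ar.exactly-same-side sde sdf) (L₁.uniqueEx⇒Exactly (V1.res₁-≐ X) (V1.res₁-≐ Y) U))

    uniqueEx-across⇒ : ∀ {e e1 f f2} → On₁ e e1 → On₂ f f2 → UniqueEx G X Y e f
      → UniqueEx G₁ (res₁ X) (res₁ Y) e1 d₁ × UniqueEx G₂ (res₂ X) (res₂ Y) d₂ f2
        × (L₁.InCut (S.Res₁ (_∈ X)) e1 d₁ × L₁.InCycle (S.Res₁ (_∈ Y)) e1 d₁) × S.Res₂ (_∈ X) d₂
    uniqueEx-across⇒ sde sdf U with proj₁ (Ar.exactly-across sde sdf) (L.uniqueEx⇒Exactly L.⇔P-refl L.⇔P-refl U)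
    ... | H1 , H2 = L₁.Exactly⇒uniqueEx (V1.res₁-≐ X) (V1.res₁-≐ Y) H1 , L₂.Exactly⇒uniqueEx (V2.res₁-≐ X) (V2.res₁-≐ Y) H2
                  , dc , Ar.DC₁-d₁⇒Res₂ sde dc
      where dc = proj₂ (H1 d₁) (inj₂ refl)
    uniqueEx-across⇐ : ∀ {e e1 f f2} → On₁ e e1 → On₂ f f2
      → UniqueEx G₁ (res₁ X) (res₁ Y) e1 d₁ → UniqueEx G₂ (res₂ X) (res₂ Y) d₂ f2 → UniqueEx G X Y e f
    uniqueEx-across⇐ sde sdf U1 U2 = L.Exactly⇒uniqueEx L.⇔P-refl L.⇔P-refl (proj₂ (Ar.exactly-across sde sdf)
                              (L₁.uniqueEx⇒Exactly (V1.res₁-≐ X) (V1.res₁-≐ Y) U1 , L₂.uniqueEx⇒Exactly (V2.res₁-≐ X) (V2.res₁-≐ Y) U2))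

    sides : ∀ {h h' x y} → On₁ h x → On₂ h' y → h ≢ h'
    sides sd sd' eq = On₁₂-disjoint sd (subst (λ z → On₂ z _) (sym eq) sd')

    module HeadsSameSide {e e1 f f1} (sde : On₁ e e1) (sdf : On₁ f f1) (p' : IsPair G (removeAdd X e f) (addRemove Y e f)) where
      X' = removeAdd X e f
      Y' = addRemove Y e f
      tX' = GraphProperties.spt⇒tree G (proj₁ p')
      tY' = GraphProperties.spt⇒tree G (proj₁ (proj₂ p'))
      ne1 : ∀ {h x} → On₁ h x → h ≢ e → x ≢ e1
      ne1 sd ne eq = ne (On₁-injective sd (subst (On₁ _) (sym eq) sde))
      ne1' : ∀ {h x} → On₁ h x → x ≢ e1 → h ≢ e
      ne1' sd ne eq = ne (On₁-functional (subst (λ z → On₁ z _) eq sd) sde)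
      eqf : ∀ {h x} → On₁ h x → h ≡ f → x ≡ f1
      eqf sd eq = On₁-functional (subst (λ z → On₁ z _) eq sd) sdf
      eqf' : ∀ {h x} → On₁ h x → x ≡ f1 → h ≡ f
      eqf' sd eq = On₁-injective sd (subst (On₁ _) (sym eq) sdf)
      neqf : ∀ {h x} → On₁ h x → x ≢ f1 → h ≢ f
      neqf sd ne eq = ne (eqf sd eq)
      d≢e1 : d₁ ≢ e1
      d≢e1 eq = avoid₁ e (subst (On₁ e) (sym eq) sde)
      d≢f1 : d₁ ≢ f1
      d≢f1 eq = avoid₁ f (subst (On₁ f) (sym eq) sdf)
      On₂-X′⇒X : ∀ h x → On₂ h x → h ∈ X' → h ∈ X
      On₂-X′⇒X h x sd m with ∈-removeAdd⁻ {p = X} m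
      ... | inj₁ eq = ⊥-elim (sides sdf sd (sym eq))
      ... | inj₂ (_ , m') = m'
      On₂-X⇒X′ : ∀ h x → On₂ h x → h ∈ X → h ∈ X'
      On₂-X⇒X′ h x sd m = ∈-removeAdd⁺ {p = X} (inj₂ ((λ eq → sides sde sd (sym eq)) , m))
      On₂-Y′⇒Y : ∀ h x → On₂ h x → h ∈ Y' → h ∈ Y
      On₂-Y′⇒Y h x sd m with ∈-addRemove⁻ {p = Y} m
      ... | _ , inj₁ eq = ⊥-elim (sides sde sd (sym eq))
      ... | _ , inj₂ m' = m'
      On₂-Y⇒Y′ : ∀ h x → On₂ h x → h ∈ Y → h ∈ Y'
      On₂-Y⇒Y′ h x sd m = ∈-addRemove⁺ {p = Y} ((λ eq → sides sdf sd (sym eq)) , inj₂ m)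
      res₁-X′ : res₁ X' ≡ removeAdd (res₁ X) e1 f1
      res₁-X′ = V1.res₁-≡ fw bw r a
        where
        fw : ∀ h x → On₁ h x → h ∈ X' → x ∈ removeAdd (res₁ X) e1 f1
        fw h x sd m with ∈-removeAdd⁻ {p = X} m
        ... | inj₁ eq = ∈-removeAdd⁺ {p = res₁ X} (inj₁ (eqf sd eq))
        ... | inj₂ (ne , m') = ∈-removeAdd⁺ {p = res₁ X} (inj₂ (ne1 sd ne , V1.res₁-On₁⁺ sd m'))
        bw : ∀ h x → On₁ h x → x ∈ removeAdd (res₁ X) e1 f1 → h ∈ X'
        bw h x sd m with ∈-removeAdd⁻ {p = res₁ X} m
        ... | inj₁ eq = ∈-removeAdd⁺ {p = X} (inj₁ (eqf' sd eq))
        ... | inj₂ (ne , m') = ∈-removeAdd⁺ {p = X} (inj₂ (ne1' sd ne , V1.res₁-On₁⁻ sd m'))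
        r : S.Joined₂ (_∈ X') → d₁ ∈ removeAdd (res₁ X) e1 f1
        r r2 = ∈-removeAdd⁺ {p = res₁ X} (inj₂ (d≢e1 , V1.∈-res₁⁺ (inj₂ (refl , S.Joined₂-mono On₂-X′⇒X r2))))
        a : d₁ ∈ removeAdd (res₁ X) e1 f1 → S.Joined₂ (_∈ X')
        a m with ∈-removeAdd⁻ {p = res₁ X} m
        ... | inj₁ eq = ⊥-elim (d≢f1 eq)
        ... | inj₂ (_ , m') = S.Joined₂-mono On₂-X⇒X′ (Res₁-d₁⇒joined₂ (V1.∈-res₁⁻ m'))
      res₁-Y′ : res₁ Y' ≡ addRemove (res₁ Y) e1 f1
      res₁-Y′ = V1.res₁-≡ fw bw r a
        where
        fw : ∀ h x → On₁ h x → h ∈ Y' → x ∈ addRemove (res₁ Y) e1 f1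
        fw h x sd m with ∈-addRemove⁻ {p = Y} m
        ... | ne , inj₁ eq = ∈-addRemove⁺ {p = res₁ Y} ((λ eq' → ne (eqf' sd eq')) , inj₁ (On₁-functional (subst (λ z → On₁ z _) eq sd) sde))
        ... | ne , inj₂ m' = ∈-addRemove⁺ {p = res₁ Y} ((λ eq' → ne (eqf' sd eq')) , inj₂ (V1.res₁-On₁⁺ sd m'))
        bw : ∀ h x → On₁ h x → x ∈ addRemove (res₁ Y) e1 f1 → h ∈ Y'
        bw h x sd m with ∈-addRemove⁻ {p = res₁ Y} m
        ... | ne , inj₁ eq = ∈-addRemove⁺ {p = Y} (neqf sd ne , inj₁ (On₁-injective sd (subst (On₁ _) (sym eq) sde)))
        ... | ne , inj₂ m' = ∈-addRemove⁺ {p = Y} (neqf sd ne , inj₂ (V1.res₁-On₁⁻ sd m'))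
        r : S.Joined₂ (_∈ Y') → d₁ ∈ addRemove (res₁ Y) e1 f1
        r r2 = ∈-addRemove⁺ {p = res₁ Y} (d≢f1 , inj₂ (V1.∈-res₁⁺ (inj₂ (refl , S.Joined₂-mono On₂-Y′⇒Y r2))))
        a : d₁ ∈ addRemove (res₁ Y) e1 f1 → S.Joined₂ (_∈ Y')
        a m with ∈-addRemove⁻ {p = res₁ Y} m
        ... | _ , inj₁ eq = ⊥-elim (d≢e1 eq)
        ... | _ , inj₂ m' = S.Joined₂-mono On₂-Y⇒Y′ (Res₁-d₁⇒joined₂ (V1.∈-res₁⁻ m'))
      joined₁-transfer : ∀ {Z Z'} → L.Tree (_∈ Z) → L.Tree (_∈ Z')
        → (∀ h x → On₂ h x → h ∈ Z → h ∈ Z') → (∀ h x → On₂ h x → h ∈ Z' → h ∈ Z)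
        → S.Joined₁ (_∈ Z) → S.Joined₁ (_∈ Z')
      joined₁-transfer {Z} {Z'} tZ tZ' f g r1 with S.Decidability.Joined₂? (_∈ Z') (_∈? Z')
      ... | yes r2' = ⊥-elim (S.Trees.¬both-joined (_∈ Z) (proj₂ tZ) r1 (S.Joined₂-mono g r2'))
      ... | no nr2' = S.Trees.joined₁-unless-joined₂ (_∈ Z') (proj₁ tZ') nr2'
      res₂-X′ : res₂ X' ≡ res₂ X
      res₂-X′ = V2.res₁-≡ (λ h x sd m → V2.res₁-On₁⁺ sd (On₂-X′⇒X h x sd m)) (λ h x sd m → On₂-X⇒X′ h x sd (V2.res₁-On₁⁻ sd m))
              (λ r1 → V2.∈-res₁⁺ (inj₂ (refl , joined₁-transfer tX' tX On₂-X′⇒X On₂-X⇒X′ r1)))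
              (λ m → joined₁-transfer tX tX' On₂-X⇒X′ On₂-X′⇒X (Res₂-d₂⇒joined₁ (V2.∈-res₁⁻ m)))
      res₂-Y′ : res₂ Y' ≡ res₂ Y
      res₂-Y′ = V2.res₁-≡ (λ h x sd m → V2.res₁-On₁⁺ sd (On₂-Y′⇒Y h x sd m)) (λ h x sd m → On₂-Y⇒Y′ h x sd (V2.res₁-On₁⁻ sd m))
              (λ r1 → V2.∈-res₁⁺ (inj₂ (refl , joined₁-transfer tY' tY On₂-Y′⇒Y On₂-Y⇒Y′ r1)))
              (λ m → joined₁-transfer tY tY' On₂-Y⇒Y′ On₂-Y′⇒Y (Res₂-d₂⇒joined₁ (V2.∈-res₁⁻ m)))

    heads-same-side : ∀ {e e1 f f1} → On₁ e e1 → On₁ f f1 → IsPair G (removeAdd X e f) (addRemove Y e f)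
      → res₁ (removeAdd X e f) ≡ removeAdd (res₁ X) e1 f1 × res₁ (addRemove Y e f) ≡ addRemove (res₁ Y) e1 f1
        × res₂ (removeAdd X e f) ≡ res₂ X × res₂ (addRemove Y e f) ≡ res₂ Y
    heads-same-side sde sdf p' = res₁-X′ , res₁-Y′ , res₂-X′ , res₂-Y′
      where open HeadsSameSide sde sdf p'

    module HeadsAcross {e e1 f f2} (sde : On₁ e e1) (sdf : On₂ f f2) (p' : IsPair G (removeAdd X e f) (addRemove Y e f))
      (indX : L₁.InCut (S.Res₁ (_∈ X)) e1 d₁) (incY : L₁.InCycle (S.Res₁ (_∈ Y)) e1 d₁) where
      X' = removeAdd X e f
      Y' = addRemove Y e f
      tX' = GraphProperties.spt⇒tree G (proj₁ p')
      tY' = GraphProperties.spt⇒tree G (proj₁ (proj₂ p'))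
      ne1 : ∀ {h x} → On₁ h x → h ≢ e → x ≢ e1
      ne1 sd ne eq = ne (On₁-injective sd (subst (On₁ _) (sym eq) sde))
      ne1' : ∀ {h x} → On₁ h x → x ≢ e1 → h ≢ e
      ne1' sd ne eq = ne (On₁-functional (subst (λ z → On₁ z _) eq sd) sde)
      eqf : ∀ {h x} → On₂ h x → h ≡ f → x ≡ f2
      eqf sd eq = On₂-functional (subst (λ z → On₂ z _) eq sd) sdf
      eqf' : ∀ {h x} → On₂ h x → x ≡ f2 → h ≡ f
      eqf' sd eq = On₂-injective sd (subst (On₂ _) (sym eq) sdf)
      ¬joined₁-X′ : ¬ S.Joined₁ (_∈ X')
      ¬joined₁-X′ r = indX (L₁.reach-mono k r)
        where k : ∀ h → S.Part₁ (_∈ X') h → L₁.Minus (S.Res₁ (_∈ X)) e1 h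
              k h (h' , sd' , m') with ∈-removeAdd⁻ {p = X} m'
              ... | inj₁ eq = ⊥-elim (sides sd' sdf eq)
              ... | inj₂ (ne , mX) = inj₁ (h' , sd' , mX) , ne1 sd' ne
      joined₂-X′ : S.Joined₂ (_∈ X')
      joined₂-X′ with S.Decidability.Joined₂? (_∈ X') (_∈? X')
      ... | yes r = r
      ... | no nr = ⊥-elim (¬joined₁-X′ (S.Trees.joined₁-unless-joined₂ (_∈ X') (proj₁ tX') nr))
      joined₁-Y′ : S.Joined₁ (_∈ Y')
      joined₁-Y′ = L₁.reach-mono k (proj₂ incY)
        where k : ∀ h → L₁.Minus (L₁.Plus (S.Res₁ (_∈ Y)) e1) d₁ h → S.Part₁ (_∈ Y') h
              k h (inj₁ (inj₁ (h' , sd' , mY)) , _) = h' , sd' , ∈-addRemove⁺ {p = Y} ((λ eq → sides sd' sdf eq) , inj₂ mY)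
              k h (inj₁ (inj₂ (eq , _)) , ne) = ⊥-elim (ne eq)
              k h (inj₂ refl , _) = e , sde , ∈-addRemove⁺ {p = Y} ((λ eq → sides sde sdf eq) , inj₁ refl)
      ¬joined₂-Y′ : ¬ S.Joined₂ (_∈ Y')
      ¬joined₂-Y′ = S.Trees.¬both-joined (_∈ Y') (proj₂ tY') joined₁-Y′
      res₁-X′ : res₁ X' ≡ removeAdd (res₁ X) e1 d₁
      res₁-X′ = V1.res₁-≡ fw bw (λ _ → ∈-removeAdd⁺ {p = res₁ X} (inj₁ refl)) (λ _ → joined₂-X′)
        where
        fw : ∀ h x → On₁ h x → h ∈ X' → x ∈ removeAdd (res₁ X) e1 d₁
        fw h x sd m with ∈-removeAdd⁻ {p = X} m
        ... | inj₁ eq = ⊥-elim (sides sd sdf eq)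
        ... | inj₂ (ne , m') = ∈-removeAdd⁺ {p = res₁ X} (inj₂ (ne1 sd ne , V1.res₁-On₁⁺ sd m'))
        bw : ∀ h x → On₁ h x → x ∈ removeAdd (res₁ X) e1 d₁ → h ∈ X'
        bw h x sd m with ∈-removeAdd⁻ {p = res₁ X} m
        ... | inj₁ refl = ⊥-elim (avoid₁ h sd)
        ... | inj₂ (ne , m') = ∈-removeAdd⁺ {p = X} (inj₂ (ne1' sd ne , V1.res₁-On₁⁻ sd m'))
      res₁-Y′ : res₁ Y' ≡ addRemove (res₁ Y) e1 d₁
      res₁-Y′ = V1.res₁-≡ fw bw (λ r → ⊥-elim (¬joined₂-Y′ r)) (λ m → ⊥-elim (proj₁ (∈-addRemove⁻ {p = res₁ Y} m) refl))
        where
        fw : ∀ h x → On₁ h x → h ∈ Y' → x ∈ addRemove (res₁ Y) e1 d₁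
        fw h x sd m with ∈-addRemove⁻ {p = Y} m
        ... | _ , inj₁ eq = ∈-addRemove⁺ {p = res₁ Y} ((λ eq' → avoid₁ h (subst (On₁ h) eq' sd)) , inj₁ (On₁-functional (subst (λ z → On₁ z _) eq sd) sde))
        ... | _ , inj₂ m' = ∈-addRemove⁺ {p = res₁ Y} ((λ eq' → avoid₁ h (subst (On₁ h) eq' sd)) , inj₂ (V1.res₁-On₁⁺ sd m'))
        bw : ∀ h x → On₁ h x → x ∈ addRemove (res₁ Y) e1 d₁ → h ∈ Y'
        bw h x sd m with ∈-addRemove⁻ {p = res₁ Y} m
        ... | _ , inj₁ eq = ∈-addRemove⁺ {p = Y} ((λ eq' → sides sd sdf eq') , inj₁ (On₁-injective sd (subst (On₁ _) (sym eq) sde)))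
        ... | _ , inj₂ m' = ∈-addRemove⁺ {p = Y} ((λ eq' → sides sd sdf eq') , inj₂ (V1.res₁-On₁⁻ sd m'))
      res₂-X′ : res₂ X' ≡ removeAdd (res₂ X) d₂ f2
      res₂-X′ = V2.res₁-≡ fw bw (λ r → ⊥-elim (¬joined₁-X′ r)) a
        where
        fw : ∀ h x → On₂ h x → h ∈ X' → x ∈ removeAdd (res₂ X) d₂ f2
        fw h x sd m with ∈-removeAdd⁻ {p = X} m
        ... | inj₁ eq = ∈-removeAdd⁺ {p = res₂ X} (inj₁ (eqf sd eq))
        ... | inj₂ (ne , m') = ∈-removeAdd⁺ {p = res₂ X} (inj₂ ((λ eq → avoid₂ h (subst (On₂ h) eq sd)) , V2.res₁-On₁⁺ sd m'))
        bw : ∀ h x → On₂ h x → x ∈ removeAdd (res₂ X) d₂ f2 → h ∈ X'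
        bw h x sd m with ∈-removeAdd⁻ {p = res₂ X} m
        ... | inj₁ eq = ∈-removeAdd⁺ {p = X} (inj₁ (eqf' sd eq))
        ... | inj₂ (ne , m') = ∈-removeAdd⁺ {p = X} (inj₂ ((λ eq → sides sde sd (sym eq)) , V2.res₁-On₁⁻ sd m'))
        a : d₂ ∈ removeAdd (res₂ X) d₂ f2 → S.Joined₁ (_∈ X')
        a m with ∈-removeAdd⁻ {p = res₂ X} m
        ... | inj₁ eq = ⊥-elim (avoid₂ f (subst (On₂ f) (sym eq) sdf))
        ... | inj₂ (ne , _) = ⊥-elim (ne refl)
      res₂-Y′ : res₂ Y' ≡ addRemove (res₂ Y) d₂ f2
      res₂-Y′ = V2.res₁-≡ fw bw (λ _ → ∈-addRemove⁺ {p = res₂ Y} ((λ eq → avoid₂ f (subst (On₂ f) (sym eq) sdf)) , inj₁ refl)) (λ _ → joined₁-Y′)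
        where
        fw : ∀ h x → On₂ h x → h ∈ Y' → x ∈ addRemove (res₂ Y) d₂ f2
        fw h x sd m with ∈-addRemove⁻ {p = Y} m
        ... | ne , inj₁ eq = ⊥-elim (sides sde sd (sym eq))
        ... | ne , inj₂ m' = ∈-addRemove⁺ {p = res₂ Y} ((λ eq → ne (eqf' sd eq)) , inj₂ (V2.res₁-On₁⁺ sd m'))
        bw : ∀ h x → On₂ h x → x ∈ addRemove (res₂ Y) d₂ f2 → h ∈ Y'
        bw h x sd m with ∈-addRemove⁻ {p = res₂ Y} m
        ... | ne , inj₁ refl = ⊥-elim (avoid₂ h sd)
        ... | ne , inj₂ m' = ∈-addRemove⁺ {p = Y} ((λ eq → ne (eqf sd eq)) , inj₂ (V2.res₁-On₁⁻ sd m'))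

    heads-across : ∀ {e e1 f f2} → On₁ e e1 → On₂ f f2 → IsPair G (removeAdd X e f) (addRemove Y e f)
      → L₁.InCut (S.Res₁ (_∈ X)) e1 d₁ → L₁.InCycle (S.Res₁ (_∈ Y)) e1 d₁
      → res₁ (removeAdd X e f) ≡ removeAdd (res₁ X) e1 d₁ × res₁ (addRemove Y e f) ≡ addRemove (res₁ Y) e1 d₁
        × res₂ (removeAdd X e f) ≡ removeAdd (res₂ X) d₂ f2 × res₂ (addRemove Y e f) ≡ addRemove (res₂ Y) d₂ f2
    heads-across sde sdf p' indX incY = res₁-X′ , res₁-Y′ , res₂-X′ , res₂-Y′
      where open HeadsAcross sde sdf p' indX incY

  IsPair-swap : ∀ {H A B} → IsPair H A B → IsPair H B A
  IsPair-swap (a , b , dj , cv) = b , a , (λ e x y → dj e y x) , (λ e → Sum.swap (cv e))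

  cong-pair : ∀ {m n} {A B : Subset m} {A' B' : Subset m} (f : Subset m → Subset n)
    → (A , B) ≡ (A' , B') → (f A , f B) ≡ (f A' , f B')
  cong-pair f refl = refl

  arc-same-side⇒ : ∀ {S T S' T' e e1 f f1} → On₁ e e1 → On₁ f f1 → IsPair G S T → IsPair G S' T'
    → (S' , T') ≡ exch e f (S , T) → ArcCond G S T e f
    → ArcCond G₁ (res₁ S) (res₁ T) e1 f1 × e1 ≢ d₁ × f1 ≢ d₁
      × (res₁ S' , res₁ T') ≡ exch e1 f1 (res₁ S , res₁ T) × (res₂ S' , res₂ T') ≡ (res₂ S , res₂ T)
  arc-same-side⇒ {S} {T} {S'} {T'} {e} {e1} {f} {f1} sde sdf p p' isH (inj₁ (eS , fT , U)) =
    inj₁ (e1∈ , V1.res₁-On₁⁺ sdf fT , ForPair.uniqueEx-same-side⇒ S T p sde sdf U) , d1e , d1f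
    , trans (cong-pair res₁ hd) (trans (cong₂ _,_ h1 h2) (sym (exch-∈ e1∈)))
    , trans (cong-pair res₂ hd) (cong₂ _,_ h3 h4)
    where
    hd = trans isH (exch-∈ eS)
    p'' = subst₂ (IsPair G) (cong proj₁ hd) (cong proj₂ hd) p'
    hs = ForPair.heads-same-side S T p sde sdf p''
    h1 = proj₁ hs
    h2 = proj₁ (proj₂ hs)
    h3 = proj₁ (proj₂ (proj₂ hs))
    h4 = proj₂ (proj₂ (proj₂ hs))
    e1∈ = V1.res₁-On₁⁺ sde eS
    d1e : e1 ≢ d₁
    d1e eq = avoid₁ e (subst (On₁ e) eq sde)
    d1f : f1 ≢ d₁
    d1f eq = avoid₁ f (subst (On₁ f) eq sdf)
  arc-same-side⇒ {S} {T} {S'} {T'} {e} {e1} {f} {f1} sde sdf p p' isH (inj₂ (eT , fS , U)) =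
    inj₂ (V1.res₁-On₁⁺ sde eT , V1.res₁-On₁⁺ sdf fS , ForPair.uniqueEx-same-side⇒ T S (IsPair-swap p) sde sdf U) , d1e , d1f
    , trans (cong-pair res₁ hd) (trans (cong₂ _,_ h2 h1) (sym (exch-∉ e1∉)))
    , trans (cong-pair res₂ hd) (cong₂ _,_ h4 h3)
    where
    e∉ : e ∉ S
    e∉ m = proj₁ (proj₂ (proj₂ p)) e m eT
    hd = trans isH (exch-∉ e∉)
    p'' = IsPair-swap (subst₂ (IsPair G) (cong proj₁ hd) (cong proj₂ hd) p')
    hs = ForPair.heads-same-side T S (IsPair-swap p) sde sdf p''
    h1 = proj₁ hs
    h2 = proj₁ (proj₂ hs)
    h3 = proj₁ (proj₂ (proj₂ hs))
    h4 = proj₂ (proj₂ (proj₂ hs))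
    e1∉ : e1 ∉ res₁ S
    e1∉ m = e∉ (V1.res₁-On₁⁻ sde m)
    d1e : e1 ≢ d₁
    d1e eq = avoid₁ e (subst (On₁ e) eq sde)
    d1f : f1 ≢ d₁
    d1f eq = avoid₁ f (subst (On₁ f) eq sdf)

  Res₁-d₁ : ∀ {Y e1} → L₁.Plus (S.Res₁ Y) e1 d₁ → e1 ≢ d₁ → S.Res₁ Y d₁
  Res₁-d₁ (inj₁ q) _ = q
  Res₁-d₁ (inj₂ eq) ne = ⊥-elim (ne (sym eq))

  arc-across⇒ : ∀ {S T S' T' e e1 f f2} → On₁ e e1 → On₂ f f2 → IsPair G S T → IsPair G S' T'
    → (S' , T') ≡ exch e f (S , T) → ArcCond G S T e f
    → ArcCond G₁ (res₁ S) (res₁ T) e1 d₁ × ArcCond G₂ (res₂ S) (res₂ T) d₂ f2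
      × (res₁ S' , res₁ T') ≡ exch e1 d₁ (res₁ S , res₁ T) × (res₂ S' , res₂ T') ≡ exch d₂ f2 (res₂ S , res₂ T)
  arc-across⇒ {S} {T} {S'} {T'} {e} {e1} {f} {f2} sde sdf p p' isH (inj₁ (eS , fT , U)) =
    inj₁ (e1∈ , d1∈ , U1) , inj₁ (d2∈ , V2.res₁-On₁⁺ sdf fT , U2)
    , trans (cong-pair res₁ hd) (trans (cong₂ _,_ h1 h2) (sym (exch-∈ e1∈)))
    , trans (cong-pair res₂ hd) (trans (cong₂ _,_ h3 h4) (sym (exch-∈ d2∈)))
    where
    c = ForPair.uniqueEx-across⇒ S T p sde sdf U
    U1 = proj₁ c
    U2 = proj₁ (proj₂ c)
    indX = proj₁ (proj₁ (proj₂ (proj₂ c)))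
    incY = proj₂ (proj₁ (proj₂ (proj₂ c)))
    q2 = proj₂ (proj₂ (proj₂ c))
    d1e : e1 ≢ d₁
    d1e eq = avoid₁ e (subst (On₁ e) eq sde)
    e1∈ = V1.res₁-On₁⁺ sde eS
    d1∈ = V1.∈-res₁⁺ (Res₁-d₁ (proj₁ incY) d1e)
    d2∈ = V2.∈-res₁⁺ q2
    hd = trans isH (exch-∈ eS)
    p'' = subst₂ (IsPair G) (cong proj₁ hd) (cong proj₂ hd) p'
    hs = ForPair.heads-across S T p sde sdf p'' indX incY
    h1 = proj₁ hs
    h2 = proj₁ (proj₂ hs)
    h3 = proj₁ (proj₂ (proj₂ hs))
    h4 = proj₂ (proj₂ (proj₂ hs))
  arc-across⇒ {S} {T} {S'} {T'} {e} {e1} {f} {f2} sde sdf p p' isH (inj₂ (eT , fS , U)) =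
    inj₂ (V1.res₁-On₁⁺ sde eT , d1∈ , U1) , inj₂ (d2∈T , V2.res₁-On₁⁺ sdf fS , U2)
    , trans (cong-pair res₁ hd) (trans (cong₂ _,_ h2 h1) (sym (exch-∉ e1∉)))
    , trans (cong-pair res₂ hd) (trans (cong₂ _,_ h4 h3) (sym (exch-∉ d2∉)))
    where
    c = ForPair.uniqueEx-across⇒ T S (IsPair-swap p) sde sdf U
    U1 = proj₁ c
    U2 = proj₁ (proj₂ c)
    indX = proj₁ (proj₁ (proj₂ (proj₂ c)))
    incY = proj₂ (proj₁ (proj₂ (proj₂ c)))
    q2 = proj₂ (proj₂ (proj₂ c))
    d1e : e1 ≢ d₁
    d1e eq = avoid₁ e (subst (On₁ e) eq sde)
    e∉ : e ∉ S
    e∉ m = proj₁ (proj₂ (proj₂ p)) e m eT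
    e1∉ : e1 ∉ res₁ S
    e1∉ m = e∉ (V1.res₁-On₁⁻ sde m)
    d1∈ = V1.∈-res₁⁺ (Res₁-d₁ (proj₁ incY) d1e)
    d2∈T = V2.∈-res₁⁺ q2
    d2∉ : d₂ ∉ res₂ S
    d2∉ m = proj₁ (proj₂ (proj₂ (V2.isPair-res₁ p))) d₂ m d2∈T
    hd = trans isH (exch-∉ e∉)
    p'' = IsPair-swap (subst₂ (IsPair G) (cong proj₁ hd) (cong proj₂ hd) p')
    hs = ForPair.heads-across T S (IsPair-swap p) sde sdf p'' indX incY
    h1 = proj₁ hs
    h2 = proj₁ (proj₂ hs)
    h3 = proj₁ (proj₂ (proj₂ hs))
    h4 = proj₂ (proj₂ (proj₂ hs))

  merge = V1.merge

  merge-pair : ∀ {A B A' B' : Subset (E G₁)} {C D C' D' : Subset (E G₂)}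
    → (A , B) ≡ (A' , B') → (C , D) ≡ (C' , D') → (merge A C , merge B D) ≡ (merge A' C' , merge B' D')
  merge-pair refl refl = refl

  merge-removeAdd : ∀ {e e1 f f1} → On₁ e e1 → On₁ f f1 → ∀ A1 A2 → merge (removeAdd A1 e1 f1) A2 ≡ removeAdd (merge A1 A2) e f
  merge-removeAdd {f = f} sde sdf A1 A2 = trans (V1.merge-update₁ sdf inside (A1 [ _ ]≔ outside) A2) (cong (_[ f ]≔ inside) (V1.merge-update₁ sde outside A1 A2))
  merge-addRemove : ∀ {e e1 f f1} → On₁ e e1 → On₁ f f1 → ∀ A1 A2 → merge (addRemove A1 e1 f1) A2 ≡ addRemove (merge A1 A2) e f
  merge-addRemove {f = f} sde sdf A1 A2 = trans (V1.merge-update₁ sdf outside (A1 [ _ ]≔ inside) A2) (cong (_[ f ]≔ outside) (V1.merge-update₁ sde inside A1 A2))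

  merge-update-across : ∀ {e e1 f f2} → On₁ e e1 → On₂ f f2 → ∀ b b' c c' A1 A2
    → merge ((A1 [ e1 ]≔ b) [ d₁ ]≔ c) ((A2 [ d₂ ]≔ c') [ f2 ]≔ b') ≡ ((merge A1 A2) [ e ]≔ b) [ f ]≔ b'
  merge-update-across {f = f} sde sdf b b' c c' A1 A2 =
    trans (V1.merge-update₂ sdf b' _ _) (cong (_[ f ]≔ b')
      (trans (V1.merge-update-d₂ c' _ _) (trans (V1.merge-update-d₁ c _ _) (V1.merge-update₁ sde b A1 A2))))

  arc-same-side⇐ : ∀ {S1 T1 S2 T2 S1' T1' S2' T2' e e1 f f1} → On₁ e e1 → On₁ f f1
    → (p1 : IsPair G₁ S1 T1) (p2 : IsPair G₂ S2 T2) (ok : ¬ ((d₁ ∈ S1 × d₂ ∈ S2) ⊎ (d₁ ∈ T1 × d₂ ∈ T2)))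
    → ArcCond G₁ S1 T1 e1 f1 → (S1' , T1') ≡ exch e1 f1 (S1 , T1) → (S2' , T2') ≡ (S2 , T2)
    → ArcCond G (merge S1 S2) (merge T1 T2) e f × (merge S1' S2' , merge T1' T2') ≡ exch e f (merge S1 S2 , merge T1 T2)
  arc-same-side⇐ {S1} {T1} {S2} {T2} {S1'} {T1'} {S2'} {T2'} {e} {e1} {f} {f1} sde sdf p1 p2 ok (inj₁ (e1S , f1T , U)) hd1 hd2 =
    inj₁ (e∈ , V1.∈-merge⁺ (inj₁ (f1 , sdf , f1T)) , ForPair.uniqueEx-same-side⇐ (merge S1 S2) (merge T1 T2) P sde sdf U')
    , trans (merge-pair (trans hd1 (exch-∈ e1S)) hd2) (trans (cong₂ _,_ (merge-removeAdd sde sdf S1 S2) (merge-addRemove sde sdf T1 T2)) (sym (exch-∈ e∈)))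
    where
    P = isPair-merge p1 p2 ok
    cf = oneVirtual p1 p2 ok
    eqS = res₁-merge (proj₁ p1) (proj₁ p2) (proj₁ cf)
    eqT = res₁-merge (proj₁ (proj₂ p1)) (proj₁ (proj₂ p2)) (proj₂ cf)
    U' = subst₂ (λ A B → UniqueEx G₁ A B e1 f1) (sym eqS) (sym eqT) U
    e∈ = V1.∈-merge⁺ (inj₁ (e1 , sde , e1S))
  arc-same-side⇐ {S1} {T1} {S2} {T2} {S1'} {T1'} {S2'} {T2'} {e} {e1} {f} {f1} sde sdf p1 p2 ok (inj₂ (e1T , f1S , U)) hd1 hd2 =
    inj₂ (V1.∈-merge⁺ (inj₁ (e1 , sde , e1T)) , V1.∈-merge⁺ (inj₁ (f1 , sdf , f1S)) , ForPair.uniqueEx-same-side⇐ (merge T1 T2) (merge S1 S2) (IsPair-swap P) sde sdf U')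
    , trans (merge-pair (trans hd1 (exch-∉ e1∉)) hd2) (trans (cong₂ _,_ (merge-addRemove sde sdf S1 S2) (merge-removeAdd sde sdf T1 T2)) (sym (exch-∉ e∉)))
    where
    P = isPair-merge p1 p2 ok
    cf = oneVirtual p1 p2 ok
    eqS = res₁-merge (proj₁ p1) (proj₁ p2) (proj₁ cf)
    eqT = res₁-merge (proj₁ (proj₂ p1)) (proj₁ (proj₂ p2)) (proj₂ cf)
    U' = subst₂ (λ A B → UniqueEx G₁ A B e1 f1) (sym eqT) (sym eqS) U
    e1∉ : e1 ∉ S1
    e1∉ m = proj₁ (proj₂ (proj₂ p1)) e1 m e1T
    e∉ : e ∉ merge S1 S2
    e∉ m with V1.∈-merge⁻ m
    ... | inj₁ (x , sd , mx) = e1∉ (subst (_∈ S1) (On₁-functional sd sde) mx)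
    ... | inj₂ (x , sd , _) = On₁₂-disjoint sde sd

  arc-across⇐ : ∀ {S1 T1 S2 T2 S1' T1' S2' T2' e e1 f f2} → On₁ e e1 → On₂ f f2
    → (p1 : IsPair G₁ S1 T1) (p2 : IsPair G₂ S2 T2) (ok : ¬ ((d₁ ∈ S1 × d₂ ∈ S2) ⊎ (d₁ ∈ T1 × d₂ ∈ T2)))
    → ArcCond G₁ S1 T1 e1 d₁ → ArcCond G₂ S2 T2 d₂ f2
    → (S1' , T1') ≡ exch e1 d₁ (S1 , T1) → (S2' , T2') ≡ exch d₂ f2 (S2 , T2)
    → ArcCond G (merge S1 S2) (merge T1 T2) e f × (merge S1' S2' , merge T1' T2') ≡ exch e f (merge S1 S2 , merge T1 T2)
  arc-across⇐ {S1} {T1} {S2} {T2} {S1'} {T1'} {S2'} {T2'} {e} {e1} {f} {f2} sde sdf p1 p2 ok (inj₁ (e1S , d1T , U1)) (inj₁ (d2S , f2T , U2)) hd1 hd2 =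
    inj₁ (e∈ , V1.∈-merge⁺ (inj₂ (f2 , sdf , f2T)) , ForPair.uniqueEx-across⇐ (merge S1 S2) (merge T1 T2) P sde sdf U1' U2')
    , trans (merge-pair (trans hd1 (exch-∈ e1S)) (trans hd2 (exch-∈ d2S)))
        (trans (cong₂ _,_ (merge-update-across sde sdf outside inside inside outside S1 S2) (merge-update-across sde sdf inside outside outside inside T1 T2)) (sym (exch-∈ e∈)))
    where
    P = isPair-merge p1 p2 ok
    cf = oneVirtual p1 p2 ok
    eqS1 = res₁-merge (proj₁ p1) (proj₁ p2) (proj₁ cf)
    eqT1 = res₁-merge (proj₁ (proj₂ p1)) (proj₁ (proj₂ p2)) (proj₂ cf)
    eqS2 = res₂-merge (proj₁ p1) (proj₁ p2) (proj₁ cf)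
    eqT2 = res₂-merge (proj₁ (proj₂ p1)) (proj₁ (proj₂ p2)) (proj₂ cf)
    U1' = subst₂ (λ A B → UniqueEx G₁ A B e1 d₁) (sym eqS1) (sym eqT1) U1
    U2' = subst₂ (λ A B → UniqueEx G₂ A B d₂ f2) (sym eqS2) (sym eqT2) U2
    e∈ = V1.∈-merge⁺ (inj₁ (e1 , sde , e1S))
  arc-across⇐ {S1} {T1} {S2} {T2} {S1'} {T1'} {S2'} {T2'} {e} {e1} {f} {f2} sde sdf p1 p2 ok (inj₂ (e1T , d1S , U1)) (inj₂ (d2T , f2S , U2)) hd1 hd2 =
    inj₂ (V1.∈-merge⁺ (inj₁ (e1 , sde , e1T)) , V1.∈-merge⁺ (inj₂ (f2 , sdf , f2S)) , ForPair.uniqueEx-across⇐ (merge T1 T2) (merge S1 S2) (IsPair-swap P) sde sdf U1' U2')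
    , trans (merge-pair (trans hd1 (exch-∉ e1∉)) (trans hd2 (exch-∉ d2∉)))
        (trans (cong₂ _,_ (merge-update-across sde sdf inside outside outside inside S1 S2) (merge-update-across sde sdf outside inside inside outside T1 T2)) (sym (exch-∉ e∉)))
    where
    P = isPair-merge p1 p2 ok
    cf = oneVirtual p1 p2 ok
    eqS1 = res₁-merge (proj₁ p1) (proj₁ p2) (proj₁ cf)
    eqT1 = res₁-merge (proj₁ (proj₂ p1)) (proj₁ (proj₂ p2)) (proj₂ cf)
    eqS2 = res₂-merge (proj₁ p1) (proj₁ p2) (proj₁ cf)
    eqT2 = res₂-merge (proj₁ (proj₂ p1)) (proj₁ (proj₂ p2)) (proj₂ cf)
    U1' = subst₂ (λ A B → UniqueEx G₁ A B e1 d₁) (sym eqT1) (sym eqS1) U1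
    U2' = subst₂ (λ A B → UniqueEx G₂ A B d₂ f2) (sym eqT2) (sym eqS2) U2
    e1∉ : e1 ∉ S1
    e1∉ m = proj₁ (proj₂ (proj₂ p1)) e1 m e1T
    d2∉ : d₂ ∉ S2
    d2∉ m = proj₁ (proj₂ (proj₂ p2)) d₂ m d2T
    e∉ : e ∉ merge S1 S2
    e∉ m with V1.∈-merge⁻ m
    ... | inj₁ (x , sd , mx) = e1∉ (subst (_∈ S1) (On₁-functional sd sde) mx)
    ... | inj₂ (x , sd , _) = On₁₂-disjoint sde sd
  arc-across⇐ sde sdf p1 p2 ok (inj₁ (_ , d1T , _)) (inj₂ (d2T , _ , _)) hd1 hd2 = ⊥-elim (ok (inj₂ (d1T , d2T)))
  arc-across⇐ sde sdf p1 p2 ok (inj₂ (_ , d1S , _)) (inj₁ (d2S , _ , _)) hd1 hd2 = ⊥-elim (ok (inj₁ (d1S , d2S)))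

module Isomorphism {G G₁ G₂ d₁ d₂} (cs : CliqueSum G G₁ G₂ d₁ d₂) (b₁ : Bispanning G₁) (b₂ : Bispanning G₂) where
  open VertexBijection cs b₁ b₂
  open CliqueSum cs
  module Arcs₁ = ArcTransfer cs b₁ b₂
  module Arcs₂ = ArcTransfer (swapSides cs) b₂ b₁

  sideOf : Fin (E G) → Fin (E G₁) ⊎ Fin (E G₂)
  sideOf e = Sum.map proj₁ proj₁ (side e)

  sideOf-On₁ : ∀ {e x} → On₁ e x → sideOf e ≡ inj₁ x
  sideOf-On₁ {e} sd with side e
  ... | inj₁ (y , sd') = cong inj₁ (On₁-functional sd' sd)
  ... | inj₂ (y , sd') = ⊥-elim (On₁₂-disjoint sd sd')
  sideOf-On₂ : ∀ {e x} → On₂ e x → sideOf e ≡ inj₂ x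
  sideOf-On₂ {e} sd with side e
  ... | inj₂ (y , sd') = cong inj₂ (On₂-functional sd' sd)
  ... | inj₁ (y , sd') = ⊥-elim (On₁₂-disjoint sd' sd)

  NotVirtual : Fin (E G₁) ⊎ Fin (E G₂) → Set
  NotVirtual (inj₁ x) = x ≢ d₁
  NotVirtual (inj₂ x) = x ≢ d₂

  edgeOf : (z : Fin (E G₁) ⊎ Fin (E G₂)) → .(NotVirtual z) → Fin (E G)
  edgeOf (inj₁ x) nd with x ≟ d₁
  ... | yes eq = ⊥-elim-irr (nd eq)
  ... | no ne = proj₁ (surj₁ x ne)
  edgeOf (inj₂ x) nd with x ≟ d₂
  ... | yes eq = ⊥-elim-irr (nd eq)
  ... | no ne = proj₁ (surj₂ x ne)

  edgeOf-On₁ : ∀ x .(nd : x ≢ d₁) → On₁ (edgeOf (inj₁ x) nd) x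
  edgeOf-On₁ x nd with x ≟ d₁
  ... | yes eq = ⊥-elim-irr (nd eq)
  ... | no ne = proj₂ (surj₁ x ne)
  edgeOf-On₂ : ∀ x .(nd : x ≢ d₂) → On₂ (edgeOf (inj₂ x) nd) x
  edgeOf-On₂ x nd with x ≟ d₂
  ... | yes eq = ⊥-elim-irr (nd eq)
  ... | no ne = proj₂ (surj₂ x ne)

  sideOf-edgeOf : ∀ z .(nd : NotVirtual z) → sideOf (edgeOf z nd) ≡ z
  sideOf-edgeOf (inj₁ x) nd = sideOf-On₁ (edgeOf-On₁ x nd)
  sideOf-edgeOf (inj₂ x) nd = sideOf-On₂ (edgeOf-On₂ x nd)

  edgeOf-sideOf : ∀ e .(nd : NotVirtual (sideOf e)) → edgeOf (sideOf e) nd ≡ e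
  edgeOf-sideOf e nd with side e
  ... | inj₁ (x , sd) = On₁-injective (edgeOf-On₁ x nd) sd
  ... | inj₂ (x , sd) = On₂-injective (edgeOf-On₂ x nd) sd

  merge-swap : ∀ A1 A2 → SideSubsets.merge (swapSides cs) b₂ b₁ A2 A1 ≡ V1.merge A1 A2
  merge-swap A1 A2 = subset-ext (λ e m → V1.∈-merge⁺ (Sum.swap (SideSubsets.∈-merge⁻ (swapSides cs) b₂ b₁ m)))
                         (λ e m → SideSubsets.∈-merge⁺ (swapSides cs) b₂ b₁ (Sum.swap (V1.∈-merge⁻ m)))

  arc⇒etaArc : ∀ e f S T S' T' (ip : IsPair G S T) (ip' : IsPair G S' T') → ArcCond G S T e f → (S' , T') ≡ exch e f (S , T)
    → EtaArcCond G₁ G₂ d₁ d₂ (sideOf e) (sideOf f) (toEta (tvert S T ip)) (toEta (tvert S' T' ip'))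
  arc⇒etaArc e f S T S' T' ip ip' c h = by-sides (side e) (side f)
    where
    x = toEta (tvert S T ip)
    y = toEta (tvert S' T' ip')
    Et = λ a b → EtaArcCond G₁ G₂ d₁ d₂ a b x y
    by-sides : (∃ (On₁ e)) ⊎ (∃ (On₂ e)) → (∃ (On₁ f)) ⊎ (∃ (On₂ f)) → Et (sideOf e) (sideOf f)
    by-sides (inj₁ (e1 , sde)) (inj₁ (f1 , sdf)) = subst₂ Et (sym (sideOf-On₁ sde)) (sym (sideOf-On₁ sdf)) (Arcs₁.arc-same-side⇒ sde sdf ip ip' h c)
    by-sides (inj₁ (e1 , sde)) (inj₂ (f2 , sdf)) = subst₂ Et (sym (sideOf-On₁ sde)) (sym (sideOf-On₂ sdf)) (Arcs₁.arc-across⇒ sde sdf ip ip' h c)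
    by-sides (inj₂ (e2 , sde)) (inj₂ (f2 , sdf)) = subst₂ Et (sym (sideOf-On₂ sde)) (sym (sideOf-On₂ sdf))
        (let (a , n1 , n2 , h2 , h1) = Arcs₂.arc-same-side⇒ sde sdf ip ip' h c in a , n1 , n2 , h1 , h2)
    by-sides (inj₂ (e2 , sde)) (inj₁ (f1 , sdf)) = subst₂ Et (sym (sideOf-On₂ sde)) (sym (sideOf-On₁ sdf))
        (let (a2 , a1 , h2 , h1) = Arcs₂.arc-across⇒ sde sdf ip ip' h c in a2 , a1 , h1 , h2)

  etaArc-avoids-d : ∀ e' f' S1 T1 S2 T2 (ip1 : IsPair G₁ S1 T1) (ip2 : IsPair G₂ S2 T2) ok y
    → EtaArcCond G₁ G₂ d₁ d₂ e' f' (evert (tvert S1 T1 ip1) (tvert S2 T2 ip2) ok) y → NotVirtual e' × NotVirtual f'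
  etaArc-avoids-d (inj₁ e1) (inj₁ f1) S1 T1 S2 T2 ip1 ip2 ok y (_ , n1 , n2 , _) = n1 , n2
  etaArc-avoids-d (inj₂ e2) (inj₂ f2) S1 T1 S2 T2 ip1 ip2 ok y (_ , n1 , n2 , _) = n1 , n2
  etaArc-avoids-d (inj₁ e1) (inj₂ f2) S1 T1 S2 T2 ip1 ip2 ok y (ac1 , ac2 , _) =
    arc-ends-distinct (proj₁ (proj₂ (proj₂ ip1))) ac1 , λ eq → arc-ends-distinct (proj₁ (proj₂ (proj₂ ip2))) ac2 (sym eq)
  etaArc-avoids-d (inj₂ e2) (inj₁ f1) S1 T1 S2 T2 ip1 ip2 ok y (ac2 , ac1 , _) =
    arc-ends-distinct (proj₁ (proj₂ (proj₂ ip2))) ac2 , λ eq → arc-ends-distinct (proj₁ (proj₂ (proj₂ ip1))) ac1 (sym eq)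

  arc-cong : ∀ {e f} {A B A' B' C D C' D' : Subset (E G)} → A ≡ C → B ≡ D → A' ≡ C' → B' ≡ D'
    → ArcCond G A B e f × (A' , B') ≡ exch e f (A , B) → ArcCond G C D e f × (C' , D') ≡ exch e f (C , D)
  arc-cong refl refl refl refl x = x

  etaArc⇒arc : ∀ e' f' S1 T1 S2 T2 S1' T1' S2' T2' (ip1 : IsPair G₁ S1 T1) (ip2 : IsPair G₂ S2 T2) ok ip1' ip2' ok'
    .(nd1 : NotVirtual e') .(nd2 : NotVirtual f')
    → EtaArcCond G₁ G₂ d₁ d₂ e' f' (evert (tvert S1 T1 ip1) (tvert S2 T2 ip2) ok) (evert (tvert S1' T1' ip1') (tvert S2' T2' ip2') ok')
    → ArcCond G (V1.merge S1 S2) (V1.merge T1 T2) (edgeOf e' nd1) (edgeOf f' nd2)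
      × (V1.merge S1' S2' , V1.merge T1' T2') ≡ exch (edgeOf e' nd1) (edgeOf f' nd2) (V1.merge S1 S2 , V1.merge T1 T2)
  etaArc⇒arc (inj₁ e1) (inj₁ f1) S1 T1 S2 T2 S1' T1' S2' T2' ip1 ip2 ok ip1' ip2' ok' nd1 nd2 (ac , _ , _ , h1 , h2) =
    Arcs₁.arc-same-side⇐ (edgeOf-On₁ e1 nd1) (edgeOf-On₁ f1 nd2) ip1 ip2 ok ac h1 h2
  etaArc⇒arc (inj₁ e1) (inj₂ f2) S1 T1 S2 T2 S1' T1' S2' T2' ip1 ip2 ok ip1' ip2' ok' nd1 nd2 (ac1 , ac2 , h1 , h2) =
    Arcs₁.arc-across⇐ (edgeOf-On₁ e1 nd1) (edgeOf-On₂ f2 nd2) ip1 ip2 ok ac1 ac2 h1 h2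
  etaArc⇒arc (inj₂ e2) (inj₂ f2) S1 T1 S2 T2 S1' T1' S2' T2' ip1 ip2 ok ip1' ip2' ok' nd1 nd2 (ac , _ , _ , h1 , h2) =
    arc-cong (merge-swap S1 S2) (merge-swap T1 T2) (merge-swap S1' S2') (merge-swap T1' T2')
      (Arcs₂.arc-same-side⇐ (edgeOf-On₂ e2 nd1) (edgeOf-On₂ f2 nd2) ip2 ip1 (λ z → ok (Sum.map (λ (a , b) → b , a) (λ (a , b) → b , a) z)) ac h2 h1)
  etaArc⇒arc (inj₂ e2) (inj₁ f1) S1 T1 S2 T2 S1' T1' S2' T2' ip1 ip2 ok ip1' ip2' ok' nd1 nd2 (ac2 , ac1 , h1 , h2) =
    arc-cong (merge-swap S1 S2) (merge-swap T1 T2) (merge-swap S1' S2') (merge-swap T1' T2')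
      (Arcs₂.arc-across⇐ (edgeOf-On₂ e2 nd1) (edgeOf-On₁ f1 nd2) ip2 ip1 (λ z → ok (Sum.map (λ (a , b) → b , a) (λ (a , b) → b , a) z)) ac2 ac1 h2 h1)

  arcTo : TArc G → EArc G₁ G₂ d₁ d₂
  arcTo record { e = e ; f = f ; from = tvert S T ip ; to = tvert S' T' ip' ; cond = c ; isHead = h } =
    record { e = sideOf e ; f = sideOf f ; from = toEta (tvert S T ip) ; to = toEta (tvert S' T' ip') ; cond = arc⇒etaArc e f S T S' T' ip ip' c h }

  arcFrom : EArc G₁ G₂ d₁ d₂ → TArc G
  arcFrom record { e = e' ; f = f' ; from = evert (tvert S1 T1 ip1) (tvert S2 T2 ip2) ok ; to = evert (tvert S1' T1' ip1') (tvert S2' T2' ip2') ok' ; cond = c } =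
    record { e = edgeOf e' (proj₁ (etaArc-avoids-d e' f' S1 T1 S2 T2 ip1 ip2 ok _ c))
           ; f = edgeOf f' (proj₂ (etaArc-avoids-d e' f' S1 T1 S2 T2 ip1 ip2 ok _ c))
           ; from = fromEta (evert (tvert S1 T1 ip1) (tvert S2 T2 ip2) ok)
           ; to = fromEta (evert (tvert S1' T1' ip1') (tvert S2' T2' ip2') ok')
           ; cond = proj₁ (etaArc⇒arc e' f' S1 T1 S2 T2 S1' T1' S2' T2' ip1 ip2 ok ip1' ip2' ok' _ _ c)
           ; isHead = proj₂ (etaArc⇒arc e' f' S1 T1 S2 T2 S1' T1' S2' T2' ip1 ip2 ok ip1' ip2' ok' _ _ c) }

  tarc-eq : ∀ {e e' f f' x x' y y'} .{c c' h h'} → e ≡ e' → f ≡ f' → x ≡ x' → y ≡ y'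
    → record { e = e ; f = f ; from = x ; to = y ; cond = c ; isHead = h } ≡ (TArc G ∋ record { e = e' ; f = f' ; from = x' ; to = y' ; cond = c' ; isHead = h' })
  tarc-eq refl refl refl refl = refl

  earc-eq : ∀ {e e' f f' x x' y y'} .{c c'} → e ≡ e' → f ≡ f' → x ≡ x' → y ≡ y'
    → record { e = e ; f = f ; from = x ; to = y ; cond = c } ≡ (EArc G₁ G₂ d₁ d₂ ∋ record { e = e' ; f = f' ; from = x' ; to = y' ; cond = c' })
  earc-eq refl refl refl refl = refl

  arcFrom-arcTo : ∀ a → arcFrom (arcTo a) ≡ a
  arcFrom-arcTo record { e = e ; f = f ; from = tvert S T ip ; to = tvert S' T' ip' ; cond = c ; isHead = h } =
    tarc-eq (edgeOf-sideOf e _) (edgeOf-sideOf f _) (fromEta-toEta (tvert S T ip)) (fromEta-toEta (tvert S' T' ip'))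

  arcTo-arcFrom : ∀ b → arcTo (arcFrom b) ≡ b
  arcTo-arcFrom record { e = e' ; f = f' ; from = evert (tvert S1 T1 ip1) (tvert S2 T2 ip2) ok ; to = evert (tvert S1' T1' ip1') (tvert S2' T2' ip2') ok' ; cond = c } =
    earc-eq (sideOf-edgeOf e' _) (sideOf-edgeOf f' _) (toEta-fromEta (evert (tvert S1 T1 ip1) (tvert S2 T2 ip2) ok)) (toEta-fromEta (evert (tvert S1' T1' ip1') (tvert S2' T2' ip2') ok'))

  tail-pres : ∀ a → EArc.from (arcTo a) ≡ toEta (TArc.from a)
  tail-pres record { e = e ; f = f ; from = tvert S T ip ; to = tvert S' T' ip' ; cond = c ; isHead = h } = refl
  head-pres : ∀ a → EArc.to (arcTo a) ≡ toEta (TArc.to a)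
  head-pres record { e = e ; f = f ; from = tvert S T ip ; to = tvert S' T' ip' ; cond = c ; isHead = h } = refl

  iso : tau3 G ≅ eta G₁ G₂ d₁ d₂
  iso = record { vmap = ↔⇒⤖ (mk↔ₛ′ toEta fromEta toEta-fromEta fromEta-toEta) ; amap = ↔⇒⤖ (mk↔ₛ′ arcTo arcFrom arcTo-arcFrom arcFrom-arcTo) ; tailPres = tail-pres ; headPres = head-pres }

mainTheorem2 : (G G₁ G₂ : Graph) (d₁ : Fin (E G₁)) (d₂ : Fin (E G₂))
    → Atomic G → VertexConnectivity G 2
    → Simple G₁ → Bispanning G₁ → Simple G₂ → Bispanning G₂
    → IsTwoCliqueSum G G₁ G₂ d₁ d₂
    → tau3 G ≅ eta G₁ G₂ d₁ d₂
mainTheorem2 G G₁ G₂ d₁ d₂ _ _ _ b₁ _ b₂ t = Isomorphism.iso (fromIsTwoCliqueSum t) b₁ b₂
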